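{- For all $n\ge0$, $$B_{n+1}=\sum_{k=0}^{n}\frac{n-k+1}{n+1}\,H_{n-k+1}\,B_k.$$
   Context: Let $\Lambda$ be the ring of symmetric functions over $\mathbb{Q}$ in variables $X=(x_1,x_2,\ldots)$, completed with respect to degree; $h_n$, $p_\lambda$ denote complete homogeneous and power sum symmetric functions. Plethysm: for a formal power series $A$ in the $x_i$ and an auxiliary variable $t$, $p_k(A)$ is obtained from $A$ by replacing every variable by its $k$-th power, and $F(A)$ for $F\in\Lambda$ is obtained by substituting $p_k\mapsto p_k(A)$ (used when $A$ has zero constant term). The alphabet $tX$ means $(tx_1,tx_2,\ldots)$. $\Omega(X)=\sum_{n\ge0}h_n(X)$, $\Omega_0(X)=\Omega(X)-1$. The Bell symmetric functions $B_n$ are defined by $\Omega(\Omega_0(tX))=\sum_{n\ge0}B_n(X)t^n$. For a partition $\lambda$, $\ell(\lambda)$ is the number of parts, $\gcd(\lambda)$ the gcd of its parts, $z_\lambda=\prod_j m_j(\lambda)!\,j^{m_j(\lambda)}$ with $m_j(\lambda)$ the number of parts equal to $j$, and $\sigma_r(k)=\sum_{d\mid k}d^r$. For $n\ge1$, $H_n=\sum_{\lambda\vdash n}\frac{\sigma_{\ell(\lambda)-1}(\gcd(\lambda))}{z_\lambda}p_\lambda$. -}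

module Defs where

open import Data.Nat as ℕ using (ℕ; zero; suc; _∸_)
open import Data.Nat.GCD using (gcd)
open import Data.Nat.Divisibility using (_∣?_)
open import Data.Nat.ListAction using (sum; product)
open import Data.Integer using (+_)
open import Data.Rational using (ℚ; 0ℚ; 1ℚ; _+_; _*_; _/_)
open import Data.List using (List; []; _∷_; map; concatMap; foldr; length; filter; upTo; applyUpTo; _++_)
open import Data.List.Properties using (≡-dec)
open import Data.Product using (_×_; _,_)
open import Relation.Nullary using (yes; no)
open import Relation.Binary.PropositionalEquality using (_≡_)

-- Rationals a/d for natural numbers (convention: d = 0 gives 0; it is
-- only ever applied with d ≥ 1).

divℕ : ℕ → ℕ → ℚ
divℕ a zero    = 0ℚ
divℕ a (suc d) = (+ a) / suc d

-- Λ_ℚ presented as the polynomial ring ℚ[p₁,p₂,…] in the power sums.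
-- A monomial p_λ = p_{λ₁} p_{λ₂} ⋯ is a list of parts (read as a
-- multiset); a polynomial is a finite formal ℚ-linear combination of
-- monomials.

Monomial : Set
Monomial = List ℕ

Poly : Set
Poly = List (ℚ × Monomial)

insert : ℕ → List ℕ → List ℕ
insert x [] = x ∷ []
insert x (y ∷ ys) with y ℕ.≤? x
... | yes _ = x ∷ y ∷ ys
... | no  _ = y ∷ insert x ys

sortDesc : List ℕ → List ℕ
sortDesc = foldr insert []

coeff : Poly → Monomial → ℚ
coeff [] μ = 0ℚ
coeff ((c , m) ∷ f) μ with ≡-dec ℕ._≟_ (sortDesc m) (sortDesc μ)
... | yes _ = c + coeff f μ
... | no  _ = coeff f μ

infix 4 _≈ᴾ_
_≈ᴾ_ : Poly → Poly → Set
f ≈ᴾ g = ∀ μ → coeff f μ ≡ coeff g μ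

0ᴾ : Poly
0ᴾ = []

1ᴾ : Poly
1ᴾ = (1ℚ , []) ∷ []

infixl 6 _+ᴾ_
_+ᴾ_ : Poly → Poly → Poly
_+ᴾ_ = _++_

infixl 7 _*ᴾ_
_*ᴾ_ : Poly → Poly → Poly
f *ᴾ g = concatMap (λ { (c , m) → map (λ { (d , n) → (c * d , m ++ n) }) g }) f

scale : ℚ → Poly → Poly
scale a = map (λ { (c , m) → (a * c , m) })

sumᴾ : List Poly → Poly
sumᴾ = foldr _+ᴾ_ 0ᴾ

pλ : Monomial → Poly
pλ l = (1ℚ , l) ∷ []

-- p_k[f] for f ∈ Λ: replace each x_i by x_i^k, i.e. p_j ↦ p_{kj}
adams : ℕ → Poly → Poly
adams k = map (λ { (c , m) → (c , map (k ℕ.*_) m) })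

-- Formal power series in t with coefficients in Λ (the coefficient of t^N).

Series : Set
Series = ℕ → Poly

1ˢ : Series
1ˢ zero    = 1ᴾ
1ˢ (suc _) = 0ᴾ

_*ˢ_ : Series → Series → Series
(A *ˢ B) N = sumᴾ (map (λ i → A i *ᴾ B (N ∸ i)) (upTo (suc N)))

prodˢ : List Series → Series
prodˢ = foldr _*ˢ_ 1ˢ

-- p_k(A): replace every variable (the x_i and t) by its k-th power.
-- (k = 0 never occurs; convention 0.)
pS : ℕ → Series → Series
pS zero    A N = 0ᴾ
pS (suc j) A N with suc j ∣? N
... | yes _ = adams (suc j) (A (N ℕ./ suc j))
... | no  _ = 0ᴾ

-- F(A) for a polynomial F in the p's: substitute p_k ↦ p_k(A)
substP : Poly → Series → Series
substP f A N =
  sumᴾ (map (λ { (c , m) → scale c (prodˢ (map (λ k → pS k A) m) N) }) f)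

-- An element of the completed Λ, given by its homogeneous components.
GSym : Set
GSym = ℕ → Poly

-- Plethysm F(A) = Σₙ Fₙ(A) for A with zero constant term in t
-- (then Fₙ(A) only contributes to t^N for n ≤ N).
pleth : GSym → Series → Series
pleth F A N = sumᴾ (map (λ n → substP (F n) A N) (upTo (suc N)))

-- partitions of n with all parts ≤ m, as non-increasing lists (fuel f)
partsF : ℕ → ℕ → ℕ → List (List ℕ)
partsF _       zero    m = [] ∷ []
partsF zero    (suc n) m = []
partsF (suc f) (suc n) m =
  concatMap (λ k → map (k ∷_) (partsF f (suc n ∸ k) k))
            (filter (λ k → k ℕ.≤? m) (applyUpTo suc (suc n)))

partitions : ℕ → List (List ℕ)
partitions n = partsF n n n

mult : ℕ → List ℕ → ℕ
mult j l = length (filter (λ x → x ℕ.≟ j) l)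

z : List ℕ → ℕ
z l = product (map (λ j → (mult j l) ℕ.! ℕ.* (j ℕ.^ mult j l)) (applyUpTo suc (sum l)))

gcdL : List ℕ → ℕ
gcdL = foldr gcd 0

σ : ℕ → ℕ → ℕ
σ r k = sum (map (λ d → d ℕ.^ r) (filter (λ d → d ∣? k) (applyUpTo suc k)))

h : ℕ → Poly
h n = sumᴾ (map (λ l → scale (divℕ 1 (z l)) (pλ l)) (partitions n))

H : ℕ → Poly
H n = sumᴾ (map (λ l → scale (divℕ (σ (length l ∸ 1) (gcdL l)) (z l)) (pλ l))
                (partitions n))

Ωg : GSym
Ωg n = h n

Ω₀g : GSym
Ω₀g zero    = 0ᴾ
Ω₀g (suc n) = h (suc n)

tX : Series
tX (suc zero) = pλ (1 ∷ [])
tX _          = 0ᴾ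

B : ℕ → Poly
B = pleth Ωg (pleth Ω₀g tX)

-- Write A = Ω₀(tX) = Σ_{n≥1} hₙ tⁿ, so that Σₙ Bₙ tⁿ = Ω(A), and let θ = t d/dt. Working in the
-- power-sum variables, the chain rule for f ↦ f(A) together with ∂hⱼ/∂pₖ = h_{j-k}/k gives
-- θ Ω(A) = (Σₖ θpₖ(A)/k) Ω(A), the logarithmic derivative of Ω(A) = exp(Σₖ pₖ(A)/k).
-- In degree i ≥ 1 the series Σₖ pₖ(A)/k = Σₖ pₖ[Ω₀]/k has coefficient Hᵢ: the coefficient of p_μ
-- in pₖ[h_{i/k}] is 1/z_{μ/k} = k^{ℓ(μ)}/z_μ when k divides every part of μ, and summing k^{ℓ(μ)-1}
-- over the divisors k of gcd(μ) gives σ_{ℓ(μ)-1}(gcd μ). Comparing coefficients of t^{n+1} in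
-- θB = (Σᵢ i Hᵢ tⁱ) B yields (n+1) B_{n+1} = Σᵢ i Hᵢ B_{n+1-i}.

module Submission where

open import Defs
open import Data.Bool using (if_then_else_)
open import Data.Empty using (⊥; ⊥-elim)
import Data.Integer as ℤ
import Data.Integer.Properties as ℤ
open import Data.List using (List; []; _∷_; _++_; map; concat; concatMap; filter; length; upTo; applyUpTo)
open import Data.List.Properties
  using (≡-dec; upTo-∷ʳ; map-upTo; applyUpTo-∷ʳ; ++-assoc; ++-identityʳ; map-++; map-∘; concat-++; concatMap-++;
         length-map; length-filter; filter-accept; filter-reject; ∷-injectiveˡ; ∷-injectiveʳ)
open import Data.List.Membership.Propositional using (_∈_; _∉_)
open import Data.List.Membership.Propositional.Properties using (∈-∃++)
open import Data.List.Relation.Binary.Equality.Propositional using (≋⇒≡)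
open import Data.List.Relation.Binary.Permutation.Propositional as ↭ using (_↭_; prep; swap; ↭-refl; ↭-sym; ↭-trans; ↭⇒↭ₛ)
open import Data.List.Relation.Binary.Permutation.Propositional.Properties
  using (filter-↭; ↭-length; drop-∷; shift; ∈-resp-↭; ¬x∷xs↭[]; ++⁺ʳ; ++-comm; All-resp-↭)
  renaming (map⁺ to ↭-map⁺)
open import Data.List.Relation.Unary.All as All using (All; []; _∷_)
import Data.List.Relation.Unary.All.Properties as Allₚ
open import Data.List.Relation.Unary.Any using (here; there)
open import Data.List.Relation.Unary.Linked using ([]; [-]; _∷_)
import Data.List.Relation.Unary.Linked as Linked
open import Data.List.Relation.Unary.Linked.Properties using (Linked⇒All)
open import Data.List.Relation.Unary.Sorted.TotalOrder using (Sorted)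
open import Data.List.Relation.Unary.Sorted.TotalOrder.Properties using (↗↭↗⇒≋)
import Data.List.Sort.InsertionSort.Base as InsertionSort
import Data.List.Sort.InsertionSort.Properties as InsertionSortₚ
open import Data.Nat as ℕ using (ℕ; zero; suc; _≤_; _<_; _∸_; z≤n; s≤s; _≟_; _≤?_; _<?_; _^_; _!; NonZero)
import Data.Nat.Properties as ℕ
open import Data.List.Membership.DecPropositional _≟_ using (_∈?_)
open import Data.Nat.Divisibility using (_∣_; _∣?_; divides; ∣-trans; _∣0; ∣m∣n⇒∣m+n; ∣⇒≤; m∣m*n)
open import Data.Nat.DivMod using (m/n*n≡m; m*n/n≡m; m*[n/m]≡n)
open import Data.Nat.GCD using (gcd; gcd-comm; gcd-assoc; gcd[m,n]∣m; gcd[m,n]∣n; gcd-greatest; gcd[m,n]≡0⇒m≡0)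
open import Data.Nat.ListAction using (sum; product)
open import Data.Nat.ListAction.Properties using (sum-↭; product-++; product≢0)
open import Data.Nat.Solver renaming (module +-*-Solver to ℕ-Solver)
open import Data.Product using (_×_; _,_; proj₁; proj₂; ∃)
open import Data.Rational as ℚ using (ℚ; 0ℚ; 1ℚ; _+_; _*_; fromℚᵘ)
import Data.Rational.Properties as ℚ
open import Data.Rational.Solver renaming (module +-*-Solver to ℚ-Solver)
open import Data.Rational.Unnormalised as ℚᵘ using (mkℚᵘ; *≡*)
import Data.Rational.Unnormalised.Properties as ℚᵘ
open import Data.Sum using (inj₁; inj₂)
open import Function using (_∘_; id)
open import Relation.Binary.Bundles using (Setoid; DecTotalOrder)
open import Relation.Binary.Properties.DecTotalOrder ℕ.≤-decTotalOrder using (≥-decTotalOrder)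
import Relation.Binary.Reasoning.Setoid
open import Relation.Nullary using (Dec; yes; no; ¬_; ¬?; does)
open import Relation.Nullary.Decidable using (_×-dec_; map′; dec-true; dec-false)
open import Relation.Binary.PropositionalEquality
import Relation.Binary.PropositionalEquality as ≡

private
  variable
    I K : Set
    X Y : Set

-- Indicators and finite sums of rationals

when : Dec X → ℚ → ℚ
when d c = if does d then c else 0ℚ

when-yes : (d : Dec X) {c : ℚ} → X → when d c ≡ c
when-yes (yes _) _ = refl
when-yes (no ¬p) p = ⊥-elim (¬p p)

when-no : (d : Dec X) {c : ℚ} → ¬ X → when d c ≡ 0ℚ
when-no (yes p) ¬p = ⊥-elim (¬p p)
when-no (no _)  _  = refl

when-zero : (d : Dec X) → when d 0ℚ ≡ 0ℚ
when-zero (yes _) = refl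
when-zero (no _)  = refl

when-cong : (d : Dec X) {a b : ℚ} → (X → a ≡ b) → when d a ≡ when d b
when-cong (yes p) e = e p
when-cong (no _)  e = refl

when-⇔ : (d : Dec X) (e : Dec Y) (c : ℚ) → (X → Y) → (Y → X) → when d c ≡ when e c
when-⇔ (yes _) (yes _) c _ _ = refl
when-⇔ (yes p) (no ¬q) c f _ = ⊥-elim (¬q (f p))
when-⇔ (no ¬p) (yes q) c _ g = ⊥-elim (¬p (g q))
when-⇔ (no _)  (no _)  c _ _ = refl

when-comm : (d : Dec X) (e : Dec Y) (c : ℚ) → when d (when e c) ≡ when e (when d c)
when-comm (yes _) e       c = refl
when-comm (no _)  (yes _) c = refl
when-comm (no _)  (no _)  c = refl

when-×-dec : (d : Dec X) (e : Dec Y) (c : ℚ) → when (d ×-dec e) c ≡ when d (when e c)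
when-×-dec (yes _) (yes _) c = refl
when-×-dec (yes _) (no _)  c = refl
when-×-dec (no _)  _       c = refl

when²-no : (d : Dec X) (e : Dec Y) (c : ℚ) → (X → Y → ⊥) → when d (when e c) ≡ 0ℚ
when²-no (yes p) (yes q) c absurd = ⊥-elim (absurd p q)
when²-no (yes _) (no _)  c _      = refl
when²-no (no _)  _       c _      = refl

*-when : (d : Dec X) (a c : ℚ) → a * when d c ≡ when d (a * c)
*-when (yes _) a c = refl
*-when (no _)  a c = ℚ.*-zeroʳ a

when-+ : (d : Dec X) (a c : ℚ) → when d (a + c) ≡ when d a + when d c
when-+ (yes _) a c = refl
when-+ (no _)  a c = refl

∑ : List I → (I → ℚ) → ℚ
∑ []       F = 0ℚ
∑ (x ∷ xs) F = F x + ∑ xs F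

syntax ∑ xs (λ x → e) = ∑[ x ∈ xs ] e

∑-++ : (xs ys : List I) (F : I → ℚ) → ∑ (xs ++ ys) F ≡ ∑ xs F + ∑ ys F
∑-++ []       ys F = sym (ℚ.+-identityˡ _)
∑-++ (x ∷ xs) ys F = trans (cong (F x +_) (∑-++ xs ys F)) (sym (ℚ.+-assoc (F x) _ _))

∑-cong : (xs : List I) {F G : I → ℚ} → (∀ x → F x ≡ G x) → ∑ xs F ≡ ∑ xs G
∑-cong []       e = refl
∑-cong (x ∷ xs) e = cong₂ _+_ (e x) (∑-cong xs e)

∑-cong-All : {Q : I → Set} (xs : List I) {F G : I → ℚ} → All Q xs → (∀ {x} → Q x → F x ≡ G x) → ∑ xs F ≡ ∑ xs G
∑-cong-All []       []       e = refl
∑-cong-All (x ∷ xs) (q ∷ qs) e = cong₂ _+_ (e q) (∑-cong-All xs qs e)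


∑-zero : (xs : List I) → ∑[ x ∈ xs ] 0ℚ ≡ 0ℚ
∑-zero []       = refl
∑-zero (x ∷ xs) = trans (ℚ.+-identityˡ _) (∑-zero xs)

∑-distrib-+ : (xs : List I) (F G : I → ℚ) → ∑[ x ∈ xs ] (F x + G x) ≡ ∑ xs F + ∑ xs G
∑-distrib-+ []       F G = refl
∑-distrib-+ (x ∷ xs) F G = trans (cong (F x + G x +_) (∑-distrib-+ xs F G))
  (solve 4 (λ a b c d → (a :+ b) :+ (c :+ d) := (a :+ c) :+ (b :+ d)) refl (F x) (G x) (∑ xs F) (∑ xs G))
  where
  open ℚ-Solver

*-distribˡ-∑ : (xs : List I) (a : ℚ) (F : I → ℚ) → a * ∑ xs F ≡ ∑[ x ∈ xs ] (a * F x)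
*-distribˡ-∑ []       a F = ℚ.*-zeroʳ a
*-distribˡ-∑ (x ∷ xs) a F = trans (ℚ.*-distribˡ-+ a (F x) _) (cong (a * F x +_) (*-distribˡ-∑ xs a F))

∑-comm : (xs : List I) (ys : List K) (F : I → K → ℚ) →
         ∑[ x ∈ xs ] ∑ ys (F x) ≡ ∑[ y ∈ ys ] ∑[ x ∈ xs ] F x y
∑-comm []       ys F = sym (∑-zero ys)
∑-comm (x ∷ xs) ys F = trans (cong (∑ ys (F x) +_) (∑-comm xs ys F)) (sym (∑-distrib-+ ys (F x) _))

∑-map : (f : K → I) (xs : List K) (F : I → ℚ) → ∑ (map f xs) F ≡ ∑ xs (F ∘ f)
∑-map f []       F = refl
∑-map f (x ∷ xs) F = cong (F (f x) +_) (∑-map f xs F)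

∑-concatMap : (g : K → List I) (xs : List K) (F : I → ℚ) →
              ∑ (concatMap g xs) F ≡ ∑[ x ∈ xs ] ∑ (g x) F
∑-concatMap g []       F = refl
∑-concatMap g (x ∷ xs) F = trans (∑-++ (g x) _ F) (cong (∑ (g x) F +_) (∑-concatMap g xs F))

∑-when : (xs : List I) (d : Dec X) (F : I → ℚ) → ∑[ x ∈ xs ] when d (F x) ≡ when d (∑ xs F)
∑-when xs (yes _) F = refl
∑-when xs (no _)  F = ∑-zero xs

∑-filter : {P : I → Set} (P? : ∀ x → Dec (P x)) (xs : List I) (F : I → ℚ) →
           ∑ (filter P? xs) F ≡ ∑[ x ∈ xs ] when (P? x) (F x)
∑-filter P? []       F = refl
∑-filter P? (x ∷ xs) F with P? x
... | yes _ = cong (F x +_) (∑-filter P? xs F)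
... | no _  = trans (∑-filter P? xs F) (sym (ℚ.+-identityˡ _))

∑-applyUpTo-suc : ∀ n (F : ℕ → ℚ) → ∑ (applyUpTo suc n) F ≡ ∑[ i ∈ upTo n ] F (suc i)
∑-applyUpTo-suc n F = trans (cong (λ l → ∑ l F) (sym (map-upTo suc n))) (∑-map suc (upTo n) F)

∑-upTo-sucˡ : ∀ n (F : ℕ → ℚ) → ∑ (upTo (suc n)) F ≡ F 0 + ∑[ i ∈ upTo n ] F (suc i)
∑-upTo-sucˡ n F = cong (F 0 +_) (∑-applyUpTo-suc n F)

∑-upTo-sucʳ : ∀ n (F : ℕ → ℚ) → ∑ (upTo (suc n)) F ≡ ∑ (upTo n) F + F n
∑-upTo-sucʳ n F = begin
  ∑ (upTo (suc n)) F            ≡⟨ cong (λ l → ∑ l F) (upTo-∷ʳ n) ⟨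
  ∑ (upTo n ++ n ∷ []) F        ≡⟨ ∑-++ (upTo n) (n ∷ []) F ⟩
  ∑ (upTo n) F + (F n + 0ℚ)     ≡⟨ cong (∑ (upTo n) F +_) (ℚ.+-identityʳ (F n)) ⟩
  ∑ (upTo n) F + F n            ∎
  where
  open ≡-Reasoning

∑-upTo-cong : ∀ n {F G : ℕ → ℚ} → (∀ i → i < n → F i ≡ G i) → ∑ (upTo n) F ≡ ∑ (upTo n) G
∑-upTo-cong zero    e = refl
∑-upTo-cong (suc n) {F} {G} e = begin
  ∑ (upTo (suc n)) F  ≡⟨ ∑-upTo-sucʳ n F ⟩
  ∑ (upTo n) F + F n  ≡⟨ cong₂ _+_ (∑-upTo-cong n (λ i i<n → e i (ℕ.m≤n⇒m≤1+n i<n))) (e n ℕ.≤-refl) ⟩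
  ∑ (upTo n) G + G n  ≡⟨ ∑-upTo-sucʳ n G ⟨
  ∑ (upTo (suc n)) G  ∎
  where
  open ≡-Reasoning

∑-upTo-zero : ∀ n {F : ℕ → ℚ} → (∀ i → i < n → F i ≡ 0ℚ) → ∑ (upTo n) F ≡ 0ℚ
∑-upTo-zero n e = trans (∑-upTo-cong n e) (∑-zero (upTo n))

∑-upTo-single : ∀ n a (F : ℕ → ℚ) → a < n → (∀ i → i < n → i ≢ a → F i ≡ 0ℚ) → ∑ (upTo n) F ≡ F a
∑-upTo-single (suc n) a F a<1+n e with ℕ.m≤n⇒m<n∨m≡n (ℕ.≤-pred a<1+n)
... | inj₁ a<n = begin
  ∑ (upTo (suc n)) F  ≡⟨ ∑-upTo-sucʳ n F ⟩
  ∑ (upTo n) F + F n  ≡⟨ cong₂ _+_ (∑-upTo-single n a F a<n (λ i i<n → e i (ℕ.m≤n⇒m≤1+n i<n)))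
                                   (e n ℕ.≤-refl (λ n≡a → ℕ.<-irrefl (sym n≡a) a<n)) ⟩
  F a + 0ℚ            ≡⟨ ℚ.+-identityʳ (F a) ⟩
  F a                 ∎
  where
  open ≡-Reasoning
... | inj₂ refl = begin
  ∑ (upTo (suc n)) F  ≡⟨ ∑-upTo-sucʳ n F ⟩
  ∑ (upTo n) F + F n  ≡⟨ cong (_+ F n) (∑-upTo-zero n (λ i i<n → e i (ℕ.m≤n⇒m≤1+n i<n) (ℕ.<⇒≢ i<n))) ⟩
  0ℚ + F n            ≡⟨ ℚ.+-identityˡ (F n) ⟩
  F n                 ∎
  where
  open ≡-Reasoning

∑-upTo-when-≡ : ∀ n a (F : ℕ → ℚ) → ∑[ i ∈ upTo n ] when (i ℕ.≟ a) (F i) ≡ when (a ℕ.<? n) (F a)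
∑-upTo-when-≡ n a F with a ℕ.<? n
... | yes a<n = trans (∑-upTo-single n a _ a<n (λ i _ i≢a → when-no (i ℕ.≟ a) i≢a))
                    (trans (when-yes (a ℕ.≟ a) refl) (sym (when-yes (a ℕ.<? n) a<n)))
... | no a≮n  = trans (∑-upTo-zero n (λ i i<n → when-no (i ℕ.≟ a) (λ i≡a → a≮n (subst (_< n) i≡a i<n))))
                    (sym (when-no (a ℕ.<? n) a≮n))

∑-upTo-truncate : ∀ m n (F : ℕ → ℚ) → m ≤ n → (∀ i → m ≤ i → i < n → F i ≡ 0ℚ) →
                  ∑ (upTo n) F ≡ ∑ (upTo m) F
∑-upTo-truncate m n F m≤n e with ℕ.m≤n⇒m<n∨m≡n m≤n
... | inj₂ refl = refl
∑-upTo-truncate m (suc n) F _ e | inj₁ m<1+n = begin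
  ∑ (upTo (suc n)) F  ≡⟨ ∑-upTo-sucʳ n F ⟩
  ∑ (upTo n) F + F n  ≡⟨ cong₂ _+_ (∑-upTo-truncate m n F m≤n (λ i m≤i i<n → e i m≤i (ℕ.m≤n⇒m≤1+n i<n)))
                                   (e n m≤n ℕ.≤-refl) ⟩
  ∑ (upTo m) F + 0ℚ   ≡⟨ ℚ.+-identityʳ _ ⟩
  ∑ (upTo m) F        ∎
  where
  open ≡-Reasoning
  m≤n = ℕ.≤-pred m<1+n

∑-upTo-reverse : ∀ n (F : ℕ → ℚ) → ∑ (upTo n) F ≡ ∑[ i ∈ upTo n ] F (n ∸ suc i)
∑-upTo-reverse zero    F = refl
∑-upTo-reverse (suc n) F = begin
  ∑ (upTo (suc n)) F                                       ≡⟨ ∑-upTo-sucˡ n F ⟩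
  F 0 + ∑[ i ∈ upTo n ] F (suc i)                          ≡⟨ cong (F 0 +_) (∑-upTo-reverse n (F ∘ suc)) ⟩
  F 0 + ∑[ i ∈ upTo n ] F (suc (n ∸ suc i))                ≡⟨ ℚ.+-comm (F 0) _ ⟩
  ∑[ i ∈ upTo n ] F (suc (n ∸ suc i)) + F 0                ≡⟨ cong₂ _+_ (∑-upTo-cong n (λ i i<n → cong F (sym (ℕ.+-∸-assoc 1 i<n))))
                                                                         (cong F (sym (ℕ.n∸n≡0 n))) ⟩
  ∑[ i ∈ upTo n ] F (suc n ∸ suc i) + F (suc n ∸ suc n)    ≡⟨ ∑-upTo-sucʳ n (λ i → F (suc n ∸ suc i)) ⟨
  ∑[ i ∈ upTo (suc n) ] F (suc n ∸ suc i)                  ∎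
  where
  open ≡-Reasoning

∑-upTo-shift : ∀ {k} N (F : ℕ → ℚ) → k ≤ N →
               ∑[ j ∈ upTo (suc N) ] when (k ≤? j) (F (j ∸ k)) ≡ ∑[ j ∈ upTo (suc (N ∸ k)) ] F j
∑-upTo-shift {k} N F k≤N = trans (cong (λ n → ∑[ j ∈ upTo n ] when (k ≤? j) (F (j ∸ k))) (sym k+[1+N-k]≡1+N))
                                 (offset k (suc (N ∸ k)))
  where
  k+[1+N-k]≡1+N : k ℕ.+ suc (N ∸ k) ≡ suc N
  k+[1+N-k]≡1+N = trans (ℕ.+-suc k (N ∸ k)) (cong suc (ℕ.m+[n∸m]≡n k≤N))
  offset : ∀ k n → ∑[ j ∈ upTo (k ℕ.+ n) ] when (k ≤? j) (F (j ∸ k)) ≡ ∑ (upTo n) F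
  offset zero    n = ∑-cong (upTo n) (λ j → when-yes (0 ≤? j) z≤n)
  offset (suc k) n = begin
    ∑[ j ∈ upTo (suc k ℕ.+ n) ] when (suc k ≤? j) (F (j ∸ suc k))
      ≡⟨ ∑-upTo-sucˡ (k ℕ.+ n) (λ j → when (suc k ≤? j) (F (j ∸ suc k))) ⟩
    0ℚ + ∑[ j ∈ upTo (k ℕ.+ n) ] when (suc k ≤? suc j) (F (j ∸ k))
      ≡⟨ ℚ.+-identityˡ _ ⟩
    ∑[ j ∈ upTo (k ℕ.+ n) ] when (suc k ≤? suc j) (F (j ∸ k))
      ≡⟨ ∑-cong (upTo (k ℕ.+ n)) (λ j → when-⇔ (suc k ≤? suc j) (k ≤? j) _ ℕ.≤-pred s≤s) ⟩
    ∑[ j ∈ upTo (k ℕ.+ n) ] when (k ≤? j) (F (j ∸ k))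
      ≡⟨ offset k n ⟩
    ∑ (upTo n) F ∎
    where
    open ≡-Reasoning

∑-upTo-triangle : ∀ N (G : ℕ → ℕ → ℚ) →
                  ∑[ i ∈ upTo (suc N) ] ∑[ j ∈ upTo (suc i) ] G j (i ∸ j) ≡
                  ∑[ j ∈ upTo (suc N) ] ∑[ l ∈ upTo (suc (N ∸ j)) ] G j l
∑-upTo-triangle N G = begin
  ∑[ i ∈ upTo (suc N) ] ∑[ j ∈ upTo (suc i) ] G j (i ∸ j)
    ≡⟨ ∑-upTo-cong (suc N) (λ i i<1+N → row i (ℕ.≤-pred i<1+N)) ⟩
  ∑[ i ∈ upTo (suc N) ] ∑[ j ∈ upTo (suc N) ] when (j ≤? i) (G j (i ∸ j))
    ≡⟨ ∑-comm (upTo (suc N)) (upTo (suc N)) (λ i j → when (j ≤? i) (G j (i ∸ j))) ⟩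
  ∑[ j ∈ upTo (suc N) ] ∑[ i ∈ upTo (suc N) ] when (j ≤? i) (G j (i ∸ j))
    ≡⟨ ∑-upTo-cong (suc N) (λ j j<1+N → column j (ℕ.≤-pred j<1+N)) ⟩
  ∑[ j ∈ upTo (suc N) ] ∑[ l ∈ upTo (suc (N ∸ j)) ] G j l ∎
  where
  open ≡-Reasoning
  row : ∀ i → i ≤ N → ∑[ j ∈ upTo (suc i) ] G j (i ∸ j) ≡ ∑[ j ∈ upTo (suc N) ] when (j ≤? i) (G j (i ∸ j))
  row i i≤N = begin
    ∑[ j ∈ upTo (suc i) ] G j (i ∸ j)                     ≡⟨ ∑-upTo-cong (suc i) {F = λ j → when (j ≤? i) (G j (i ∸ j))}
                                                               (λ j j<1+i → when-yes (j ≤? i) (ℕ.≤-pred j<1+i)) ⟨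
    ∑[ j ∈ upTo (suc i) ] when (j ≤? i) (G j (i ∸ j))     ≡⟨ ∑-upTo-truncate (suc i) (suc N) (λ j → when (j ≤? i) (G j (i ∸ j))) (s≤s i≤N)
                                                               (λ j i<j _ → when-no (j ≤? i) (ℕ.<⇒≱ i<j)) ⟨
    ∑[ j ∈ upTo (suc N) ] when (j ≤? i) (G j (i ∸ j))     ∎
  column : ∀ j → j ≤ N → ∑[ i ∈ upTo (suc N) ] when (j ≤? i) (G j (i ∸ j)) ≡ ∑[ l ∈ upTo (suc (N ∸ j)) ] G j l
  column j = ∑-upTo-shift N (G j)

divℕ-cong : ∀ a b {d e} → 0 < d → 0 < e → a ℕ.* e ≡ b ℕ.* d → divℕ a d ≡ divℕ b e
divℕ-cong a b {suc d} {suc e} _ _ eq = ℚ.fromℚᵘ-cong {mkℚᵘ (ℤ.+ a) d} {mkℚᵘ (ℤ.+ b) e}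
  (*≡* (trans (sym (ℤ.pos-* a (suc e))) (trans (cong ℤ.+_ eq) (ℤ.pos-* b (suc d)))))

private
  fromℚᵘ-+ : ∀ p q → fromℚᵘ p + fromℚᵘ q ≡ fromℚᵘ (p ℚᵘ.+ q)
  fromℚᵘ-+ p q = ℚ.toℚᵘ-injective (ℚᵘ.≃-trans (ℚ.toℚᵘ-homo-+ (fromℚᵘ p) (fromℚᵘ q))
    (ℚᵘ.≃-trans (ℚᵘ.+-cong (ℚ.toℚᵘ-fromℚᵘ p) (ℚ.toℚᵘ-fromℚᵘ q)) (ℚᵘ.≃-sym (ℚ.toℚᵘ-fromℚᵘ (p ℚᵘ.+ q)))))

  fromℚᵘ-* : ∀ p q → fromℚᵘ p * fromℚᵘ q ≡ fromℚᵘ (p ℚᵘ.* q)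
  fromℚᵘ-* p q = ℚ.toℚᵘ-injective (ℚᵘ.≃-trans (ℚ.toℚᵘ-homo-* (fromℚᵘ p) (fromℚᵘ q))
    (ℚᵘ.≃-trans (ℚᵘ.*-cong (ℚ.toℚᵘ-fromℚᵘ p) (ℚ.toℚᵘ-fromℚᵘ q)) (ℚᵘ.≃-sym (ℚ.toℚᵘ-fromℚᵘ (p ℚᵘ.* q)))))

divℕ-* : ∀ a b {d e} → 0 < d → 0 < e → divℕ a d * divℕ b e ≡ divℕ (a ℕ.* b) (d ℕ.* e)
divℕ-* a b {suc d} {suc e} _ _ = trans (fromℚᵘ-* (mkℚᵘ (ℤ.+ a) d) (mkℚᵘ (ℤ.+ b) e))
  (ℚ.fromℚᵘ-cong {mkℚᵘ (ℤ.+ a) d ℚᵘ.* mkℚᵘ (ℤ.+ b) e} {mkℚᵘ (ℤ.+ (a ℕ.* b)) (e ℕ.+ d ℕ.* suc e)}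
    (*≡* (cong (ℤ._* ℤ.+ (suc d ℕ.* suc e)) (sym (ℤ.pos-* a b)))))

divℕ-+ : ∀ a b {d} → 0 < d → divℕ a d + divℕ b d ≡ divℕ (a ℕ.+ b) d
divℕ-+ a b {suc d} 0<d = begin
  divℕ a (suc d) + divℕ b (suc d)                   ≡⟨ fromℚᵘ-+ (mkℚᵘ (ℤ.+ a) d) (mkℚᵘ (ℤ.+ b) d) ⟩
  fromℚᵘ (mkℚᵘ (ℤ.+ a) d ℚᵘ.+ mkℚᵘ (ℤ.+ b) d)       ≡⟨ ℚ.fromℚᵘ-cong {mkℚᵘ (ℤ.+ a) d ℚᵘ.+ mkℚᵘ (ℤ.+ b) d} {mkℚᵘ (ℤ.+ (a ℕ.* suc d ℕ.+ b ℕ.* suc d)) (d ℕ.+ d ℕ.* suc d)}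
                                                             (*≡* (cong (ℤ._* ℤ.+ (suc d ℕ.* suc d)) numerator)) ⟩
  divℕ (a ℕ.* suc d ℕ.+ b ℕ.* suc d) (suc d ℕ.* suc d) ≡⟨ divℕ-cong (a ℕ.* suc d ℕ.+ b ℕ.* suc d) (a ℕ.+ b) (s≤s z≤n) 0<d cross ⟩
  divℕ (a ℕ.+ b) (suc d)                            ∎
  where
  open ≡-Reasoning
  numerator : ℤ.+ a ℤ.* ℤ.+ suc d ℤ.+ ℤ.+ b ℤ.* ℤ.+ suc d ≡ ℤ.+ (a ℕ.* suc d ℕ.+ b ℕ.* suc d)
  numerator = trans (cong₂ ℤ._+_ (sym (ℤ.pos-* a (suc d))) (sym (ℤ.pos-* b (suc d)))) (sym (ℤ.pos-+ (a ℕ.* suc d) (b ℕ.* suc d)))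
  cross : (a ℕ.* suc d ℕ.+ b ℕ.* suc d) ℕ.* suc d ≡ (a ℕ.+ b) ℕ.* (suc d ℕ.* suc d)
  cross = solve 3 (λ a b d → (a :* (con 1 :+ d) :+ b :* (con 1 :+ d)) :* (con 1 :+ d)
                             := (a :+ b) :* ((con 1 :+ d) :* (con 1 :+ d))) refl a b d
    where
    open ℕ-Solver

divℕ-zero : ∀ d → divℕ 0 d ≡ 0ℚ
divℕ-zero zero    = refl
divℕ-zero (suc d) = divℕ-cong 0 0 {suc d} {1} (s≤s z≤n) (s≤s z≤n) refl

divℕ-self : ∀ d → divℕ (suc d) (suc d) ≡ 1ℚ
divℕ-self d = divℕ-cong (suc d) 1 {suc d} {1} (s≤s z≤n) (s≤s z≤n) (trans (ℕ.*-identityʳ _) (sym (ℕ.*-identityˡ _)))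

divℕ-sum : (f : I → ℕ) (xs : List I) {d : ℕ} → 0 < d → divℕ (sum (map f xs)) d ≡ ∑[ x ∈ xs ] divℕ (f x) d
divℕ-sum f []       {d} _   = divℕ-zero d
divℕ-sum f (x ∷ xs) {d} 0<d = trans (sym (divℕ-+ (f x) _ 0<d)) (cong (divℕ (f x) d +_) (divℕ-sum f xs 0<d))

ι : ℕ → ℚ
ι n = divℕ n 1

ι-+ : ∀ a b → ι (a ℕ.+ b) ≡ ι a + ι b
ι-+ a b = sym (divℕ-+ a b (s≤s z≤n))

-- Monomials as multisets

private
  module ≥-Sort = InsertionSort ≥-decTotalOrder
  module ≥-Sortₚ = InsertionSortₚ ≥-decTotalOrder
  open DecTotalOrder ≥-decTotalOrder using (totalOrder)

Sorted≥ : List ℕ → Set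
Sorted≥ = Sorted totalOrder

sorted-↭⇒≡ : ∀ {l l′} → Sorted≥ l → Sorted≥ l′ → l ↭ l′ → l ≡ l′
sorted-↭⇒≡ l↗ l′↗ p = ≋⇒≡ (↗↭↗⇒≋ totalOrder l↗ l′↗ (↭⇒↭ₛ p))

private
  insert≡≥-insert : ∀ x l → insert x l ≡ ≥-Sort.insert x l
  insert≡≥-insert x []       = refl
  insert≡≥-insert x (y ∷ ys) with y ℕ.≤? x
  ... | yes y≤x rewrite dec-true (y ℕ.≤? x) y≤x = refl
  ... | no y≰x  rewrite dec-false (y ℕ.≤? x) y≰x = cong (y ∷_) (insert≡≥-insert x ys)

  sortDesc≡≥-sort : ∀ l → sortDesc l ≡ ≥-Sort.sort l
  sortDesc≡≥-sort []      = refl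
  sortDesc≡≥-sort (x ∷ l) = ≡.trans (insert≡≥-insert x (sortDesc l)) (cong (≥-Sort.insert x) (sortDesc≡≥-sort l))

sortDesc-↭ : ∀ l → sortDesc l ↭ l
sortDesc-↭ l rewrite sortDesc≡≥-sort l = ≥-Sortₚ.sort-↭ l

sortDesc-sorted : ∀ l → Sorted≥ (sortDesc l)
sortDesc-sorted l rewrite sortDesc≡≥-sort l = ≥-Sortₚ.sort-↗ l

sortDesc-≡⇒↭ : ∀ {m μ} → sortDesc m ≡ sortDesc μ → m ↭ μ
sortDesc-≡⇒↭ {m} {μ} e = ↭-trans (↭-sym (sortDesc-↭ m)) (≡.subst (_↭ μ) (sym e) (sortDesc-↭ μ))

↭⇒sortDesc-≡ : ∀ {m μ} → m ↭ μ → sortDesc m ≡ sortDesc μ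
↭⇒sortDesc-≡ {m} {μ} p = sorted-↭⇒≡ (sortDesc-sorted m) (sortDesc-sorted μ)
                           (↭-trans (sortDesc-↭ m) (↭-trans p (↭-sym (sortDesc-↭ μ))))

-- The test by which coeff compares monomials, as a decision procedure for _↭_.
infix 4 _↭?_
_↭?_ : (m μ : Monomial) → Dec (m ↭ μ)
m ↭? μ = map′ sortDesc-≡⇒↭ ↭⇒sortDesc-≡ (≡-dec _≟_ (sortDesc m) (sortDesc μ))

mult-↭ : ∀ j {m m′} → m ↭ m′ → mult j m ≡ mult j m′
mult-↭ j p = ↭-length (filter-↭ (_≟ j) p)

mult-∷-≡ : ∀ j l → mult j (j ∷ l) ≡ suc (mult j l)
mult-∷-≡ j l = cong length (filter-accept (_≟ j) refl)

mult-∷-≢ : ∀ {j x} l → x ≢ j → mult j (x ∷ l) ≡ mult j l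
mult-∷-≢ {j} l x≢j = cong length (filter-reject (_≟ j) x≢j)

∉⇒mult≡0 : ∀ {j} l → j ∉ l → mult j l ≡ 0
∉⇒mult≡0 []      _   = refl
∉⇒mult≡0 {j} (x ∷ l) j∉ = ≡.trans (mult-∷-≢ l (λ x≡j → j∉ (here (sym x≡j)))) (∉⇒mult≡0 l (j∉ ∘ there))

∈⇒↭∷ : ∀ {j : ℕ} {l} → j ∈ l → ∃ λ ν → l ↭ j ∷ ν
∈⇒↭∷ {j} {l} j∈l with xs , ys , refl ← ∈-∃++ {v = j} {xs = l} j∈l = xs ++ ys , shift j xs ys

∷↭⇒∈ : ∀ {j : ℕ} {n μ} → j ∷ n ↭ μ → j ∈ μ
∷↭⇒∈ p = ∈-resp-↭ p (here refl)

gcdL-↭ : ∀ {m m′} → m ↭ m′ → gcdL m ≡ gcdL m′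
gcdL-↭ ↭.refl         = refl
gcdL-↭ (prep x p)     = cong (gcd x) (gcdL-↭ p)
gcdL-↭ (swap x y p)   = ≡.trans (gcd-swap x y _) (cong (λ g → gcd y (gcd x g)) (gcdL-↭ p))
  where
  gcd-swap : ∀ x y g → gcd x (gcd y g) ≡ gcd y (gcd x g)
  gcd-swap x y g = ≡.trans (sym (gcd-assoc x y g)) (≡.trans (cong (λ t → gcd t g) (gcd-comm x y)) (gcd-assoc y x g))
gcdL-↭ (↭.trans p q) = ≡.trans (gcdL-↭ p) (gcdL-↭ q)

-- Coefficients in Λ

coeff-∷ : ∀ c m f μ → coeff ((c , m) ∷ f) μ ≡ when (m ↭? μ) c + coeff f μ
coeff-∷ c m f μ with ≡-dec _≟_ (sortDesc m) (sortDesc μ)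
... | yes _ = refl
... | no _  = sym (ℚ.+-identityˡ _)

coeffₜ : Monomial → ℚ × Monomial → ℚ
coeffₜ μ (c , m) = when (m ↭? μ) c

coeff-∑ : ∀ f μ → coeff f μ ≡ ∑ f (coeffₜ μ)
coeff-∑ []            μ = refl
coeff-∑ ((c , m) ∷ f) μ = trans (coeff-∷ c m f μ) (cong (when (m ↭? μ) c +_) (coeff-∑ f μ))

coeff-++ : ∀ f g μ → coeff (f ++ g) μ ≡ coeff f μ + coeff g μ
coeff-++ f g μ = begin
  coeff (f ++ g) μ               ≡⟨ coeff-∑ (f ++ g) μ ⟩
  ∑ (f ++ g) (coeffₜ μ)          ≡⟨ ∑-++ f g (coeffₜ μ) ⟩
  ∑ f (coeffₜ μ) + ∑ g (coeffₜ μ) ≡⟨ cong₂ _+_ (coeff-∑ f μ) (coeff-∑ g μ) ⟨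
  coeff f μ + coeff g μ          ∎
  where
  open ≡-Reasoning

coeff-scale : ∀ a f μ → coeff (scale a f) μ ≡ a * coeff f μ
coeff-scale a f μ = begin
  coeff (scale a f) μ                              ≡⟨ coeff-∑ (scale a f) μ ⟩
  ∑ (scale a f) (coeffₜ μ)                         ≡⟨ ∑-map _ f (coeffₜ μ) ⟩
  ∑[ t ∈ f ] when (proj₂ t ↭? μ) (a * proj₁ t)     ≡⟨ ∑-cong f (λ t → *-when (proj₂ t ↭? μ) a (proj₁ t)) ⟨
  ∑[ t ∈ f ] (a * coeffₜ μ t)                      ≡⟨ *-distribˡ-∑ f a (coeffₜ μ) ⟨
  a * ∑ f (coeffₜ μ)                               ≡⟨ cong (a *_) (coeff-∑ f μ) ⟨
  a * coeff f μ                                    ∎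
  where
  open ≡-Reasoning

coeff-sumᴾ : (F : I → Poly) (xs : List I) (μ : Monomial) →
             coeff (sumᴾ (map F xs)) μ ≡ ∑[ x ∈ xs ] coeff (F x) μ
coeff-sumᴾ F []       μ = refl
coeff-sumᴾ F (x ∷ xs) μ = trans (coeff-++ (F x) _ μ) (cong (coeff (F x) μ +_) (coeff-sumᴾ F xs μ))

coeff-pλ : ∀ m μ → coeff (pλ m) μ ≡ when (m ↭? μ) 1ℚ
coeff-pλ m μ = trans (coeff-∷ 1ℚ m [] μ) (ℚ.+-identityʳ _)

∑-*ᴾ : ∀ f g (F : ℚ × Monomial → ℚ) →
       ∑ (f *ᴾ g) F ≡ ∑[ s ∈ f ] ∑[ t ∈ g ] F (proj₁ s * proj₁ t , proj₂ s ++ proj₂ t)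
∑-*ᴾ []            g F = refl
∑-*ᴾ ((c , m) ∷ f) g F = trans (∑-++ (map _ g) (f *ᴾ g) F) (cong₂ _+_ (∑-map _ g F) (∑-*ᴾ f g F))

coeff-*ᴾ : ∀ f g μ →
           coeff (f *ᴾ g) μ ≡ ∑[ s ∈ f ] ∑[ t ∈ g ] when (proj₂ s ++ proj₂ t ↭? μ) (proj₁ s * proj₁ t)
coeff-*ᴾ f g μ = trans (coeff-∑ (f *ᴾ g) μ) (∑-*ᴾ f g (coeffₜ μ))

-- _≈ᴾ_ wrapped in a record, so that the two sides can be inferred from a proof.
infix 4 _≈_
record _≈_ (f g : Poly) : Set where
  constructor mk≈
  field ≈⇒≈ᴾ : f ≈ᴾ g
open _≈_ public

≈-refl : ∀ {f} → f ≈ f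
≈-refl = mk≈ λ _ → refl

≈-reflexive : ∀ {f g} → f ≡ g → f ≈ g
≈-reflexive refl = ≈-refl

≈-sym : ∀ {f g} → f ≈ g → g ≈ f
≈-sym (mk≈ e) = mk≈ (sym ∘ e)

≈-trans : ∀ {f g h} → f ≈ g → g ≈ h → f ≈ h
≈-trans (mk≈ e) (mk≈ e′) = mk≈ λ μ → trans (e μ) (e′ μ)

≈-setoid : Setoid _ _
≈-setoid = record { Carrier = Poly ; _≈_ = _≈_
                  ; isEquivalence = record { refl = ≈-refl ; sym = ≈-sym ; trans = ≈-trans } }

module ≈-Reasoning = Relation.Binary.Reasoning.Setoid ≈-setoid

-- Linear functionals on Λ

linear : (Monomial → ℚ) → Poly → ℚ
linear ψ f = ∑[ t ∈ f ] (proj₁ t * ψ (proj₂ t))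

without : Monomial → Poly → Poly
without m₀ = filter (λ t → ¬? (proj₂ t ↭? m₀))

private
  without-∷-↭ : ∀ {m₀} c {m} f → m ↭ m₀ → without m₀ ((c , m) ∷ f) ≡ without m₀ f
  without-∷-↭ {m₀} c f m↭m₀ = filter-reject (λ t → ¬? (proj₂ t ↭? m₀)) (λ m≁m₀ → m≁m₀ m↭m₀)

  without-∷-≁ : ∀ {m₀} c {m} f → ¬ (m ↭ m₀) → without m₀ ((c , m) ∷ f) ≡ (c , m) ∷ without m₀ f
  without-∷-≁ {m₀} c f m≁m₀ = filter-accept (λ t → ¬? (proj₂ t ↭? m₀)) m≁m₀

coeff-without-↭ : ∀ m₀ f {μ} → μ ↭ m₀ → coeff (without m₀ f) μ ≡ 0ℚ
coeff-without-↭ m₀ []            μ↭m₀ = refl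
coeff-without-↭ m₀ ((c , m) ∷ f) {μ} μ↭m₀ = by-cases (m ↭? m₀)
  where
  open ≡-Reasoning
  by-cases : Dec (m ↭ m₀) → coeff (without m₀ ((c , m) ∷ f)) μ ≡ 0ℚ
  by-cases (yes m↭m₀) = trans (cong (λ h → coeff h μ) (without-∷-↭ c f m↭m₀)) (coeff-without-↭ m₀ f μ↭m₀)
  by-cases (no m≁m₀)  = begin
    coeff (without m₀ ((c , m) ∷ f)) μ        ≡⟨ cong (λ h → coeff h μ) (without-∷-≁ c f m≁m₀) ⟩
    coeff ((c , m) ∷ without m₀ f) μ          ≡⟨ coeff-∷ c m (without m₀ f) μ ⟩
    when (m ↭? μ) c + coeff (without m₀ f) μ  ≡⟨ cong₂ _+_ (when-no (m ↭? μ) (λ m↭μ → m≁m₀ (↭-trans m↭μ μ↭m₀)))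
                                                           (coeff-without-↭ m₀ f μ↭m₀) ⟩
    0ℚ + 0ℚ                                   ≡⟨ ℚ.+-identityˡ 0ℚ ⟩
    0ℚ                                        ∎

coeff-without-≁ : ∀ m₀ f {μ} → ¬ (μ ↭ m₀) → coeff (without m₀ f) μ ≡ coeff f μ
coeff-without-≁ m₀ []            μ≁m₀ = refl
coeff-without-≁ m₀ ((c , m) ∷ f) {μ} μ≁m₀ = by-cases (m ↭? m₀)
  where
  open ≡-Reasoning
  by-cases : Dec (m ↭ m₀) → coeff (without m₀ ((c , m) ∷ f)) μ ≡ coeff ((c , m) ∷ f) μ
  by-cases (yes m↭m₀) = begin
    coeff (without m₀ ((c , m) ∷ f)) μ  ≡⟨ cong (λ h → coeff h μ) (without-∷-↭ c f m↭m₀) ⟩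
    coeff (without m₀ f) μ              ≡⟨ coeff-without-≁ m₀ f μ≁m₀ ⟩
    coeff f μ                           ≡⟨ ℚ.+-identityˡ _ ⟨
    0ℚ + coeff f μ                      ≡⟨ cong (_+ coeff f μ) (when-no (m ↭? μ) (λ m↭μ → μ≁m₀ (↭-trans (↭-sym m↭μ) m↭m₀))) ⟨
    when (m ↭? μ) c + coeff f μ         ≡⟨ coeff-∷ c m f μ ⟨
    coeff ((c , m) ∷ f) μ               ∎
  by-cases (no m≁m₀)  = begin
    coeff (without m₀ ((c , m) ∷ f)) μ        ≡⟨ cong (λ h → coeff h μ) (without-∷-≁ c f m≁m₀) ⟩
    coeff ((c , m) ∷ without m₀ f) μ          ≡⟨ coeff-∷ c m (without m₀ f) μ ⟩
    when (m ↭? μ) c + coeff (without m₀ f) μ  ≡⟨ cong (when (m ↭? μ) c +_) (coeff-without-≁ m₀ f μ≁m₀) ⟩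
    when (m ↭? μ) c + coeff f μ               ≡⟨ coeff-∷ c m f μ ⟨
    coeff ((c , m) ∷ f) μ                     ∎

without-cong : ∀ m₀ {f g} → f ≈ g → without m₀ f ≈ without m₀ g
without-cong m₀ {f} {g} (mk≈ e) = mk≈ λ μ → case μ (μ ↭? m₀)
  where
  case : ∀ μ → Dec (μ ↭ m₀) → coeff (without m₀ f) μ ≡ coeff (without m₀ g) μ
  case μ (yes μ↭m₀) = trans (coeff-without-↭ m₀ f μ↭m₀) (sym (coeff-without-↭ m₀ g μ↭m₀))
  case μ (no μ≁m₀)  = trans (coeff-without-≁ m₀ f μ≁m₀) (trans (e μ) (sym (coeff-without-≁ m₀ g μ≁m₀)))

module _ {ψ : Monomial → ℚ} (ψ-↭ : ∀ {m m′} → m ↭ m′ → ψ m ≡ ψ m′) where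

  linear-split : ∀ m₀ f → linear ψ f ≡ coeff f m₀ * ψ m₀ + linear ψ (without m₀ f)
  linear-split m₀ [] = sym (trans (cong (_+ 0ℚ) (ℚ.*-zeroˡ (ψ m₀))) (ℚ.+-identityʳ 0ℚ))
  linear-split m₀ ((c , m) ∷ f) = by-cases (m ↭? m₀)
    where
    open ≡-Reasoning
    open ℚ-Solver
    rhs = coeff ((c , m) ∷ f) m₀ * ψ m₀ + linear ψ (without m₀ ((c , m) ∷ f))
    by-cases : Dec (m ↭ m₀) → c * ψ m + linear ψ f ≡ rhs
    by-cases (yes m↭m₀) = begin
      c * ψ m + linear ψ f                                             ≡⟨ cong₂ (λ x y → c * x + y) (ψ-↭ m↭m₀) (linear-split m₀ f) ⟩
      c * ψ m₀ + (coeff f m₀ * ψ m₀ + linear ψ (without m₀ f))         ≡⟨ solve 4 (λ c p x l → c :* p :+ (x :* p :+ l) := (c :+ x) :* p :+ l)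
                                                                                 refl c (ψ m₀) (coeff f m₀) _ ⟩
      (c + coeff f m₀) * ψ m₀ + linear ψ (without m₀ f)                ≡⟨ cong₂ (λ x h → (x + coeff f m₀) * ψ m₀ + linear ψ h)
                                                                                 (when-yes (m ↭? m₀) m↭m₀) (without-∷-↭ c f m↭m₀) ⟨
      (when (m ↭? m₀) c + coeff f m₀) * ψ m₀ + linear ψ (without m₀ ((c , m) ∷ f))
                                                                       ≡⟨ cong (λ x → x * ψ m₀ + linear ψ (without m₀ ((c , m) ∷ f))) (coeff-∷ c m f m₀) ⟨
      rhs                                                              ∎
    by-cases (no m≁m₀) = begin
      c * ψ m + linear ψ f                                             ≡⟨ cong (c * ψ m +_) (linear-split m₀ f) ⟩
      c * ψ m + (coeff f m₀ * ψ m₀ + linear ψ (without m₀ f))          ≡⟨ solve 5 (λ c q x p l → c :* q :+ (x :* p :+ l) := (con 0ℚ :+ x) :* p :+ (c :* q :+ l))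
                                                                                 refl c (ψ m) (coeff f m₀) (ψ m₀) _ ⟩
      (0ℚ + coeff f m₀) * ψ m₀ + linear ψ ((c , m) ∷ without m₀ f)     ≡⟨ cong₂ (λ x h → (x + coeff f m₀) * ψ m₀ + linear ψ h)
                                                                                 (when-no (m ↭? m₀) m≁m₀) (without-∷-≁ c f m≁m₀) ⟨
      (when (m ↭? m₀) c + coeff f m₀) * ψ m₀ + linear ψ (without m₀ ((c , m) ∷ f))
                                                                       ≡⟨ cong (λ x → x * ψ m₀ + linear ψ (without m₀ ((c , m) ∷ f))) (coeff-∷ c m f m₀) ⟨
      rhs                                                              ∎

  private
    linear-cong-step : ∀ m₀ {f g} → f ≈ g → linear ψ (without m₀ f) ≡ linear ψ (without m₀ g) →
                       linear ψ f ≡ linear ψ g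
    linear-cong-step m₀ {f} {g} (mk≈ e) ih = begin
      linear ψ f                                         ≡⟨ linear-split m₀ f ⟩
      coeff f m₀ * ψ m₀ + linear ψ (without m₀ f)        ≡⟨ cong₂ (λ a b → a * ψ m₀ + b) (e m₀) ih ⟩
      coeff g m₀ * ψ m₀ + linear ψ (without m₀ g)        ≡⟨ linear-split m₀ g ⟨
      linear ψ g                                         ∎
      where
      open ≡-Reasoning

    length-without-∷ : ∀ c m f → length (without m ((c , m) ∷ f)) ≤ length f
    length-without-∷ c m f = ℕ.≤-trans (ℕ.≤-reflexive (cong length (without-∷-↭ c f (↭-refl {x = m})))) (length-filter _ f)

    -- Induction on the number of terms: without m₀ removes at least the head term.
    linear-cong′ : ∀ n f g → length f ℕ.+ length g ≤ n → f ≈ g → linear ψ f ≡ linear ψ g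
    linear-cong′ _       []            []            _  _ = refl
    linear-cong′ (suc n) ((c , m) ∷ f) g (s≤s le) e =
      linear-cong-step m e (linear-cong′ n _ _ (ℕ.≤-trans (ℕ.+-mono-≤ (length-without-∷ c m f) (length-filter _ g)) le)
                                         (without-cong m e))
    linear-cong′ (suc n) []            ((c , m) ∷ g) (s≤s le) e =
      linear-cong-step m e (linear-cong′ n [] _ (ℕ.≤-trans (length-without-∷ c m g) le) (without-cong m e))

  linear-cong : ∀ {f g} → f ≈ g → linear ψ f ≡ linear ψ g
  linear-cong {f} {g} = linear-cong′ _ f g ℕ.≤-refl

-- Λ is a commutative ring

+ᴾ-cong : ∀ {f f′ g g′} → f ≈ f′ → g ≈ g′ → f +ᴾ g ≈ f′ +ᴾ g′
+ᴾ-cong {f} {f′} {g} {g′} (mk≈ e) (mk≈ e′) = mk≈ λ μ →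
  trans (coeff-++ f g μ) (trans (cong₂ _+_ (e μ) (e′ μ)) (sym (coeff-++ f′ g′ μ)))

scale-cong : ∀ a {f g} → f ≈ g → scale a f ≈ scale a g
scale-cong a {f} {g} (mk≈ e) = mk≈ λ μ →
  trans (coeff-scale a f μ) (trans (cong (a *_) (e μ)) (sym (coeff-scale a g μ)))

scale-scale : ∀ a b f → scale a (scale b f) ≈ scale (a * b) f
scale-scale a b f = mk≈ λ μ → begin
  coeff (scale a (scale b f)) μ  ≡⟨ coeff-scale a (scale b f) μ ⟩
  a * coeff (scale b f) μ        ≡⟨ cong (a *_) (coeff-scale b f μ) ⟩
  a * (b * coeff f μ)            ≡⟨ ℚ.*-assoc a b _ ⟨
  a * b * coeff f μ              ≡⟨ coeff-scale (a * b) f μ ⟨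
  coeff (scale (a * b) f) μ      ∎
  where
  open ≡-Reasoning

scale-identity : ∀ f → scale 1ℚ f ≈ f
scale-identity f = mk≈ λ μ → trans (coeff-scale 1ℚ f μ) (ℚ.*-identityˡ (coeff f μ))

scale-zero : ∀ f → scale 0ℚ f ≈ 0ᴾ
scale-zero f = mk≈ λ μ → trans (coeff-scale 0ℚ f μ) (ℚ.*-zeroˡ (coeff f μ))

*ᴾ-distribʳ-+ᴾ : ∀ f g h → (f +ᴾ g) *ᴾ h ≡ f *ᴾ h +ᴾ g *ᴾ h
*ᴾ-distribʳ-+ᴾ f g h = concatMap-++ _ f g

*ᴾ-distribˡ-+ᴾ : ∀ f g h → f *ᴾ (g +ᴾ h) ≈ f *ᴾ g +ᴾ f *ᴾ h
*ᴾ-distribˡ-+ᴾ f g h = mk≈ λ μ → begin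
  coeff (f *ᴾ (g ++ h)) μ                  ≡⟨ coeff-*ᴾ f (g ++ h) μ ⟩
  ∑[ s ∈ f ] ∑ (g ++ h) (term μ s)           ≡⟨ ∑-cong f (λ s → ∑-++ g h (term μ s)) ⟩
  ∑[ s ∈ f ] (∑ g (term μ s) + ∑ h (term μ s)) ≡⟨ ∑-distrib-+ f _ _ ⟩
  ∑[ s ∈ f ] ∑ g (term μ s) + ∑[ s ∈ f ] ∑ h (term μ s)
                                           ≡⟨ cong₂ _+_ (coeff-*ᴾ f g μ) (coeff-*ᴾ f h μ) ⟨
  coeff (f *ᴾ g) μ + coeff (f *ᴾ h) μ      ≡⟨ coeff-++ (f *ᴾ g) _ μ ⟨
  coeff (f *ᴾ g ++ f *ᴾ h) μ               ∎
  where
  open ≡-Reasoning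
  term : Monomial → ℚ × Monomial → ℚ × Monomial → ℚ
  term μ s t = when (proj₂ s ++ proj₂ t ↭? μ) (proj₁ s * proj₁ t)

*ᴾ-zeroʳ : ∀ f → f *ᴾ 0ᴾ ≡ 0ᴾ
*ᴾ-zeroʳ []      = refl
*ᴾ-zeroʳ (_ ∷ f) = *ᴾ-zeroʳ f

*ᴾ-comm : ∀ f g → f *ᴾ g ≈ g *ᴾ f
*ᴾ-comm f g = mk≈ λ μ → begin
  coeff (f *ᴾ g) μ                                                          ≡⟨ coeff-*ᴾ f g μ ⟩
  ∑[ s ∈ f ] ∑[ t ∈ g ] when (proj₂ s ++ proj₂ t ↭? μ) (proj₁ s * proj₁ t)  ≡⟨ ∑-comm f g _ ⟩
  ∑[ t ∈ g ] ∑[ s ∈ f ] when (proj₂ s ++ proj₂ t ↭? μ) (proj₁ s * proj₁ t)  ≡⟨ ∑-cong g (λ t → ∑-cong f (λ s → commute μ s t)) ⟩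
  ∑[ t ∈ g ] ∑[ s ∈ f ] when (proj₂ t ++ proj₂ s ↭? μ) (proj₁ t * proj₁ s)  ≡⟨ coeff-*ᴾ g f μ ⟨
  coeff (g *ᴾ f) μ                                                          ∎
  where
  open ≡-Reasoning
  commute : ∀ μ s t → when (proj₂ s ++ proj₂ t ↭? μ) (proj₁ s * proj₁ t) ≡ when (proj₂ t ++ proj₂ s ↭? μ) (proj₁ t * proj₁ s)
  commute μ (c , m) (d , n) = trans (when-⇔ (m ++ n ↭? μ) (n ++ m ↭? μ) _ (↭-trans (++-comm n m)) (↭-trans (++-comm m n)))
                               (cong (when (n ++ m ↭? μ)) (ℚ.*-comm c d))

*ᴾ-assoc : ∀ f g h → (f *ᴾ g) *ᴾ h ≈ f *ᴾ (g *ᴾ h)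
*ᴾ-assoc f g h = mk≈ λ μ → begin
  coeff ((f *ᴾ g) *ᴾ h) μ  ≡⟨ coeff-*ᴾ (f *ᴾ g) h μ ⟩
  ∑[ r ∈ f *ᴾ g ] ∑[ u ∈ h ] when (proj₂ r ++ proj₂ u ↭? μ) (proj₁ r * proj₁ u)
                           ≡⟨ ∑-*ᴾ f g _ ⟩
  ∑[ s ∈ f ] ∑[ t ∈ g ] ∑[ u ∈ h ] when ((proj₂ s ++ proj₂ t) ++ proj₂ u ↭? μ) ((proj₁ s * proj₁ t) * proj₁ u)
                           ≡⟨ ∑-cong f (λ s → ∑-cong g (λ t → ∑-cong h (λ u → reassociate μ s t u))) ⟩
  ∑[ s ∈ f ] ∑[ t ∈ g ] ∑[ u ∈ h ] when (proj₂ s ++ (proj₂ t ++ proj₂ u) ↭? μ) (proj₁ s * (proj₁ t * proj₁ u))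
                           ≡⟨ ∑-cong f (λ s → ∑-*ᴾ g h _) ⟨
  ∑[ s ∈ f ] ∑[ r ∈ g *ᴾ h ] when (proj₂ s ++ proj₂ r ↭? μ) (proj₁ s * proj₁ r)
                           ≡⟨ coeff-*ᴾ f (g *ᴾ h) μ ⟨
  coeff (f *ᴾ (g *ᴾ h)) μ  ∎
  where
  open ≡-Reasoning
  reassociate : ∀ μ s t u → when ((proj₂ s ++ proj₂ t) ++ proj₂ u ↭? μ) ((proj₁ s * proj₁ t) * proj₁ u)
                        ≡ when (proj₂ s ++ (proj₂ t ++ proj₂ u) ↭? μ) (proj₁ s * (proj₁ t * proj₁ u))
  reassociate μ (c , m) (d , n) (e , o) = cong₂ (λ x y → when (x ↭? μ) y) (++-assoc m n o) (ℚ.*-assoc c d e)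

*ᴾ-congʳ : ∀ {f f′} g → f ≈ f′ → f *ᴾ g ≈ f′ *ᴾ g
*ᴾ-congʳ {f} {f′} g f≈f′ = mk≈ λ μ → begin
  coeff (f *ᴾ g) μ     ≡⟨ as-linear f μ ⟩
  linear (ψ μ) f       ≡⟨ linear-cong (ψ-↭ μ) f≈f′ ⟩
  linear (ψ μ) f′      ≡⟨ as-linear f′ μ ⟨
  coeff (f′ *ᴾ g) μ    ∎
  where
  open ≡-Reasoning
  ψ : Monomial → Monomial → ℚ
  ψ μ m = ∑[ t ∈ g ] when (m ++ proj₂ t ↭? μ) (proj₁ t)
  ψ-↭ : ∀ μ {m m′} → m ↭ m′ → ψ μ m ≡ ψ μ m′
  ψ-↭ μ m↭m′ = ∑-cong g (λ t → when-⇔ (_ ↭? μ) (_ ↭? μ) _ (↭-trans (++⁺ʳ _ (↭-sym m↭m′))) (↭-trans (++⁺ʳ _ m↭m′)))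
  as-linear : ∀ f μ → coeff (f *ᴾ g) μ ≡ linear (ψ μ) f
  as-linear f μ = trans (coeff-*ᴾ f g μ) (∑-cong f λ s →
    trans (∑-cong g (λ t → sym (*-when (proj₂ s ++ proj₂ t ↭? μ) (proj₁ s) (proj₁ t)))) (sym (*-distribˡ-∑ g (proj₁ s) _)))

*ᴾ-congˡ : ∀ f {g g′} → g ≈ g′ → f *ᴾ g ≈ f *ᴾ g′
*ᴾ-congˡ f {g} {g′} g≈g′ = ≈-trans (*ᴾ-comm f g) (≈-trans (*ᴾ-congʳ f g≈g′) (*ᴾ-comm g′ f))

*ᴾ-cong : ∀ {f f′ g g′} → f ≈ f′ → g ≈ g′ → f *ᴾ g ≈ f′ *ᴾ g′
*ᴾ-cong {f′ = f′} {g = g} f≈f′ g≈g′ = ≈-trans (*ᴾ-congʳ g f≈f′) (*ᴾ-congˡ f′ g≈g′)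

scale-+ᴾ : ∀ a f g → scale a (f +ᴾ g) ≈ scale a f +ᴾ scale a g
scale-+ᴾ a f g = ≈-reflexive (map-++ _ f g)

scale-*ᴾˡ : ∀ a f g → scale a f *ᴾ g ≈ scale a (f *ᴾ g)
scale-*ᴾˡ a f g = mk≈ λ μ → begin
  coeff (scale a f *ᴾ g) μ
    ≡⟨ coeff-*ᴾ (scale a f) g μ ⟩
  ∑[ s ∈ scale a f ] ∑[ t ∈ g ] when (proj₂ s ++ proj₂ t ↭? μ) (proj₁ s * proj₁ t)
    ≡⟨ ∑-map _ f _ ⟩
  ∑[ s ∈ f ] ∑[ t ∈ g ] when (proj₂ s ++ proj₂ t ↭? μ) (a * proj₁ s * proj₁ t)
    ≡⟨ ∑-cong f (λ s → ∑-cong g (λ t → trans (cong (when (proj₂ s ++ proj₂ t ↭? μ)) (ℚ.*-assoc a _ _))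
                                                (sym (*-when (proj₂ s ++ proj₂ t ↭? μ) a _)))) ⟩
  ∑[ s ∈ f ] ∑[ t ∈ g ] (a * when (proj₂ s ++ proj₂ t ↭? μ) (proj₁ s * proj₁ t))
    ≡⟨ ∑-cong f (λ s → *-distribˡ-∑ g a _) ⟨
  ∑[ s ∈ f ] (a * ∑[ t ∈ g ] when (proj₂ s ++ proj₂ t ↭? μ) (proj₁ s * proj₁ t))
    ≡⟨ *-distribˡ-∑ f a _ ⟨
  a * ∑[ s ∈ f ] ∑[ t ∈ g ] when (proj₂ s ++ proj₂ t ↭? μ) (proj₁ s * proj₁ t)
    ≡⟨ cong (a *_) (coeff-*ᴾ f g μ) ⟨
  a * coeff (f *ᴾ g) μ
    ≡⟨ coeff-scale a (f *ᴾ g) μ ⟨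
  coeff (scale a (f *ᴾ g)) μ ∎
  where
  open ≡-Reasoning

scale-*ᴾʳ : ∀ a f g → f *ᴾ scale a g ≈ scale a (f *ᴾ g)
scale-*ᴾʳ a f g = ≈-trans (*ᴾ-comm f (scale a g)) (≈-trans (scale-*ᴾˡ a g f) (scale-cong a (*ᴾ-comm g f)))

sumᴾ-cong : (xs : List I) {F G : I → Poly} → (∀ x → F x ≈ G x) → sumᴾ (map F xs) ≈ sumᴾ (map G xs)
sumᴾ-cong []       e = ≈-refl
sumᴾ-cong (x ∷ xs) e = +ᴾ-cong (e x) (sumᴾ-cong xs e)

sumᴾ-zero : (xs : List I) {F : I → Poly} → (∀ x → F x ≈ 0ᴾ) → sumᴾ (map F xs) ≈ 0ᴾ
sumᴾ-zero []       e = ≈-refl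
sumᴾ-zero (x ∷ xs) e = +ᴾ-cong (e x) (sumᴾ-zero xs e)

sumᴾ-distrib-+ᴾ : (xs : List I) (F G : I → Poly) →
                  sumᴾ (map (λ x → F x +ᴾ G x) xs) ≈ sumᴾ (map F xs) +ᴾ sumᴾ (map G xs)
sumᴾ-distrib-+ᴾ xs F G = mk≈ λ μ → begin
  coeff (sumᴾ (map (λ x → F x +ᴾ G x) xs)) μ                 ≡⟨ coeff-sumᴾ _ xs μ ⟩
  ∑[ x ∈ xs ] coeff (F x +ᴾ G x) μ                           ≡⟨ ∑-cong xs (λ x → coeff-++ (F x) (G x) μ) ⟩
  ∑[ x ∈ xs ] (coeff (F x) μ + coeff (G x) μ)                ≡⟨ ∑-distrib-+ xs _ _ ⟩
  ∑[ x ∈ xs ] coeff (F x) μ + ∑[ x ∈ xs ] coeff (G x) μ      ≡⟨ cong₂ _+_ (coeff-sumᴾ F xs μ) (coeff-sumᴾ G xs μ) ⟨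
  coeff (sumᴾ (map F xs)) μ + coeff (sumᴾ (map G xs)) μ      ≡⟨ coeff-++ (sumᴾ (map F xs)) _ μ ⟨
  coeff (sumᴾ (map F xs) +ᴾ sumᴾ (map G xs)) μ               ∎
  where
  open ≡-Reasoning

*ᴾ-distribʳ-sumᴾ : (xs : List I) (F : I → Poly) (g : Poly) → sumᴾ (map F xs) *ᴾ g ≡ sumᴾ (map (λ x → F x *ᴾ g) xs)
*ᴾ-distribʳ-sumᴾ []       F g = refl
*ᴾ-distribʳ-sumᴾ (x ∷ xs) F g = trans (*ᴾ-distribʳ-+ᴾ (F x) _ g) (cong (F x *ᴾ g +ᴾ_) (*ᴾ-distribʳ-sumᴾ xs F g))

*ᴾ-distribˡ-sumᴾ : (xs : List I) (F : I → Poly) (g : Poly) → g *ᴾ sumᴾ (map F xs) ≈ sumᴾ (map (λ x → g *ᴾ F x) xs)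
*ᴾ-distribˡ-sumᴾ xs F g = ≈-trans (*ᴾ-comm g _)
  (≈-trans (≈-reflexive (*ᴾ-distribʳ-sumᴾ xs F g)) (sumᴾ-cong xs (λ x → *ᴾ-comm (F x) g)))

scale-sumᴾ : ∀ a (xs : List I) (F : I → Poly) → scale a (sumᴾ (map F xs)) ≈ sumᴾ (map (λ x → scale a (F x)) xs)
scale-sumᴾ a []       F = ≈-refl
scale-sumᴾ a (x ∷ xs) F = ≈-trans (scale-+ᴾ a (F x) _) (+ᴾ-cong ≈-refl (scale-sumᴾ a xs F))

sumᴾ-comm : ∀ {K : Set} (xs : List I) (ys : List K) (F : I → K → Poly) →
            sumᴾ (map (λ x → sumᴾ (map (F x) ys)) xs) ≈ sumᴾ (map (λ y → sumᴾ (map (λ x → F x y) xs)) ys)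
sumᴾ-comm xs ys F = mk≈ λ μ → begin
  coeff (sumᴾ (map (λ x → sumᴾ (map (F x) ys)) xs)) μ    ≡⟨ coeff-sumᴾ _ xs μ ⟩
  ∑[ x ∈ xs ] coeff (sumᴾ (map (F x) ys)) μ              ≡⟨ ∑-cong xs (λ x → coeff-sumᴾ (F x) ys μ) ⟩
  ∑[ x ∈ xs ] ∑[ y ∈ ys ] coeff (F x y) μ                ≡⟨ ∑-comm xs ys _ ⟩
  ∑[ y ∈ ys ] ∑[ x ∈ xs ] coeff (F x y) μ                ≡⟨ ∑-cong ys (λ y → coeff-sumᴾ (λ x → F x y) xs μ) ⟨
  ∑[ y ∈ ys ] coeff (sumᴾ (map (λ x → F x y) xs)) μ      ≡⟨ coeff-sumᴾ _ ys μ ⟨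
  coeff (sumᴾ (map (λ y → sumᴾ (map (λ x → F x y) xs)) ys)) μ ∎
  where
  open ≡-Reasoning

sumᴾ-upTo-cong : ∀ n {F G : ℕ → Poly} → (∀ i → i < n → F i ≈ G i) → sumᴾ (map F (upTo n)) ≈ sumᴾ (map G (upTo n))
sumᴾ-upTo-cong n {F} {G} e = mk≈ λ μ →
  trans (coeff-sumᴾ F (upTo n) μ) (trans (∑-upTo-cong n (λ i i<n → ≈⇒≈ᴾ (e i i<n) μ)) (sym (coeff-sumᴾ G (upTo n) μ)))

sumᴾ-upTo-zero : ∀ n {F : ℕ → Poly} → (∀ i → i < n → F i ≈ 0ᴾ) → sumᴾ (map F (upTo n)) ≈ 0ᴾ
sumᴾ-upTo-zero n {F} e = mk≈ λ μ → trans (coeff-sumᴾ F (upTo n) μ) (∑-upTo-zero n (λ i i<n → ≈⇒≈ᴾ (e i i<n) μ))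

sumᴾ-upTo-single : ∀ n a {F : ℕ → Poly} → a < n → (∀ i → i < n → i ≢ a → F i ≈ 0ᴾ) → sumᴾ (map F (upTo n)) ≈ F a
sumᴾ-upTo-single n a {F} a<n e = mk≈ λ μ →
  trans (coeff-sumᴾ F (upTo n) μ) (∑-upTo-single n a (λ i → coeff (F i) μ) a<n (λ i i<n i≢a → ≈⇒≈ᴾ (e i i<n i≢a) μ))

sumᴾ-upTo-truncate : ∀ m n {F : ℕ → Poly} → m ≤ n → (∀ i → m ≤ i → i < n → F i ≈ 0ᴾ) →
                     sumᴾ (map F (upTo n)) ≈ sumᴾ (map F (upTo m))
sumᴾ-upTo-truncate m n {F} m≤n e = mk≈ λ μ → trans (coeff-sumᴾ F (upTo n) μ)
  (trans (∑-upTo-truncate m n (λ i → coeff (F i) μ) m≤n (λ i m≤i i<n → ≈⇒≈ᴾ (e i m≤i i<n) μ)) (sym (coeff-sumᴾ F (upTo m) μ)))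

sumᴾ-upTo-sucˡ : ∀ n {F : ℕ → Poly} → F 0 ≈ 0ᴾ → sumᴾ (map F (upTo (suc n))) ≈ sumᴾ (map (F ∘ suc) (upTo n))
sumᴾ-upTo-sucˡ n {F} F0≈0 = mk≈ λ μ → begin
  coeff (sumᴾ (map F (upTo (suc n)))) μ                  ≡⟨ coeff-sumᴾ F (upTo (suc n)) μ ⟩
  ∑[ i ∈ upTo (suc n) ] coeff (F i) μ                    ≡⟨ ∑-upTo-sucˡ n (λ i → coeff (F i) μ) ⟩
  coeff (F 0) μ + ∑[ i ∈ upTo n ] coeff (F (suc i)) μ    ≡⟨ cong (_+ ∑[ i ∈ upTo n ] coeff (F (suc i)) μ) (≈⇒≈ᴾ F0≈0 μ) ⟩
  0ℚ + ∑[ i ∈ upTo n ] coeff (F (suc i)) μ               ≡⟨ ℚ.+-identityˡ _ ⟩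
  ∑[ i ∈ upTo n ] coeff (F (suc i)) μ                    ≡⟨ coeff-sumᴾ (F ∘ suc) (upTo n) μ ⟨
  coeff (sumᴾ (map (F ∘ suc) (upTo n))) μ                ∎
  where
  open ≡-Reasoning

sumᴾ-upTo-reverse : ∀ n (F : ℕ → Poly) → sumᴾ (map F (upTo n)) ≈ sumᴾ (map (λ i → F (n ∸ suc i)) (upTo n))
sumᴾ-upTo-reverse n F = mk≈ λ μ → trans (coeff-sumᴾ F (upTo n) μ)
  (trans (∑-upTo-reverse n (λ i → coeff (F i) μ)) (sym (coeff-sumᴾ (λ i → F (n ∸ suc i)) (upTo n) μ)))


whenᴾ : Dec X → Poly → Poly
whenᴾ d f = if does d then f else 0ᴾ

coeff-whenᴾ : (d : Dec X) (f : Poly) (μ : Monomial) → coeff (whenᴾ d f) μ ≡ when d (coeff f μ)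
coeff-whenᴾ (yes _) f μ = refl
coeff-whenᴾ (no _)  f μ = refl

whenᴾ-cong : (d : Dec X) {f g : Poly} → f ≈ g → whenᴾ d f ≈ whenᴾ d g
whenᴾ-cong (yes _) f≈g = f≈g
whenᴾ-cong (no _)  _   = ≈-refl

whenᴾ-⇔ : (d : Dec X) (e : Dec Y) (f : Poly) → (X → Y) → (Y → X) → whenᴾ d f ≈ whenᴾ e f
whenᴾ-⇔ d e f to from = mk≈ λ μ → trans (coeff-whenᴾ d f μ) (trans (when-⇔ d e _ to from) (sym (coeff-whenᴾ e f μ)))

whenᴾ-yes : (d : Dec X) (f : Poly) → X → whenᴾ d f ≡ f
whenᴾ-yes (yes _) f _ = refl
whenᴾ-yes (no ¬p) f p = ⊥-elim (¬p p)

whenᴾ-no : (d : Dec X) (f : Poly) → ¬ X → whenᴾ d f ≡ 0ᴾ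
whenᴾ-no (yes p) f ¬p = ⊥-elim (¬p p)
whenᴾ-no (no _)  f _  = refl

whenᴾ-0ᴾ : (d : Dec X) → whenᴾ d 0ᴾ ≡ 0ᴾ
whenᴾ-0ᴾ (yes _) = refl
whenᴾ-0ᴾ (no _)  = refl

*ᴾ-whenᴾ : (d : Dec X) (f g : Poly) → f *ᴾ whenᴾ d g ≈ whenᴾ d (f *ᴾ g)
*ᴾ-whenᴾ (yes _) f g = ≈-refl
*ᴾ-whenᴾ (no _)  f g = ≈-reflexive (*ᴾ-zeroʳ f)

-- Power series over Λ

infix 4 _≈ˢ_
record _≈ˢ_ (S T : Series) : Set where
  constructor mk≈ˢ
  field ≈ˢ-at : ∀ N → S N ≈ T N
open _≈ˢ_ public

≈ˢ-refl : ∀ {S} → S ≈ˢ S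
≈ˢ-refl = mk≈ˢ λ _ → ≈-refl

≈ˢ-sym : ∀ {S T} → S ≈ˢ T → T ≈ˢ S
≈ˢ-sym (mk≈ˢ e) = mk≈ˢ λ N → ≈-sym (e N)

≈ˢ-trans : ∀ {S T U} → S ≈ˢ T → T ≈ˢ U → S ≈ˢ U
≈ˢ-trans (mk≈ˢ e) (mk≈ˢ e′) = mk≈ˢ λ N → ≈-trans (e N) (e′ N)

≈ˢ-setoid : Setoid _ _
≈ˢ-setoid = record { Carrier = Series ; _≈_ = _≈ˢ_
                   ; isEquivalence = record { refl = ≈ˢ-refl ; sym = ≈ˢ-sym ; trans = ≈ˢ-trans } }

module ≈ˢ-Reasoning = Relation.Binary.Reasoning.Setoid ≈ˢ-setoid

0ˢ : Series
0ˢ _ = 0ᴾ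

infixl 6 _+ˢ_
_+ˢ_ : Series → Series → Series
(S +ˢ T) N = S N +ᴾ T N

scaleˢ : ℚ → Series → Series
scaleˢ a S N = scale a (S N)

Σˢ : List I → (I → Series) → Series
Σˢ xs F N = sumᴾ (map (λ x → F x N) xs)

-- The Euler operator t d/dt.
θ : Series → Series
θ S N = scale (ι N) (S N)

+ˢ-cong : ∀ {S S′ T T′} → S ≈ˢ S′ → T ≈ˢ T′ → S +ˢ T ≈ˢ S′ +ˢ T′
+ˢ-cong (mk≈ˢ e) (mk≈ˢ e′) = mk≈ˢ λ N → +ᴾ-cong (e N) (e′ N)

scaleˢ-cong : ∀ a {S T} → S ≈ˢ T → scaleˢ a S ≈ˢ scaleˢ a T
scaleˢ-cong a (mk≈ˢ e) = mk≈ˢ λ N → scale-cong a (e N)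

Σˢ-cong : (xs : List I) {F G : I → Series} → (∀ x → F x ≈ˢ G x) → Σˢ xs F ≈ˢ Σˢ xs G
Σˢ-cong xs e = mk≈ˢ λ N → sumᴾ-cong xs (λ x → ≈ˢ-at (e x) N)

θ-cong : ∀ {S T} → S ≈ˢ T → θ S ≈ˢ θ T
θ-cong (mk≈ˢ e) = mk≈ˢ λ N → scale-cong (ι N) (e N)

*ˢ-cong : ∀ {S S′ T T′} → S ≈ˢ S′ → T ≈ˢ T′ → S *ˢ T ≈ˢ S′ *ˢ T′
*ˢ-cong (mk≈ˢ e) (mk≈ˢ e′) = mk≈ˢ λ N → sumᴾ-cong (upTo (suc N)) (λ i → *ᴾ-cong (e i) (e′ (N ∸ i)))

*ˢ-comm : ∀ S T → S *ˢ T ≈ˢ T *ˢ S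
*ˢ-comm S T = mk≈ˢ λ N → mk≈ λ μ → begin
  coeff ((S *ˢ T) N) μ                                      ≡⟨ coeff-sumᴾ (λ i → S i *ᴾ T (N ∸ i)) (upTo (suc N)) μ ⟩
  ∑[ i ∈ upTo (suc N) ] coeff (S i *ᴾ T (N ∸ i)) μ          ≡⟨ ∑-upTo-reverse (suc N) (λ i → coeff (S i *ᴾ T (N ∸ i)) μ) ⟩
  ∑[ i ∈ upTo (suc N) ] coeff (S (N ∸ i) *ᴾ T (N ∸ (N ∸ i))) μ
                                                            ≡⟨ ∑-upTo-cong (suc N) (λ i i<1+N → commute N i (ℕ.≤-pred i<1+N) μ) ⟩
  ∑[ i ∈ upTo (suc N) ] coeff (T i *ᴾ S (N ∸ i)) μ          ≡⟨ coeff-sumᴾ (λ i → T i *ᴾ S (N ∸ i)) (upTo (suc N)) μ ⟨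
  coeff ((T *ˢ S) N) μ                                      ∎
  where
  open ≡-Reasoning
  commute : ∀ N i → i ≤ N → ∀ μ → coeff (S (N ∸ i) *ᴾ T (N ∸ (N ∸ i))) μ ≡ coeff (T i *ᴾ S (N ∸ i)) μ
  commute N i i≤N μ rewrite ℕ.m∸[m∸n]≡n i≤N = ≈⇒≈ᴾ (*ᴾ-comm (S (N ∸ i)) (T i)) μ

*ˢ-assoc : ∀ S T U → (S *ˢ T) *ˢ U ≈ˢ S *ˢ (T *ˢ U)
*ˢ-assoc S T U = mk≈ˢ λ N → mk≈ λ μ → begin
  coeff (((S *ˢ T) *ˢ U) N) μ
    ≡⟨ coeff-sumᴾ (λ i → (S *ˢ T) i *ᴾ U (N ∸ i)) (upTo (suc N)) μ ⟩
  ∑[ i ∈ upTo (suc N) ] coeff ((S *ˢ T) i *ᴾ U (N ∸ i)) μ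
    ≡⟨ ∑-upTo-cong (suc N) (λ i i<1+N → left N i (ℕ.≤-pred i<1+N) μ) ⟩
  ∑[ i ∈ upTo (suc N) ] ∑[ j ∈ upTo (suc i) ] G N μ j (i ∸ j)
    ≡⟨ ∑-upTo-triangle N (G N μ) ⟩
  ∑[ j ∈ upTo (suc N) ] ∑[ l ∈ upTo (suc (N ∸ j)) ] G N μ j l
    ≡⟨ ∑-cong (upTo (suc N)) (λ j → right N j μ) ⟨
  ∑[ j ∈ upTo (suc N) ] coeff (S j *ᴾ (T *ˢ U) (N ∸ j)) μ
    ≡⟨ coeff-sumᴾ (λ j → S j *ᴾ (T *ˢ U) (N ∸ j)) (upTo (suc N)) μ ⟨
  coeff ((S *ˢ (T *ˢ U)) N) μ ∎
  where
  open ≡-Reasoning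
  G : ℕ → Monomial → ℕ → ℕ → ℚ
  G N μ j l = coeff (S j *ᴾ (T l *ᴾ U (N ∸ j ∸ l))) μ
  left : ∀ N i → i ≤ N → ∀ μ → coeff ((S *ˢ T) i *ᴾ U (N ∸ i)) μ ≡ ∑[ j ∈ upTo (suc i) ] G N μ j (i ∸ j)
  left N i i≤N μ = begin
    coeff ((S *ˢ T) i *ᴾ U (N ∸ i)) μ                                 ≡⟨ cong (λ h → coeff h μ) (*ᴾ-distribʳ-sumᴾ (upTo (suc i)) (λ j → S j *ᴾ T (i ∸ j)) (U (N ∸ i))) ⟩
    coeff (sumᴾ (map (λ j → (S j *ᴾ T (i ∸ j)) *ᴾ U (N ∸ i)) (upTo (suc i)))) μ
                                                                      ≡⟨ coeff-sumᴾ (λ j → (S j *ᴾ T (i ∸ j)) *ᴾ U (N ∸ i)) (upTo (suc i)) μ ⟩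
    ∑[ j ∈ upTo (suc i) ] coeff ((S j *ᴾ T (i ∸ j)) *ᴾ U (N ∸ i)) μ   ≡⟨ ∑-upTo-cong (suc i) (λ j j<1+i → reassociate j (ℕ.≤-pred j<1+i)) ⟩
    ∑[ j ∈ upTo (suc i) ] G N μ j (i ∸ j)                             ∎
    where
    reassociate : ∀ j → j ≤ i → coeff ((S j *ᴾ T (i ∸ j)) *ᴾ U (N ∸ i)) μ ≡ G N μ j (i ∸ j)
    reassociate j j≤i rewrite ℕ.∸-+-assoc N j (i ∸ j) | ℕ.m+[n∸m]≡n j≤i = ≈⇒≈ᴾ (*ᴾ-assoc (S j) _ _) μ
  right : ∀ N j μ → coeff (S j *ᴾ (T *ˢ U) (N ∸ j)) μ ≡ ∑[ l ∈ upTo (suc (N ∸ j)) ] G N μ j l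
  right N j μ = trans (≈⇒≈ᴾ (*ᴾ-distribˡ-sumᴾ (upTo (suc (N ∸ j))) (λ l → T l *ᴾ U (N ∸ j ∸ l)) (S j)) μ) (coeff-sumᴾ (λ l → S j *ᴾ (T l *ᴾ U (N ∸ j ∸ l))) (upTo (suc (N ∸ j))) μ)

*ˢ-distribˡ-+ˢ : ∀ S T U → S *ˢ (T +ˢ U) ≈ˢ S *ˢ T +ˢ S *ˢ U
*ˢ-distribˡ-+ˢ S T U = mk≈ˢ λ N →
  ≈-trans (sumᴾ-cong (upTo (suc N)) (λ i → *ᴾ-distribˡ-+ᴾ (S i) (T (N ∸ i)) (U (N ∸ i))))
          (sumᴾ-distrib-+ᴾ (upTo (suc N)) (λ i → S i *ᴾ T (N ∸ i)) (λ i → S i *ᴾ U (N ∸ i)))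

*ˢ-distribˡ-Σˢ : (xs : List I) (F : I → Series) (U : Series) → U *ˢ Σˢ xs F ≈ˢ Σˢ xs (λ x → U *ˢ F x)
*ˢ-distribˡ-Σˢ xs F U = mk≈ˢ λ N →
  ≈-trans (sumᴾ-cong (upTo (suc N)) (λ i → *ᴾ-distribˡ-sumᴾ xs (λ x → F x (N ∸ i)) (U i)))
          (sumᴾ-comm (upTo (suc N)) xs (λ i x → U i *ᴾ F x (N ∸ i)))

*ˢ-scaleˢ : ∀ a S T → S *ˢ scaleˢ a T ≈ˢ scaleˢ a (S *ˢ T)
*ˢ-scaleˢ a S T = mk≈ˢ λ N →
  ≈-trans (sumᴾ-cong (upTo (suc N)) (λ i → scale-*ᴾʳ a (S i) (T (N ∸ i)))) (≈-sym (scale-sumᴾ a (upTo (suc N)) (λ i → S i *ᴾ T (N ∸ i))))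

*ˢ-zeroˡ : ∀ {S} T → S ≈ˢ 0ˢ → S *ˢ T ≈ˢ 0ˢ
*ˢ-zeroˡ T (mk≈ˢ e) = mk≈ˢ λ N → sumᴾ-zero (upTo (suc N)) (λ i → *ᴾ-congʳ (T (N ∸ i)) (e i))

*ˢ-zeroʳ : ∀ S {T} → T ≈ˢ 0ˢ → S *ˢ T ≈ˢ 0ˢ
*ˢ-zeroʳ S {T} T≈0 = ≈ˢ-trans (*ˢ-comm S T) (*ˢ-zeroˡ S T≈0)

Σˢ-distrib-+ˢ : (xs : List I) (F G : I → Series) → Σˢ xs (λ x → F x +ˢ G x) ≈ˢ Σˢ xs F +ˢ Σˢ xs G
Σˢ-distrib-+ˢ xs F G = mk≈ˢ λ N → sumᴾ-distrib-+ᴾ xs (λ x → F x N) (λ x → G x N)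

Σˢ-zero : (xs : List I) (F : I → Series) → (∀ x → F x ≈ˢ 0ˢ) → Σˢ xs F ≈ˢ 0ˢ
Σˢ-zero xs F e = mk≈ˢ λ N → sumᴾ-zero xs (λ x → ≈ˢ-at (e x) N)

Σˢ-upTo-single : ∀ n a (F : ℕ → Series) → a < n → (∀ i → i < n → i ≢ a → F i ≈ˢ 0ˢ) → Σˢ (upTo n) F ≈ˢ F a
Σˢ-upTo-single n a F a<n e = mk≈ˢ λ N → sumᴾ-upTo-single n a a<n (λ i i<n i≢a → ≈ˢ-at (e i i<n i≢a) N)

scaleˢ-Σˢ : ∀ a (xs : List I) (F : I → Series) → scaleˢ a (Σˢ xs F) ≈ˢ Σˢ xs (λ x → scaleˢ a (F x))
scaleˢ-Σˢ a xs F = mk≈ˢ λ N → scale-sumᴾ a xs (λ x → F x N)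

θ-+ˢ : ∀ S T → θ (S +ˢ T) ≈ˢ θ S +ˢ θ T
θ-+ˢ S T = mk≈ˢ λ N → scale-+ᴾ (ι N) (S N) (T N)

θ-scaleˢ : ∀ c S → θ (scaleˢ c S) ≈ˢ scaleˢ c (θ S)
θ-scaleˢ c S = mk≈ˢ λ N → ≈-trans (scale-scale (ι N) c (S N))
  (≈-trans (≈-reflexive (cong (λ x → scale x (S N)) (ℚ.*-comm (ι N) c))) (≈-sym (scale-scale c (ι N) (S N))))

θ-1ˢ : θ 1ˢ ≈ˢ 0ˢ
θ-1ˢ = mk≈ˢ λ where
  zero    → scale-zero 1ᴾ
  (suc N) → ≈-refl

θ-*ˢ : ∀ S T → θ (S *ˢ T) ≈ˢ θ S *ˢ T +ˢ S *ˢ θ T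
θ-*ˢ S T = mk≈ˢ λ N → mk≈ λ μ → begin
  coeff (scale (ι N) ((S *ˢ T) N)) μ
    ≡⟨ coeff-scale (ι N) ((S *ˢ T) N) μ ⟩
  ι N * coeff ((S *ˢ T) N) μ
    ≡⟨ cong (ι N *_) (coeff-sumᴾ (λ i → S i *ᴾ T (N ∸ i)) (upTo (suc N)) μ) ⟩
  ι N * ∑[ i ∈ upTo (suc N) ] c N μ i
    ≡⟨ *-distribˡ-∑ (upTo (suc N)) (ι N) (c N μ) ⟩
  ∑[ i ∈ upTo (suc N) ] (ι N * c N μ i)
    ≡⟨ ∑-upTo-cong (suc N) (λ i i<1+N → split N μ i (ℕ.≤-pred i<1+N)) ⟩
  ∑[ i ∈ upTo (suc N) ] (ι i * c N μ i + ι (N ∸ i) * c N μ i)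
    ≡⟨ ∑-distrib-+ (upTo (suc N)) (λ i → ι i * c N μ i) (λ i → ι (N ∸ i) * c N μ i) ⟩
  ∑[ i ∈ upTo (suc N) ] (ι i * c N μ i) + ∑[ i ∈ upTo (suc N) ] (ι (N ∸ i) * c N μ i)
    ≡⟨ cong₂ _+_ (∑-cong (upTo (suc N)) (λ i → θ-left N μ i)) (∑-cong (upTo (suc N)) (λ i → θ-right N μ i)) ⟨
  ∑[ i ∈ upTo (suc N) ] coeff (θ S i *ᴾ T (N ∸ i)) μ + ∑[ i ∈ upTo (suc N) ] coeff (S i *ᴾ θ T (N ∸ i)) μ
    ≡⟨ cong₂ _+_ (coeff-sumᴾ (λ i → θ S i *ᴾ T (N ∸ i)) (upTo (suc N)) μ)
                 (coeff-sumᴾ (λ i → S i *ᴾ θ T (N ∸ i)) (upTo (suc N)) μ) ⟨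
  coeff ((θ S *ˢ T) N) μ + coeff ((S *ˢ θ T) N) μ
    ≡⟨ coeff-++ ((θ S *ˢ T) N) _ μ ⟨
  coeff ((θ S *ˢ T +ˢ S *ˢ θ T) N) μ ∎
  where
  open ≡-Reasoning
  c : ℕ → Monomial → ℕ → ℚ
  c N μ i = coeff (S i *ᴾ T (N ∸ i)) μ
  split : ∀ N μ i → i ≤ N → ι N * c N μ i ≡ ι i * c N μ i + ι (N ∸ i) * c N μ i
  split N μ i i≤N = trans (cong (λ k → ι k * c N μ i) (sym (ℕ.m+[n∸m]≡n i≤N)))
                          (trans (cong (_* c N μ i) (ι-+ i (N ∸ i))) (ℚ.*-distribʳ-+ (c N μ i) (ι i) (ι (N ∸ i))))
  θ-left : ∀ N μ i → coeff (θ S i *ᴾ T (N ∸ i)) μ ≡ ι i * c N μ i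
  θ-left N μ i = trans (≈⇒≈ᴾ (scale-*ᴾˡ (ι i) (S i) (T (N ∸ i))) μ) (coeff-scale (ι i) (S i *ᴾ T (N ∸ i)) μ)
  θ-right : ∀ N μ i → coeff (S i *ᴾ θ T (N ∸ i)) μ ≡ ι (N ∸ i) * c N μ i
  θ-right N μ i = trans (≈⇒≈ᴾ (scale-*ᴾʳ (ι (N ∸ i)) (S i) (T (N ∸ i))) μ) (coeff-scale (ι (N ∸ i)) (S i *ᴾ T (N ∸ i)) μ)

-- Partial derivatives ∂/∂pₖ

mulP : ℕ → Poly → Poly
mulP a = map (λ t → (proj₁ t , a ∷ proj₂ t))

∂ₘ : ℕ → Monomial → Poly
∂ₘ k []      = 0ᴾ
∂ₘ k (a ∷ m) = whenᴾ (a ≟ k) (pλ m) +ᴾ mulP a (∂ₘ k m)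

∂ : ℕ → Poly → Poly
∂ k = concatMap (λ t → scale (proj₁ t) (∂ₘ k (proj₂ t)))

coeff-mulP : ∀ {a μ ν} g → μ ↭ a ∷ ν → coeff (mulP a g) μ ≡ coeff g ν
coeff-mulP {a} {μ} {ν} g μ↭aν = begin
  coeff (mulP a g) μ                              ≡⟨ coeff-∑ (mulP a g) μ ⟩
  ∑ (mulP a g) (coeffₜ μ)                         ≡⟨ ∑-map _ g (coeffₜ μ) ⟩
  ∑[ t ∈ g ] when (a ∷ proj₂ t ↭? μ) (proj₁ t)    ≡⟨ ∑-cong g (λ t → when-⇔ (a ∷ proj₂ t ↭? μ) (proj₂ t ↭? ν) _
                                                        (λ p → drop-∷ (↭-trans p μ↭aν)) (λ p → ↭-trans (prep a p) (↭-sym μ↭aν))) ⟩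
  ∑ g (coeffₜ ν)                                  ≡⟨ coeff-∑ g ν ⟨
  coeff g ν                                       ∎
  where
  open ≡-Reasoning

coeff-mulP-∉ : ∀ {a μ} g → a ∉ μ → coeff (mulP a g) μ ≡ 0ℚ
coeff-mulP-∉ {a} {μ} g a∉μ = begin
  coeff (mulP a g) μ                              ≡⟨ coeff-∑ (mulP a g) μ ⟩
  ∑ (mulP a g) (coeffₜ μ)                         ≡⟨ ∑-map _ g (coeffₜ μ) ⟩
  ∑[ t ∈ g ] when (a ∷ proj₂ t ↭? μ) (proj₁ t)    ≡⟨ ∑-cong g (λ t → when-no (a ∷ proj₂ t ↭? μ) (a∉μ ∘ ∷↭⇒∈)) ⟩
  ∑[ t ∈ g ] 0ℚ                                   ≡⟨ ∑-zero g ⟩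
  0ℚ                                              ∎
  where
  open ≡-Reasoning

private
  ∂ₘ-step-∈ : ∀ k a m {μ ν} → μ ↭ a ∷ ν → Dec (a ≡ k) →
              when (a ≟ k) (when (m ↭? μ) 1ℚ) + when (m ↭? k ∷ ν) (ι (suc (mult k ν))) ≡
              when (a ∷ m ↭? k ∷ μ) (ι (suc (mult k μ)))
  ∂ₘ-step-∈ k .k m {μ} {ν} μ↭kν (yes refl) = begin
    when (k ≟ k) (when (m ↭? μ) 1ℚ) + when (m ↭? k ∷ ν) (ι (suc (mult k ν)))
                                                                     ≡⟨ cong₂ _+_ (when-yes (k ≟ k) refl)
                                                                          (when-⇔ (m ↭? k ∷ ν) (m ↭? μ) _ (λ p → ↭-trans p (↭-sym μ↭kν)) (λ p → ↭-trans p μ↭kν)) ⟩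
    when (m ↭? μ) 1ℚ + when (m ↭? μ) (ι (suc (mult k ν)))            ≡⟨ when-+ (m ↭? μ) 1ℚ _ ⟨
    when (m ↭? μ) (1ℚ + ι (suc (mult k ν)))                          ≡⟨ cong (when (m ↭? μ)) (ι-+ 1 (suc (mult k ν))) ⟨
    when (m ↭? μ) (ι (suc (suc (mult k ν))))                         ≡⟨ cong (λ x → when (m ↭? μ) (ι (suc x)))
                                                                          (trans (mult-↭ k μ↭kν) (mult-∷-≡ k ν)) ⟨
    when (m ↭? μ) (ι (suc (mult k μ)))                               ≡⟨ when-⇔ (m ↭? μ) (k ∷ m ↭? k ∷ μ) _ (prep k) drop-∷ ⟩
    when (k ∷ m ↭? k ∷ μ) (ι (suc (mult k μ)))                       ∎
    where
    open ≡-Reasoning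
  ∂ₘ-step-∈ k a m {μ} {ν} μ↭aν (no a≢k) = begin
    when (a ≟ k) (when (m ↭? μ) 1ℚ) + when (m ↭? k ∷ ν) (ι (suc (mult k ν)))
                                                                     ≡⟨ cong (_+ when (m ↭? k ∷ ν) (ι (suc (mult k ν)))) (when-no (a ≟ k) a≢k) ⟩
    0ℚ + when (m ↭? k ∷ ν) (ι (suc (mult k ν)))                      ≡⟨ ℚ.+-identityˡ _ ⟩
    when (m ↭? k ∷ ν) (ι (suc (mult k ν)))                           ≡⟨ cong (λ x → when (m ↭? k ∷ ν) (ι (suc x)))
                                                                          (trans (mult-↭ k μ↭aν) (mult-∷-≢ ν a≢k)) ⟨
    when (m ↭? k ∷ ν) (ι (suc (mult k μ)))                           ≡⟨ when-⇔ (m ↭? k ∷ ν) (a ∷ m ↭? k ∷ μ) _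
                                                                          (λ p → ↭-trans (prep a p) (↭-sym kμ↭akν)) (λ p → drop-∷ (↭-trans p kμ↭akν)) ⟩
    when (a ∷ m ↭? k ∷ μ) (ι (suc (mult k μ)))                       ∎
    where
    open ≡-Reasoning
    kμ↭akν : k ∷ μ ↭ a ∷ k ∷ ν
    kμ↭akν = ↭-trans (prep k μ↭aν) (swap k a ↭-refl)

  ∂ₘ-step-∉ : ∀ k a m {μ} → a ∉ μ → Dec (a ≡ k) →
              when (a ≟ k) (when (m ↭? μ) 1ℚ) + 0ℚ ≡ when (a ∷ m ↭? k ∷ μ) (ι (suc (mult k μ)))
  ∂ₘ-step-∉ k .k m {μ} k∉μ (yes refl) = begin
    when (k ≟ k) (when (m ↭? μ) 1ℚ) + 0ℚ                             ≡⟨ trans (ℚ.+-identityʳ _) (when-yes (k ≟ k) refl) ⟩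
    when (m ↭? μ) (ι 1)                                              ≡⟨ cong (λ x → when (m ↭? μ) (ι (suc x))) (∉⇒mult≡0 μ k∉μ) ⟨
    when (m ↭? μ) (ι (suc (mult k μ)))                               ≡⟨ when-⇔ (m ↭? μ) (k ∷ m ↭? k ∷ μ) _ (prep k) drop-∷ ⟩
    when (k ∷ m ↭? k ∷ μ) (ι (suc (mult k μ)))                       ∎
    where
    open ≡-Reasoning
  ∂ₘ-step-∉ k a m {μ} a∉μ (no a≢k) =
    trans (cong (_+ 0ℚ) (when-no (a ≟ k) a≢k)) (sym (when-no (a ∷ m ↭? k ∷ μ) a∉kμ))
    where
    a∉kμ : ¬ (a ∷ m ↭ k ∷ μ)
    a∉kμ p with ∷↭⇒∈ p
    ... | here a≡k  = a≢k a≡k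
    ... | there a∈μ = a∉μ a∈μ

coeff-∂ₘ : ∀ k m μ → coeff (∂ₘ k m) μ ≡ when (m ↭? k ∷ μ) (ι (suc (mult k μ)))
coeff-∂ₘ k []      μ = sym (when-no ([] ↭? k ∷ μ) (λ p → ¬x∷xs↭[] (↭-sym p)))
coeff-∂ₘ k (a ∷ m) μ = begin
  coeff (whenᴾ (a ≟ k) (pλ m) +ᴾ mulP a (∂ₘ k m)) μ            ≡⟨ coeff-++ (whenᴾ (a ≟ k) (pλ m)) _ μ ⟩
  coeff (whenᴾ (a ≟ k) (pλ m)) μ + coeff (mulP a (∂ₘ k m)) μ   ≡⟨ cong (_+ coeff (mulP a (∂ₘ k m)) μ)
                                                                       (trans (coeff-whenᴾ (a ≟ k) (pλ m) μ) (cong (when (a ≟ k)) (coeff-pλ m μ))) ⟩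
  when (a ≟ k) (when (m ↭? μ) 1ℚ) + coeff (mulP a (∂ₘ k m)) μ  ≡⟨ by-membership (a ∈? μ) ⟩
  when (a ∷ m ↭? k ∷ μ) (ι (suc (mult k μ)))                    ∎
  where
  open ≡-Reasoning
  by-membership : Dec (a ∈ μ) →
                  when (a ≟ k) (when (m ↭? μ) 1ℚ) + coeff (mulP a (∂ₘ k m)) μ ≡ when (a ∷ m ↭? k ∷ μ) (ι (suc (mult k μ)))
  by-membership (yes a∈μ) = let ν , μ↭aν = ∈⇒↭∷ a∈μ in
    trans (cong (when (a ≟ k) (when (m ↭? μ) 1ℚ) +_) (trans (coeff-mulP (∂ₘ k m) μ↭aν) (coeff-∂ₘ k m ν)))
          (∂ₘ-step-∈ k a m μ↭aν (a ≟ k))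
  by-membership (no a∉μ)  =
    trans (cong (when (a ≟ k) (when (m ↭? μ) 1ℚ) +_) (coeff-mulP-∉ (∂ₘ k m) a∉μ)) (∂ₘ-step-∉ k a m a∉μ (a ≟ k))

coeff-∂ : ∀ k f μ → coeff (∂ k f) μ ≡ ι (suc (mult k μ)) * coeff f (k ∷ μ)
coeff-∂ k f μ = begin
  coeff (∂ k f) μ                                                      ≡⟨ coeff-sumᴾ (λ t → scale (proj₁ t) (∂ₘ k (proj₂ t))) f μ ⟩
  ∑[ t ∈ f ] coeff (scale (proj₁ t) (∂ₘ k (proj₂ t))) μ                ≡⟨ ∑-cong f term ⟩
  ∑[ t ∈ f ] (ι (suc (mult k μ)) * coeffₜ (k ∷ μ) t)                   ≡⟨ *-distribˡ-∑ f (ι (suc (mult k μ))) (coeffₜ (k ∷ μ)) ⟨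
  ι (suc (mult k μ)) * ∑ f (coeffₜ (k ∷ μ))                            ≡⟨ cong (ι (suc (mult k μ)) *_) (coeff-∑ f (k ∷ μ)) ⟨
  ι (suc (mult k μ)) * coeff f (k ∷ μ)                                 ∎
  where
  open ≡-Reasoning
  term : ∀ t → coeff (scale (proj₁ t) (∂ₘ k (proj₂ t))) μ ≡ ι (suc (mult k μ)) * coeffₜ (k ∷ μ) t
  term (c , m) = begin
    coeff (scale c (∂ₘ k m)) μ                       ≡⟨ coeff-scale c (∂ₘ k m) μ ⟩
    c * coeff (∂ₘ k m) μ                             ≡⟨ cong (c *_) (coeff-∂ₘ k m μ) ⟩
    c * when (m ↭? k ∷ μ) (ι (suc (mult k μ)))       ≡⟨ *-when (m ↭? k ∷ μ) c _ ⟩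
    when (m ↭? k ∷ μ) (c * ι (suc (mult k μ)))       ≡⟨ cong (when (m ↭? k ∷ μ)) (ℚ.*-comm c _) ⟩
    when (m ↭? k ∷ μ) (ι (suc (mult k μ)) * c)       ≡⟨ *-when (m ↭? k ∷ μ) (ι (suc (mult k μ))) c ⟨
    ι (suc (mult k μ)) * when (m ↭? k ∷ μ) c         ∎

∂-+ᴾ : ∀ k f g → ∂ k (f +ᴾ g) ≡ ∂ k f +ᴾ ∂ k g
∂-+ᴾ k f g = concatMap-++ _ f g

∂-sumᴾ : ∀ k (F : I → Poly) xs → ∂ k (sumᴾ (map F xs)) ≡ sumᴾ (map (∂ k ∘ F) xs)
∂-sumᴾ k F []       = refl
∂-sumᴾ k F (x ∷ xs) = trans (∂-+ᴾ k (F x) _) (cong (∂ k (F x) +ᴾ_) (∂-sumᴾ k F xs))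

-- Substitution f ↦ f(A) and the chain rule

AllVars : (ℕ → Set) → Poly → Set
AllVars Q = All (All Q ∘ proj₂)

module Substitution (A : Series) where

  P : ℕ → Series
  P k = pS k A

  Π : Monomial → Series
  Π m = prodˢ (map P m)

  Φ : Poly → Series
  Φ f = substP f A

  Π-↭ : ∀ {m m′} → m ↭ m′ → Π m ≈ˢ Π m′
  Π-↭ ↭.refl       = ≈ˢ-refl
  Π-↭ (prep x p)   = *ˢ-cong (≈ˢ-refl {P x}) (Π-↭ p)
  Π-↭ (swap {xs} {ys} x y p) = begin
    P x *ˢ (P y *ˢ Π xs)   ≈⟨ *ˢ-assoc (P x) (P y) (Π xs) ⟨
    (P x *ˢ P y) *ˢ Π xs   ≈⟨ *ˢ-cong (*ˢ-comm (P x) (P y)) (Π-↭ p) ⟩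
    (P y *ˢ P x) *ˢ Π ys   ≈⟨ *ˢ-assoc (P y) (P x) (Π ys) ⟩
    P y *ˢ (P x *ˢ Π ys)   ∎
    where
    open ≈ˢ-Reasoning
  Π-↭ (↭.trans p q) = ≈ˢ-trans (Π-↭ p) (Π-↭ q)

  coeff-Φ : ∀ f N μ → coeff (Φ f N) μ ≡ linear (λ m → coeff (Π m N) μ) f
  coeff-Φ f N μ = ≡.trans (coeff-sumᴾ _ f μ) (∑-cong f (λ t → coeff-scale (proj₁ t) (Π (proj₂ t) N) μ))

  Φ-cong : ∀ {f g} → f ≈ g → Φ f ≈ˢ Φ g
  Φ-cong {f} {g} f≈g = mk≈ˢ λ N → mk≈ λ μ →
    ≡.trans (coeff-Φ f N μ) (≡.trans (linear-cong (λ p → ≈⇒≈ᴾ (≈ˢ-at (Π-↭ p) N) μ) f≈g) (sym (coeff-Φ g N μ)))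

  Φ-+ᴾ : ∀ f g → Φ (f +ᴾ g) ≈ˢ Φ f +ˢ Φ g
  Φ-+ᴾ f g = mk≈ˢ λ N → ≈-reflexive (≡.trans (cong concat (map-++ _ f g)) (sym (concat-++ (map _ f) (map _ g))))

  Φ-scale : ∀ a f → Φ (scale a f) ≈ˢ scaleˢ a (Φ f)
  Φ-scale a f = mk≈ˢ λ N → mk≈ λ μ → begin
    coeff (Φ (scale a f) N) μ                                  ≡⟨ coeff-Φ (scale a f) N μ ⟩
    ∑[ t ∈ scale a f ] (proj₁ t * coeff (Π (proj₂ t) N) μ)     ≡⟨ ∑-map _ f _ ⟩
    ∑[ t ∈ f ] (a * proj₁ t * coeff (Π (proj₂ t) N) μ)         ≡⟨ ∑-cong f (λ t → ℚ.*-assoc a (proj₁ t) _) ⟩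
    ∑[ t ∈ f ] (a * (proj₁ t * coeff (Π (proj₂ t) N) μ))       ≡⟨ *-distribˡ-∑ f a _ ⟨
    a * linear (λ m → coeff (Π m N) μ) f                       ≡⟨ cong (a *_) (coeff-Φ f N μ) ⟨
    a * coeff (Φ f N) μ                                        ≡⟨ coeff-scale a (Φ f N) μ ⟨
    coeff (scaleˢ a (Φ f) N) μ                                 ∎
    where
    open ≡.≡-Reasoning

  Φ-pλ : ∀ m → Φ (pλ m) ≈ˢ Π m
  Φ-pλ m = mk≈ˢ λ N → ≈-trans (≈-reflexive (++-identityʳ _)) (scale-identity (Π m N))

  Φ-mulP : ∀ a g → Φ (mulP a g) ≈ˢ P a *ˢ Φ g
  Φ-mulP a g = begin
    Φ (mulP a g)                                           ≈⟨ mk≈ˢ (λ N → ≈-reflexive (cong concat (sym (map-∘ g)))) ⟩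
    Σˢ g (λ t → scaleˢ (proj₁ t) (P a *ˢ Π (proj₂ t)))     ≈⟨ Σˢ-cong g (λ t → *ˢ-scaleˢ (proj₁ t) (P a) (Π (proj₂ t))) ⟨
    Σˢ g (λ t → P a *ˢ scaleˢ (proj₁ t) (Π (proj₂ t)))     ≈⟨ *ˢ-distribˡ-Σˢ g _ (P a) ⟨
    P a *ˢ Φ g                                             ∎
    where
    open ≈ˢ-Reasoning

  Φ-whenᴾ-yes : ∀ {Y : Set} (d : Dec Y) {f} → Y → Φ (whenᴾ d f) ≈ˢ Φ f
  Φ-whenᴾ-yes d y = Φ-cong (≈-reflexive (whenᴾ-yes d _ y))

  Φ-whenᴾ-no : ∀ {Y : Set} (d : Dec Y) {f} → ¬ Y → Φ (whenᴾ d f) ≈ˢ 0ˢ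
  Φ-whenᴾ-no d ¬y = Φ-cong (≈-reflexive (whenᴾ-no d _ ¬y))

  *ˢ-Φ-+ᴾ : ∀ S f g → S *ˢ Φ (f +ᴾ g) ≈ˢ S *ˢ Φ f +ˢ S *ˢ Φ g
  *ˢ-Φ-+ᴾ S f g = ≈ˢ-trans (*ˢ-cong (≈ˢ-refl {S}) (Φ-+ᴾ f g)) (*ˢ-distribˡ-+ˢ S (Φ f) (Φ g))

  θ-Π : ∀ K m → All (_≤ K) m → θ (Π m) ≈ˢ Σˢ (upTo (suc K)) (λ k → θ (P k) *ˢ Φ (∂ₘ k m))
  θ-Π K []      []          = ≈ˢ-trans θ-1ˢ (≈ˢ-sym (Σˢ-zero (upTo (suc K)) _ (λ k → *ˢ-zeroʳ (θ (P k)) ≈ˢ-refl)))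
  θ-Π K (a ∷ m) (a≤K ∷ m≤K) = begin
    θ (P a *ˢ Π m)                                                        ≈⟨ θ-*ˢ (P a) (Π m) ⟩
    θ (P a) *ˢ Π m +ˢ P a *ˢ θ (Π m)                                      ≈⟨ +ˢ-cong (≈ˢ-sym differentiated-factor)
                                                                               (≈ˢ-trans (*ˢ-cong (≈ˢ-refl {P a}) (θ-Π K m m≤K)) other-factors) ⟩
    Σˢ ks (λ k → θ (P k) *ˢ Φ (whenᴾ (a ≟ k) (pλ m)))
      +ˢ Σˢ ks (λ k → θ (P k) *ˢ Φ (mulP a (∂ₘ k m)))                     ≈⟨ Σˢ-distrib-+ˢ ks (λ k → θ (P k) *ˢ Φ (whenᴾ (a ≟ k) (pλ m)))
                                                                                             (λ k → θ (P k) *ˢ Φ (mulP a (∂ₘ k m))) ⟨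
    Σˢ ks (λ k → θ (P k) *ˢ Φ (whenᴾ (a ≟ k) (pλ m)) +ˢ θ (P k) *ˢ Φ (mulP a (∂ₘ k m)))
                                                                          ≈⟨ Σˢ-cong ks (λ k → *ˢ-Φ-+ᴾ (θ (P k)) (whenᴾ (a ≟ k) (pλ m)) (mulP a (∂ₘ k m))) ⟨
    Σˢ ks (λ k → θ (P k) *ˢ Φ (∂ₘ k (a ∷ m)))                             ∎
    where
    open ≈ˢ-Reasoning
    ks = upTo (suc K)
    differentiated-factor : Σˢ ks (λ k → θ (P k) *ˢ Φ (whenᴾ (a ≟ k) (pλ m))) ≈ˢ θ (P a) *ˢ Π m
    differentiated-factor = begin
      Σˢ ks (λ k → θ (P k) *ˢ Φ (whenᴾ (a ≟ k) (pλ m)))  ≈⟨ Σˢ-upTo-single (suc K) a _ (s≤s a≤K)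
                                                               (λ k _ k≢a → *ˢ-zeroʳ (θ (P k)) (Φ-whenᴾ-no (a ≟ k) (k≢a ∘ sym))) ⟩
      θ (P a) *ˢ Φ (whenᴾ (a ≟ a) (pλ m))                 ≈⟨ *ˢ-cong (≈ˢ-refl {θ (P a)}) (≈ˢ-trans (Φ-whenᴾ-yes (a ≟ a) ≡.refl) (Φ-pλ m)) ⟩
      θ (P a) *ˢ Π m                                      ∎
    other-factors : P a *ˢ Σˢ ks (λ k → θ (P k) *ˢ Φ (∂ₘ k m)) ≈ˢ Σˢ ks (λ k → θ (P k) *ˢ Φ (mulP a (∂ₘ k m)))
    other-factors = ≈ˢ-trans (*ˢ-distribˡ-Σˢ ks _ (P a)) (Σˢ-cong ks λ k → begin
      P a *ˢ (θ (P k) *ˢ Φ (∂ₘ k m))    ≈⟨ *ˢ-assoc (P a) (θ (P k)) _ ⟨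
      (P a *ˢ θ (P k)) *ˢ Φ (∂ₘ k m)    ≈⟨ *ˢ-cong (*ˢ-comm (P a) (θ (P k))) (≈ˢ-refl {Φ (∂ₘ k m)}) ⟩
      (θ (P k) *ˢ P a) *ˢ Φ (∂ₘ k m)    ≈⟨ *ˢ-assoc (θ (P k)) (P a) _ ⟩
      θ (P k) *ˢ (P a *ˢ Φ (∂ₘ k m))    ≈⟨ *ˢ-cong (≈ˢ-refl {θ (P k)}) (Φ-mulP a (∂ₘ k m)) ⟨
      θ (P k) *ˢ Φ (mulP a (∂ₘ k m))    ∎)

  θ-Φ : ∀ K f → AllVars (_≤ K) f → θ (Φ f) ≈ˢ Σˢ (upTo (suc K)) (λ k → θ (P k) *ˢ Φ (∂ k f))
  θ-Φ K []            []          = ≈ˢ-sym (Σˢ-zero (upTo (suc K)) _ (λ k → *ˢ-zeroʳ (θ (P k)) ≈ˢ-refl))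
  θ-Φ K ((c , m) ∷ f) (m≤K ∷ f≤K) = begin
    θ (scaleˢ c (Π m) +ˢ Φ f)                                             ≈⟨ θ-+ˢ (scaleˢ c (Π m)) (Φ f) ⟩
    θ (scaleˢ c (Π m)) +ˢ θ (Φ f)                                         ≈⟨ +ˢ-cong (≈ˢ-trans (θ-scaleˢ c (Π m)) (scaleˢ-cong c (θ-Π K m m≤K)))
                                                                                      (θ-Φ K f f≤K) ⟩
    scaleˢ c (Σˢ ks (λ k → θ (P k) *ˢ Φ (∂ₘ k m))) +ˢ Σˢ ks (λ k → θ (P k) *ˢ Φ (∂ k f))
                                                                          ≈⟨ +ˢ-cong (≈ˢ-trans (scaleˢ-Σˢ c ks _) (Σˢ-cong ks scale-inside))
                                                                                      (≈ˢ-refl {Σˢ ks (λ k → θ (P k) *ˢ Φ (∂ k f))}) ⟩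
    Σˢ ks (λ k → θ (P k) *ˢ Φ (scale c (∂ₘ k m))) +ˢ Σˢ ks (λ k → θ (P k) *ˢ Φ (∂ k f))
                                                                          ≈⟨ Σˢ-distrib-+ˢ ks (λ k → θ (P k) *ˢ Φ (scale c (∂ₘ k m)))
                                                                                                 (λ k → θ (P k) *ˢ Φ (∂ k f)) ⟨
    Σˢ ks (λ k → θ (P k) *ˢ Φ (scale c (∂ₘ k m)) +ˢ θ (P k) *ˢ Φ (∂ k f))  ≈⟨ Σˢ-cong ks (λ k → *ˢ-Φ-+ᴾ (θ (P k)) (scale c (∂ₘ k m)) (∂ k f)) ⟨
    Σˢ ks (λ k → θ (P k) *ˢ Φ (∂ k ((c , m) ∷ f)))                         ∎
    where
    open ≈ˢ-Reasoning
    ks = upTo (suc K)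
    scale-inside : ∀ k → scaleˢ c (θ (P k) *ˢ Φ (∂ₘ k m)) ≈ˢ θ (P k) *ˢ Φ (scale c (∂ₘ k m))
    scale-inside k = ≈ˢ-sym (≈ˢ-trans (*ˢ-cong (≈ˢ-refl {θ (P k)}) (Φ-scale c (∂ₘ k m))) (*ˢ-scaleˢ c (θ (P k)) _))

  Φ-sumᴾ : (F : I → Poly) (xs : List I) → Φ (sumᴾ (map F xs)) ≈ˢ Σˢ xs (Φ ∘ F)
  Φ-sumᴾ F []       = ≈ˢ-refl
  Φ-sumᴾ F (x ∷ xs) = ≈ˢ-trans (Φ-+ᴾ (F x) _) (+ˢ-cong (≈ˢ-refl {Φ (F x)}) (Φ-sumᴾ F xs))

-- Partitions

infix 4 _⊢_ _⊢?_
_⊢_ : Monomial → ℕ → Set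
μ ⊢ n = All (1 ≤_) μ × sum μ ≡ n

_⊢?_ : ∀ μ n → Dec (μ ⊢ n)
μ ⊢? n = All.all? (1 ≤?_) μ ×-dec (sum μ ≟ n)

PartitionOf : ℕ → ℕ → List ℕ → Set
PartitionOf n m []      = n ≡ 0
PartitionOf n m (a ∷ x) = 1 ≤ a × a ≤ n × a ≤ m × PartitionOf (n ∸ a) a x

partitionOf? : ∀ n m x → Dec (PartitionOf n m x)
partitionOf? n m []      = n ≟ 0
partitionOf? n m (a ∷ x) = 1 ≤? a ×-dec a ≤? n ×-dec a ≤? m ×-dec partitionOf? (n ∸ a) a x

partsF-PartitionOf : ∀ f n m → All (PartitionOf n m) (partsF f n m)
partsF-PartitionOf f       zero    m = refl ∷ []
partsF-PartitionOf zero    (suc n) m = []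
partsF-PartitionOf (suc f) (suc n) m = Allₚ.concat⁺ (Allₚ.map⁺ (All.map extend candidates))
  where
  candidates : All (λ k → (1 ≤ k × k ≤ suc n) × k ≤ m) (filter (_≤? m) (applyUpTo suc (suc n)))
  candidates = All.zip (Allₚ.filter⁺ (_≤? m) (Allₚ.applyUpTo⁺₁ suc (suc n) (λ i<1+n → s≤s z≤n , i<1+n)) , Allₚ.all-filter (_≤? m) (applyUpTo suc (suc n)))
  extend : ∀ {k} → (1 ≤ k × k ≤ suc n) × k ≤ m → All (PartitionOf (suc n) m) (map (k ∷_) (partsF f (suc n ∸ k) k))
  extend {k} ((1≤k , k≤1+n) , k≤m) = Allₚ.map⁺ (All.map (λ p → 1≤k , k≤1+n , k≤m , p) (partsF-PartitionOf f (suc n ∸ k) k))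

PartitionOf⇒sorted : ∀ {n m} x → PartitionOf n m x → Sorted≥ x
PartitionOf⇒sorted []          _                           = []
PartitionOf⇒sorted (a ∷ [])    _                           = [-]
PartitionOf⇒sorted (a ∷ b ∷ x) (_ , _ , _ , p@(_ , _ , b≤a , _)) = b≤a ∷ PartitionOf⇒sorted (b ∷ x) p

PartitionOf⇒⊢ : ∀ {n m} x → PartitionOf n m x → x ⊢ n
PartitionOf⇒⊢ []      n≡0                    = [] , sym n≡0
PartitionOf⇒⊢ (a ∷ x) (1≤a , a≤n , _ , p) with PartitionOf⇒⊢ x p
... | x≥1 , Σx≡n-a = 1≤a ∷ x≥1 , trans (cong (a ℕ.+_) Σx≡n-a) (ℕ.m+[n∸m]≡n a≤n)

sorted⇒PartitionOf : ∀ {n m} x → Sorted≥ x → All (_≤ m) x → x ⊢ n → PartitionOf n m x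
sorted⇒PartitionOf []      _  _            (_ , Σx≡n)          = sym Σx≡n
sorted⇒PartitionOf {n} (a ∷ x) x↗ (a≤m ∷ _) (1≤a ∷ x≥1 , Σx≡n) =
  1≤a , a≤n , a≤m , sorted⇒PartitionOf x (Linked.tail x↗) tail≤a (x≥1 , sum-tail)
  where
  a≤n : a ≤ n
  a≤n = subst (a ≤_) Σx≡n (ℕ.m≤m+n a (sum x))
  tail≤a : All (_≤ a) x
  tail≤a = All.tail (Linked⇒All (λ p q → ℕ.≤-trans q p) ℕ.≤-refl x↗)
  sum-tail : sum x ≡ n ∸ a
  sum-tail = trans (sym (ℕ.m+n∸m≡n a (sum x))) (cong (_∸ a) Σx≡n)

All-≤-sum : ∀ x → All (_≤ sum x) x
All-≤-sum []      = []
All-≤-sum (a ∷ x) = ℕ.m≤m+n a (sum x) ∷ All.map (λ b≤Σx → ℕ.≤-trans b≤Σx (ℕ.m≤n+m (sum x) a)) (All-≤-sum x)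

⊢-↭ : ∀ {μ μ′ n} → μ ↭ μ′ → μ ⊢ n → μ′ ⊢ n
⊢-↭ p (μ≥1 , Σμ≡n) = All-resp-↭ p μ≥1 , trans (sym (sum-↭ p)) Σμ≡n

PartitionOf-sortDesc⇔⊢ : ∀ n μ → (PartitionOf n n (sortDesc μ) → μ ⊢ n) × (μ ⊢ n → PartitionOf n n (sortDesc μ))
PartitionOf-sortDesc⇔⊢ n μ = to , from
  where
  to : PartitionOf n n (sortDesc μ) → μ ⊢ n
  to p = ⊢-↭ (sortDesc-↭ μ) (PartitionOf⇒⊢ (sortDesc μ) p)
  from : μ ⊢ n → PartitionOf n n (sortDesc μ)
  from μ⊢n with ⊢-↭ (↭-sym (sortDesc-↭ μ)) μ⊢n
  ... | sorted⊢n@(_ , Σ≡n) = sorted⇒PartitionOf (sortDesc μ) (sortDesc-sorted μ)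
                               (subst (λ k → All (_≤ k) (sortDesc μ)) Σ≡n (All-≤-sum (sortDesc μ))) sorted⊢n

private
  when-≡-∷ : ∀ k l a x c → when (≡-dec _≟_ (k ∷ l) (a ∷ x)) c ≡ when (k ≟ a) (when (≡-dec _≟_ l x) c)
  when-≡-∷ k l a x c with k ≟ a
  ... | yes refl = trans (when-⇔ (≡-dec _≟_ (k ∷ l) (k ∷ x)) (≡-dec _≟_ l x) c ∷-injectiveʳ (cong (k ∷_)))
                         (sym (when-yes (k ≟ k) refl))
  ... | no k≢a   = trans (when-no (≡-dec _≟_ (k ∷ l) (a ∷ x)) (k≢a ∘ ∷-injectiveˡ)) (sym (when-no (k ≟ a) k≢a))

  ∑-partsF-suc : ∀ f n m (F : List ℕ → ℚ) →
                 ∑ (partsF (suc f) (suc n) m) F ≡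
                 ∑[ i ∈ upTo (suc n) ] when (suc i ≤? m) (∑[ l ∈ partsF f (n ∸ i) (suc i) ] F (suc i ∷ l))
  ∑-partsF-suc f n m F = begin
    ∑ (concatMap (λ k → map (k ∷_) (parts k)) ks) F                 ≡⟨ ∑-concatMap (λ k → map (k ∷_) (parts k)) ks F ⟩
    ∑[ k ∈ ks ] ∑ (map (k ∷_) (parts k)) F                          ≡⟨ ∑-cong ks (λ k → ∑-map (k ∷_) (parts k) F) ⟩
    ∑[ k ∈ ks ] ∑[ l ∈ parts k ] F (k ∷ l)                          ≡⟨ ∑-filter (_≤? m) (applyUpTo suc (suc n)) _ ⟩
    ∑[ k ∈ applyUpTo suc (suc n) ] when (k ≤? m) (∑[ l ∈ parts k ] F (k ∷ l))
                                                                    ≡⟨ ∑-applyUpTo-suc (suc n) (λ k → when (k ≤? m) (∑[ l ∈ parts k ] F (k ∷ l))) ⟩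
    ∑[ i ∈ upTo (suc n) ] when (suc i ≤? m) (∑[ l ∈ parts (suc i) ] F (suc i ∷ l)) ∎
    where
    open ≡-Reasoning
    ks = filter (_≤? m) (applyUpTo suc (suc n))
    parts : ℕ → List (List ℕ)
    parts k = partsF f (suc n ∸ k) k

  ∑-first-part : ∀ n m a x c →
                 ∑[ i ∈ upTo (suc n) ] when (suc i ≤? m) (when (suc i ≟ a) (when (partitionOf? (n ∸ i) (suc i) x) c)) ≡
                 when (partitionOf? (suc n) m (a ∷ x)) c
  ∑-first-part n m zero    x c = ∑-upTo-zero (suc n) (λ i _ → when-zero (suc i ≤? m))
  ∑-first-part n m (suc a) x c = begin
    ∑[ i ∈ upTo (suc n) ] when (suc i ≤? m) (when (i ≟ a) (Q i))   ≡⟨ ∑-cong (upTo (suc n)) (λ i → when-comm (suc i ≤? m) (i ≟ a) (Q i)) ⟩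
    ∑[ i ∈ upTo (suc n) ] when (i ≟ a) (when (suc i ≤? m) (Q i))   ≡⟨ ∑-upTo-when-≡ (suc n) a _ ⟩
    when (a ℕ.<? suc n) (when (suc a ≤? m) (Q a))                  ≡⟨ cong (when (a ℕ.<? suc n)) (when-×-dec (suc a ≤? m) (partitionOf? (n ∸ a) (suc a) x) c) ⟨
    when (a ℕ.<? suc n) (when (suc a ≤? m ×-dec partitionOf? (n ∸ a) (suc a) x) c)
                                                                   ≡⟨ when-×-dec (a ℕ.<? suc n) (suc a ≤? m ×-dec partitionOf? (n ∸ a) (suc a) x) c ⟨
    when (suc a ≤? suc n ×-dec suc a ≤? m ×-dec partitionOf? (n ∸ a) (suc a) x) c
                                                                   ≡⟨ when-×-dec (1 ≤? suc a) (suc a ≤? suc n ×-dec suc a ≤? m ×-dec partitionOf? (n ∸ a) (suc a) x) c ⟨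
    when (partitionOf? (suc n) m (suc a ∷ x)) c                    ∎
    where
    open ≡-Reasoning
    Q : ℕ → ℚ
    Q i = when (partitionOf? (n ∸ i) (suc i) x) c

count-partsF : ∀ f n m x c → n ≤ f → ∑[ l ∈ partsF f n m ] when (≡-dec _≟_ l x) c ≡ when (partitionOf? n m x) c
count-partsF f       zero    m []      c _ = ℚ.+-identityʳ c
count-partsF f       zero    m (a ∷ x) c _ =
  trans (ℚ.+-identityʳ 0ℚ) (sym (when-no (partitionOf? 0 m (a ∷ x)) λ (1≤a , a≤0 , _) → ℕ.<-irrefl refl (ℕ.≤-trans 1≤a a≤0)))
count-partsF zero    (suc n) m x       c ()
count-partsF (suc f) (suc n) m x       c (s≤s n≤f) =
  trans (∑-partsF-suc f n m (λ l → when (≡-dec _≟_ l x) c)) (by-head x)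
  where
  parts : ℕ → List (List ℕ)
  parts i = partsF f (n ∸ i) (suc i)
  by-head : ∀ x → ∑[ i ∈ upTo (suc n) ] when (suc i ≤? m) (∑[ l ∈ parts i ] when (≡-dec _≟_ (suc i ∷ l) x) c)
                  ≡ when (partitionOf? (suc n) m x) c
  by-head []      = ∑-upTo-zero (suc n) (λ i _ → trans (cong (when (suc i ≤? m)) (∑-zero (parts i))) (when-zero (suc i ≤? m)))
  by-head (a ∷ x) = trans (∑-cong (upTo (suc n)) (λ i → cong (when (suc i ≤? m)) (recurse i))) (∑-first-part n m a x c)
    where
    recurse : ∀ i → ∑[ l ∈ parts i ] when (≡-dec _≟_ (suc i ∷ l) (a ∷ x)) c ≡
                    when (suc i ≟ a) (when (partitionOf? (n ∸ i) (suc i) x) c)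
    recurse i = trans (∑-cong (parts i) (λ l → when-≡-∷ (suc i) l a x c))
               (trans (∑-when (parts i) (suc i ≟ a) _)
                      (cong (when (suc i ≟ a)) (count-partsF f (n ∸ i) (suc i) x c (ℕ.≤-trans (ℕ.m∸n≤m n i) n≤f))))

coeff-∑-partitions : (w : List ℕ → ℚ) → (∀ {l l′} → l ↭ l′ → w l ≡ w l′) → ∀ n μ →
                     coeff (sumᴾ (map (λ l → scale (w l) (pλ l)) (partitions n))) μ ≡ when (μ ⊢? n) (w μ)
coeff-∑-partitions w w-↭ n μ = begin
  coeff (sumᴾ (map (λ l → scale (w l) (pλ l)) (partitions n))) μ
    ≡⟨ coeff-sumᴾ (λ l → scale (w l) (pλ l)) (partitions n) μ ⟩
  ∑[ l ∈ partitions n ] coeff (scale (w l) (pλ l)) μ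
    ≡⟨ ∑-cong-All (partitions n) (partsF-PartitionOf n n n) (λ {l} p → term l (PartitionOf⇒sorted l p)) ⟩
  ∑[ l ∈ partitions n ] when (≡-dec _≟_ l (sortDesc μ)) (w (sortDesc μ))
    ≡⟨ count-partsF n n n (sortDesc μ) (w (sortDesc μ)) ℕ.≤-refl ⟩
  when (partitionOf? n n (sortDesc μ)) (w (sortDesc μ))
    ≡⟨ when-⇔ (partitionOf? n n (sortDesc μ)) (μ ⊢? n) _ (proj₁ (PartitionOf-sortDesc⇔⊢ n μ)) (proj₂ (PartitionOf-sortDesc⇔⊢ n μ)) ⟩
  when (μ ⊢? n) (w (sortDesc μ))
    ≡⟨ cong (when (μ ⊢? n)) (w-↭ (sortDesc-↭ μ)) ⟩
  when (μ ⊢? n) (w μ) ∎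
  where
  open ≡-Reasoning
  term : ∀ l → Sorted≥ l → coeff (scale (w l) (pλ l)) μ ≡ when (≡-dec _≟_ l (sortDesc μ)) (w (sortDesc μ))
  term l l↗ = begin
    coeff (scale (w l) (pλ l)) μ                  ≡⟨ coeff-scale (w l) (pλ l) μ ⟩
    w l * coeff (pλ l) μ                          ≡⟨ cong (w l *_) (coeff-pλ l μ) ⟩
    w l * when (l ↭? μ) 1ℚ                        ≡⟨ *-when (l ↭? μ) (w l) 1ℚ ⟩
    when (l ↭? μ) (w l * 1ℚ)                      ≡⟨ cong (when (l ↭? μ)) (ℚ.*-identityʳ (w l)) ⟩
    when (l ↭? μ) (w l)                           ≡⟨ when-⇔ (l ↭? μ) (≡-dec _≟_ l (sortDesc μ)) (w l)
                                                       (λ p → sorted-↭⇒≡ l↗ (sortDesc-sorted μ) (↭-trans p (↭-sym (sortDesc-↭ μ))))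
                                                       (λ e → subst (_↭ μ) (sym e) (sortDesc-↭ μ)) ⟩
    when (≡-dec _≟_ l (sortDesc μ)) (w l)         ≡⟨ when-cong (≡-dec _≟_ l (sortDesc μ)) (cong w) ⟩
    when (≡-dec _≟_ l (sortDesc μ)) (w (sortDesc μ)) ∎

monomials-∑-pλ : {Q : Monomial → Set} (w : List ℕ → ℚ) (L : List (List ℕ)) → All Q L →
                 All (Q ∘ proj₂) (sumᴾ (map (λ l → scale (w l) (pλ l)) L))
monomials-∑-pλ w []      []       = []
monomials-∑-pλ w (l ∷ L) (q ∷ qs) = q ∷ monomials-∑-pλ w L qs

-- The constants z_λ

private
  zFactor : List ℕ → ℕ → ℕ
  zFactor l j = mult j l ! ℕ.* j ^ mult j l

  -- z l = zUpTo (sum l) l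
  zUpTo : ℕ → List ℕ → ℕ
  zUpTo s l = product (map (zFactor l) (applyUpTo suc s))

  zUpTo-suc : ∀ s l → zUpTo (suc s) l ≡ zUpTo s l ℕ.* zFactor l (suc s)
  zUpTo-suc s l = begin
    product (map (zFactor l) (applyUpTo suc (suc s)))                    ≡⟨ cong (product ∘ map (zFactor l)) (applyUpTo-∷ʳ suc s) ⟨
    product (map (zFactor l) (applyUpTo suc s ++ suc s ∷ []))            ≡⟨ cong product (map-++ (zFactor l) (applyUpTo suc s) _) ⟩
    product (map (zFactor l) (applyUpTo suc s) ++ zFactor l (suc s) ∷ []) ≡⟨ product-++ (map (zFactor l) (applyUpTo suc s)) _ ⟩
    zUpTo s l ℕ.* (zFactor l (suc s) ℕ.* 1)                                  ≡⟨ cong (zUpTo s l ℕ.*_) (ℕ.*-identityʳ _) ⟩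
    zUpTo s l ℕ.* zFactor l (suc s)                                        ∎
    where
    open ≡-Reasoning

  zUpTo-cong : ∀ s {l l′} → (∀ j → 1 ≤ j → j ≤ s → mult j l ≡ mult j l′) → zUpTo s l ≡ zUpTo s l′
  zUpTo-cong zero     e = refl
  zUpTo-cong (suc s) {l} {l′} e = begin
    zUpTo (suc s) l                  ≡⟨ zUpTo-suc s l ⟩
    zUpTo s l ℕ.* zFactor l (suc s)    ≡⟨ cong₂ ℕ._*_ (zUpTo-cong s {l} {l′} (λ j 1≤j j≤s → e j 1≤j (ℕ.m≤n⇒m≤1+n j≤s)))
                                                  (cong (λ k → k ! ℕ.* suc s ^ k) (e (suc s) (s≤s z≤n) ℕ.≤-refl)) ⟩
    zUpTo s l′ ℕ.* zFactor l′ (suc s)  ≡⟨ zUpTo-suc s l′ ⟨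
    zUpTo (suc s) l′                 ∎
    where
    open ≡-Reasoning

  mult-> : ∀ j l → sum l < j → mult j l ≡ 0
  mult-> j l Σl<j = ∉⇒mult≡0 l (λ j∈l → ℕ.<⇒≱ Σl<j (All.lookup (All-≤-sum l) j∈l))

  zUpTo-beyond : ∀ l d → zUpTo (sum l ℕ.+ d) l ≡ z l
  zUpTo-beyond l zero    = cong (λ s → zUpTo s l) (ℕ.+-identityʳ (sum l))
  zUpTo-beyond l (suc d) = begin
    zUpTo (sum l ℕ.+ suc d) l                                     ≡⟨ cong (λ s → zUpTo s l) (ℕ.+-suc (sum l) d) ⟩
    zUpTo (suc (sum l ℕ.+ d)) l                                   ≡⟨ zUpTo-suc (sum l ℕ.+ d) l ⟩
    zUpTo (sum l ℕ.+ d) l ℕ.* zFactor l (suc (sum l ℕ.+ d))           ≡⟨ cong (λ k → zUpTo (sum l ℕ.+ d) l ℕ.* (k ! ℕ.* suc (sum l ℕ.+ d) ^ k))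
                                                                        (mult-> (suc (sum l ℕ.+ d)) l (s≤s (ℕ.m≤m+n (sum l) d))) ⟩
    zUpTo (sum l ℕ.+ d) l ℕ.* 1                                     ≡⟨ ℕ.*-identityʳ _ ⟩
    zUpTo (sum l ℕ.+ d) l                                         ≡⟨ zUpTo-beyond l d ⟩
    z l                                                         ∎
    where
    open ≡-Reasoning

  zUpTo-∷ : ∀ k l s → 1 ≤ k → k ≤ s → zUpTo s (k ∷ l) ≡ zUpTo s l ℕ.* (k ℕ.* suc (mult k l))
  zUpTo-∷ k l zero    1≤k k≤0 = ⊥-elim (ℕ.<-irrefl refl (ℕ.≤-trans 1≤k k≤0))
  zUpTo-∷ k l (suc s) 1≤k k≤1+s with k ≟ suc s
  ... | yes refl = begin
    zUpTo (suc s) (k ∷ l)                                 ≡⟨ zUpTo-suc s (k ∷ l) ⟩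
    zUpTo s (k ∷ l) ℕ.* zFactor (k ∷ l) k                   ≡⟨ cong₂ ℕ._*_ (zUpTo-cong s {k ∷ l} {l} below) (cong (λ n → n ! ℕ.* k ^ n) (mult-∷-≡ k l)) ⟩
    zUpTo s l ℕ.* (suc (mult k l) ! ℕ.* k ^ suc (mult k l))   ≡⟨ solve 5 (λ Z m f p k → Z :* ((con 1 :+ m) :* f :* (k :* p))
                                                                                  := Z :* (f :* p) :* (k :* (con 1 :+ m)))
                                                                   refl (zUpTo s l) (mult k l) (mult k l !) (k ^ mult k l) k ⟩
    zUpTo s l ℕ.* zFactor l k ℕ.* (k ℕ.* suc (mult k l))        ≡⟨ cong (ℕ._* (k ℕ.* suc (mult k l))) (zUpTo-suc s l) ⟨
    zUpTo (suc s) l ℕ.* (k ℕ.* suc (mult k l))                ∎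
    where
    open ≡-Reasoning
    open ℕ-Solver
    below : ∀ j → 1 ≤ j → j ≤ s → mult j (k ∷ l) ≡ mult j l
    below j _ j≤s = mult-∷-≢ l (λ k≡j → ℕ.<-irrefl (sym k≡j) (s≤s j≤s))
  ... | no k≢1+s = begin
    zUpTo (suc s) (k ∷ l)                                     ≡⟨ zUpTo-suc s (k ∷ l) ⟩
    zUpTo s (k ∷ l) ℕ.* zFactor (k ∷ l) (suc s)                 ≡⟨ cong₂ ℕ._*_ (zUpTo-∷ k l s 1≤k (ℕ.≤-pred (ℕ.≤∧≢⇒< k≤1+s k≢1+s)))
                                                                         (cong (λ n → n ! ℕ.* suc s ^ n) (mult-∷-≢ l k≢1+s)) ⟩
    zUpTo s l ℕ.* (k ℕ.* suc (mult k l)) ℕ.* zFactor l (suc s)      ≡⟨ solve 3 (λ Z X G → Z :* X :* G := Z :* G :* X) refl (zUpTo s l) _ _ ⟩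
    zUpTo s l ℕ.* zFactor l (suc s) ℕ.* (k ℕ.* suc (mult k l))      ≡⟨ cong (ℕ._* (k ℕ.* suc (mult k l))) (zUpTo-suc s l) ⟨
    zUpTo (suc s) l ℕ.* (k ℕ.* suc (mult k l))                    ∎
    where
    open ≡-Reasoning
    open ℕ-Solver

z-∷ : ∀ k l → 1 ≤ k → z (k ∷ l) ≡ z l ℕ.* (k ℕ.* suc (mult k l))
z-∷ k l 1≤k = trans (zUpTo-∷ k l (k ℕ.+ sum l) 1≤k (ℕ.m≤m+n k (sum l)))
                    (cong (ℕ._* (k ℕ.* suc (mult k l))) (trans (cong (λ s → zUpTo s l) (ℕ.+-comm k (sum l))) (zUpTo-beyond l k)))

z-↭ : ∀ {l l′} → l ↭ l′ → z l ≡ z l′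
z-↭ {l} {l′} p = trans (cong (λ s → zUpTo s l) (sum-↭ p)) (zUpTo-cong (sum l′) {l} {l′} (λ j _ _ → mult-↭ j p))

z-pos : ∀ l → 0 < z l
z-pos l = ℕ.>-nonZero⁻¹ _ {{product≢0 (Allₚ.map⁺ (Allₚ.applyUpTo⁺₁ {P = NonZero ∘ zFactor l} suc (sum l) (λ {i} _ → ℕ.>-nonZero (factor-pos i))))}}
  where
  factor-pos : ∀ i → 0 < zFactor l (suc i)
  factor-pos i = ℕ.*-mono-≤ (ℕ.1≤n! (mult (suc i) l)) (ℕ.m^n>0 (suc i) (mult (suc i) l))

private
  mult-*-map : ∀ k x ν → 1 ≤ k → mult (k ℕ.* x) (map (k ℕ.*_) ν) ≡ mult x ν
  mult-*-map k x []      _   = refl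
  mult-*-map k x (y ∷ ν) 1≤k with y ≟ x
  ... | yes refl = trans (mult-∷-≡ (k ℕ.* y) (map (k ℕ.*_) ν)) (trans (cong suc (mult-*-map k y ν 1≤k)) (sym (mult-∷-≡ y ν)))
  ... | no y≢x   = trans (mult-∷-≢ (map (k ℕ.*_) ν) (y≢x ∘ ℕ.*-cancelˡ-≡ y x k {{ℕ.>-nonZero 1≤k}}))
                         (trans (mult-*-map k x ν 1≤k) (sym (mult-∷-≢ ν y≢x)))

z-map : ∀ k ν → 1 ≤ k → All (1 ≤_) ν → z (map (k ℕ.*_) ν) ≡ k ^ length ν ℕ.* z ν
z-map k []      _   []          = refl
z-map k (x ∷ ν) 1≤k (1≤x ∷ ν≥1) = begin
  z (k ℕ.* x ∷ map (k ℕ.*_) ν)                                      ≡⟨ z-∷ (k ℕ.* x) (map (k ℕ.*_) ν) (ℕ.*-mono-≤ 1≤k 1≤x) ⟩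
  z (map (k ℕ.*_) ν) ℕ.* (k ℕ.* x ℕ.* suc (mult (k ℕ.* x) (map (k ℕ.*_) ν))) ≡⟨ cong₂ (λ a b → a ℕ.* (k ℕ.* x ℕ.* suc b)) (z-map k ν 1≤k ν≥1) (mult-*-map k x ν 1≤k) ⟩
  k ^ length ν ℕ.* z ν ℕ.* (k ℕ.* x ℕ.* suc (mult x ν))                  ≡⟨ solve 5 (λ K P Z X M → P :* Z :* (K :* X :* (con 1 :+ M))
                                                                                        := K :* P :* (Z :* (X :* (con 1 :+ M))))
                                                                          refl k (k ^ length ν) (z ν) x (mult x ν) ⟩
  k ℕ.* k ^ length ν ℕ.* (z ν ℕ.* (x ℕ.* suc (mult x ν)))                ≡⟨ cong (k ℕ.* k ^ length ν ℕ.*_) (z-∷ x ν 1≤x) ⟨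
  k ^ length (x ∷ ν) ℕ.* z (x ∷ ν)                                 ∎
  where
  open ≡-Reasoning
  open ℕ-Solver

-- The symmetric functions hₙ and Hₙ

coeff-h : ∀ n μ → coeff (h n) μ ≡ when (μ ⊢? n) (divℕ 1 (z μ))
coeff-h = coeff-∑-partitions (λ l → divℕ 1 (z l)) (cong (divℕ 1) ∘ z-↭)

coeff-H : ∀ n μ → coeff (H n) μ ≡ when (μ ⊢? n) (divℕ (σ (length μ ∸ 1) (gcdL μ)) (z μ))
coeff-H = coeff-∑-partitions (λ l → divℕ (σ (length l ∸ 1) (gcdL l)) (z l))
            (λ p → cong₂ divℕ (cong₂ (λ r g → σ (r ∸ 1) g) (↭-length p) (gcdL-↭ p)) (z-↭ p))

private
  ι-*-inverse-z-∷ : ∀ k μ m → 1 ≤ k → ι (suc m) * divℕ 1 (z μ ℕ.* (k ℕ.* suc m)) ≡ divℕ 1 k * divℕ 1 (z μ)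
  ι-*-inverse-z-∷ k μ m 1≤k = begin
    ι (suc m) * divℕ 1 (z μ ℕ.* (k ℕ.* suc m))             ≡⟨ divℕ-* (suc m) 1 (s≤s z≤n) denominator>0 ⟩
    divℕ (suc m ℕ.* 1) (1 ℕ.* (z μ ℕ.* (k ℕ.* suc m)))     ≡⟨ divℕ-cong _ _ (ℕ.*-mono-≤ {1} {1} (s≤s z≤n) denominator>0)
                                                                 (ℕ.*-mono-≤ 1≤k (z-pos μ)) cross ⟩
    divℕ (1 ℕ.* 1) (k ℕ.* z μ)                             ≡⟨ divℕ-* 1 1 1≤k (z-pos μ) ⟨
    divℕ 1 k * divℕ 1 (z μ)                                ∎
    where
    open ≡-Reasoning
    denominator>0 : 0 < z μ ℕ.* (k ℕ.* suc m)
    denominator>0 = ℕ.*-mono-≤ (z-pos μ) (ℕ.*-mono-≤ 1≤k (s≤s z≤n))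
    cross : suc m ℕ.* 1 ℕ.* (k ℕ.* z μ) ≡ 1 ℕ.* 1 ℕ.* (1 ℕ.* (z μ ℕ.* (k ℕ.* suc m)))
    cross = solve 3 (λ m k Z → (con 1 :+ m) :* con 1 :* (k :* Z) := con 1 :* con 1 :* (con 1 :* (Z :* (k :* (con 1 :+ m)))))
                    refl m k (z μ)
      where
      open ℕ-Solver

  -- For k = 0 this relies on the junk value divℕ 1 0 = 0.
  when-≤-vanishes : ∀ j k μ c → ¬ (k ∷ μ ⊢ j) → when (k ≤? j) (divℕ 1 k * when (μ ⊢? j ∸ k) c) ≡ 0ℚ
  when-≤-vanishes j zero    μ c _ = trans (cong (when (0 ≤? j)) (ℚ.*-zeroˡ (when (μ ⊢? j ∸ 0) c))) (when-zero (0 ≤? j))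
  when-≤-vanishes j (suc k) μ c ¬kμ⊢j with suc k ≤? j
  ... | no k≰j  = when-no (suc k ≤? j) k≰j
  ... | yes k≤j = trans (when-yes (suc k ≤? j) k≤j) (trans (cong (divℕ 1 (suc k) *_) (when-no (μ ⊢? j ∸ suc k) ¬μ⊢j-k))
                                                            (ℚ.*-zeroʳ (divℕ 1 (suc k))))
    where
    ¬μ⊢j-k : ¬ (μ ⊢ j ∸ suc k)
    ¬μ⊢j-k (μ≥1 , Σμ≡j-k) = ¬kμ⊢j (s≤s z≤n ∷ μ≥1 , trans (cong (suc k ℕ.+_) Σμ≡j-k) (ℕ.m+[n∸m]≡n k≤j))

∂-h : ∀ j k → ∂ k (h j) ≈ whenᴾ (k ≤? j) (scale (divℕ 1 k) (h (j ∸ k)))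
∂-h j k = mk≈ λ μ → begin
  coeff (∂ k (h j)) μ                                                   ≡⟨ coeff-∂ k (h j) μ ⟩
  ι (suc (mult k μ)) * coeff (h j) (k ∷ μ)                              ≡⟨ cong (ι (suc (mult k μ)) *_) (coeff-h j (k ∷ μ)) ⟩
  ι (suc (mult k μ)) * when (k ∷ μ ⊢? j) (divℕ 1 (z (k ∷ μ)))           ≡⟨ value μ ⟩
  when (k ≤? j) (divℕ 1 k * when (μ ⊢? j ∸ k) (divℕ 1 (z μ)))           ≡⟨ coeff-rhs μ ⟨
  coeff (whenᴾ (k ≤? j) (scale (divℕ 1 k) (h (j ∸ k)))) μ               ∎
  where
  open ≡-Reasoning
  coeff-rhs : ∀ μ → coeff (whenᴾ (k ≤? j) (scale (divℕ 1 k) (h (j ∸ k)))) μ ≡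
                    when (k ≤? j) (divℕ 1 k * when (μ ⊢? j ∸ k) (divℕ 1 (z μ)))
  coeff-rhs μ = trans (coeff-whenᴾ (k ≤? j) _ μ)
    (cong (when (k ≤? j)) (trans (coeff-scale (divℕ 1 k) (h (j ∸ k)) μ) (cong (divℕ 1 k *_) (coeff-h (j ∸ k) μ))))
  value : ∀ μ → ι (suc (mult k μ)) * when (k ∷ μ ⊢? j) (divℕ 1 (z (k ∷ μ))) ≡
                when (k ≤? j) (divℕ 1 k * when (μ ⊢? j ∸ k) (divℕ 1 (z μ)))
  value μ = by-cases (k ∷ μ ⊢? j)
    where
    by-cases : Dec (k ∷ μ ⊢ j) → ι (suc (mult k μ)) * when (k ∷ μ ⊢? j) (divℕ 1 (z (k ∷ μ))) ≡
                                 when (k ≤? j) (divℕ 1 k * when (μ ⊢? j ∸ k) (divℕ 1 (z μ)))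
    by-cases (yes kμ⊢j@(1≤k ∷ μ≥1 , k+Σμ≡j)) = begin
      ι (suc (mult k μ)) * when (k ∷ μ ⊢? j) (divℕ 1 (z (k ∷ μ)))   ≡⟨ cong (ι (suc (mult k μ)) *_) (when-yes (k ∷ μ ⊢? j) kμ⊢j) ⟩
      ι (suc (mult k μ)) * divℕ 1 (z (k ∷ μ))                       ≡⟨ cong (λ x → ι (suc (mult k μ)) * divℕ 1 x) (z-∷ k μ 1≤k) ⟩
      ι (suc (mult k μ)) * divℕ 1 (z μ ℕ.* (k ℕ.* suc (mult k μ)))  ≡⟨ ι-*-inverse-z-∷ k μ (mult k μ) 1≤k ⟩
      divℕ 1 k * divℕ 1 (z μ)                                       ≡⟨ cong (divℕ 1 k *_) (when-yes (μ ⊢? j ∸ k) μ⊢j-k) ⟨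
      divℕ 1 k * when (μ ⊢? j ∸ k) (divℕ 1 (z μ))                   ≡⟨ when-yes (k ≤? j) k≤j ⟨
      when (k ≤? j) (divℕ 1 k * when (μ ⊢? j ∸ k) (divℕ 1 (z μ)))   ∎
      where
      k≤j : k ≤ j
      k≤j = subst (k ≤_) k+Σμ≡j (ℕ.m≤m+n k (sum μ))
      μ⊢j-k : μ ⊢ j ∸ k
      μ⊢j-k = μ≥1 , trans (sym (ℕ.m+n∸m≡n k (sum μ))) (cong (_∸ k) k+Σμ≡j)
    by-cases (no ¬kμ⊢j) = begin
      ι (suc (mult k μ)) * when (k ∷ μ ⊢? j) (divℕ 1 (z (k ∷ μ)))   ≡⟨ cong (ι (suc (mult k μ)) *_) (when-no (k ∷ μ ⊢? j) ¬kμ⊢j) ⟩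
      ι (suc (mult k μ)) * 0ℚ                                       ≡⟨ ℚ.*-zeroʳ (ι (suc (mult k μ))) ⟩
      0ℚ                                                            ≡⟨ when-≤-vanishes j k μ (divℕ 1 (z μ)) ¬kμ⊢j ⟨
      when (k ≤? j) (divℕ 1 k * when (μ ⊢? j ∸ k) (divℕ 1 (z μ)))   ∎

monomials-h : ∀ j → All (PartitionOf j j ∘ proj₂) (h j)
monomials-h j = monomials-∑-pλ (λ l → divℕ 1 (z l)) (partitions j) (partsF-PartitionOf j j j)

Ω≤ : ℕ → Poly
Ω≤ L = sumᴾ (map h (upTo (suc L)))

Ω≤-vars : ∀ L → AllVars (_≤ L) (Ω≤ L)
Ω≤-vars L = Allₚ.concat⁺ (Allₚ.map⁺ (Allₚ.applyUpTo⁺₁ {P = AllVars (_≤ L) ∘ h} id (suc L)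
              (λ {j} j<1+L → All.map (λ {t} → parts≤ (ℕ.≤-pred j<1+L) {t}) (monomials-h j))))
  where
  parts≤ : ∀ {j} → j ≤ L → ∀ {t : ℚ × Monomial} → PartitionOf j j (proj₂ t) → All (_≤ L) (proj₂ t)
  parts≤ j≤L {_ , m} p = All.map (λ x≤Σm → ℕ.≤-trans x≤Σm (ℕ.≤-trans (ℕ.≤-reflexive (proj₂ (PartitionOf⇒⊢ m p))) j≤L)) (All-≤-sum m)

∂-Ω≤ : ∀ M k → k ≤ M → ∂ k (Ω≤ M) ≈ scale (divℕ 1 k) (Ω≤ (M ∸ k))
∂-Ω≤ M k k≤M = mk≈ λ μ → begin
  coeff (∂ k (Ω≤ M)) μ                                                ≡⟨ cong (λ f → coeff f μ) (∂-sumᴾ k h (upTo (suc M))) ⟩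
  coeff (sumᴾ (map (∂ k ∘ h) (upTo (suc M)))) μ                       ≡⟨ coeff-sumᴾ (∂ k ∘ h) (upTo (suc M)) μ ⟩
  ∑[ j ∈ upTo (suc M) ] coeff (∂ k (h j)) μ                           ≡⟨ ∑-cong (upTo (suc M)) (λ j → ≈⇒≈ᴾ (∂-h j k) μ) ⟩
  ∑[ j ∈ upTo (suc M) ] coeff (whenᴾ (k ≤? j) (scale (divℕ 1 k) (h (j ∸ k)))) μ
                                                                      ≡⟨ ∑-cong (upTo (suc M)) (λ j → trans (coeff-whenᴾ (k ≤? j) _ μ)
                                                                            (cong (when (k ≤? j)) (coeff-scale (divℕ 1 k) (h (j ∸ k)) μ))) ⟩
  ∑[ j ∈ upTo (suc M) ] when (k ≤? j) (divℕ 1 k * coeff (h (j ∸ k)) μ) ≡⟨ ∑-upTo-shift M (λ j → divℕ 1 k * coeff (h j) μ) k≤M ⟩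
  ∑[ j ∈ upTo (suc (M ∸ k)) ] (divℕ 1 k * coeff (h j) μ)              ≡⟨ *-distribˡ-∑ (upTo (suc (M ∸ k))) (divℕ 1 k) (λ j → coeff (h j) μ) ⟨
  divℕ 1 k * ∑[ j ∈ upTo (suc (M ∸ k)) ] coeff (h j) μ                ≡⟨ cong (divℕ 1 k *_) (coeff-sumᴾ h (upTo (suc (M ∸ k))) μ) ⟨
  divℕ 1 k * coeff (Ω≤ (M ∸ k)) μ                                     ≡⟨ coeff-scale (divℕ 1 k) (Ω≤ (M ∸ k)) μ ⟨
  coeff (scale (divℕ 1 k) (Ω≤ (M ∸ k))) μ                             ∎
  where
  open ≡-Reasoning

-- The alphabet tX

infixl 7 _·t^_
_·t^_ : Poly → ℕ → Series
(f ·t^ d) N = whenᴾ (N ≟ d) f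

·t^-cong : ∀ d {f g} → f ≈ g → f ·t^ d ≈ˢ g ·t^ d
·t^-cong d f≈g = mk≈ˢ λ N → whenᴾ-cong (N ≟ d) f≈g

·t^-*ˢ : ∀ a b f g → (f ·t^ a) *ˢ (g ·t^ b) ≈ˢ (f *ᴾ g) ·t^ (a ℕ.+ b)
·t^-*ˢ a b f g = mk≈ˢ λ N → at N (a ≤? N)
  where
  at : ∀ N → Dec (a ≤ N) → ((f ·t^ a) *ˢ (g ·t^ b)) N ≈ ((f *ᴾ g) ·t^ (a ℕ.+ b)) N
  at N (yes a≤N) = begin
    sumᴾ (map (λ i → whenᴾ (i ≟ a) f *ᴾ whenᴾ (N ∸ i ≟ b) g) (upTo (suc N)))
      ≈⟨ sumᴾ-upTo-single (suc N) a (s≤s a≤N) (λ i _ i≢a → ≈-reflexive (cong (_*ᴾ whenᴾ (N ∸ i ≟ b) g) (whenᴾ-no (i ≟ a) f i≢a))) ⟩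
    whenᴾ (a ≟ a) f *ᴾ whenᴾ (N ∸ a ≟ b) g   ≈⟨ *ᴾ-congʳ (whenᴾ (N ∸ a ≟ b) g) (≈-reflexive (whenᴾ-yes (a ≟ a) f refl)) ⟩
    f *ᴾ whenᴾ (N ∸ a ≟ b) g                 ≈⟨ *ᴾ-whenᴾ (N ∸ a ≟ b) f g ⟩
    whenᴾ (N ∸ a ≟ b) (f *ᴾ g)               ≈⟨ whenᴾ-⇔ (N ∸ a ≟ b) (N ≟ a ℕ.+ b) (f *ᴾ g)
                                                  (λ e → trans (sym (ℕ.m+[n∸m]≡n a≤N)) (cong (a ℕ.+_) e))
                                                  (λ e → trans (cong (_∸ a) e) (ℕ.m+n∸m≡n a b)) ⟩
    whenᴾ (N ≟ a ℕ.+ b) (f *ᴾ g)               ∎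
    where
    open ≈-Reasoning
  at N (no a≰N) = begin
    sumᴾ (map (λ i → whenᴾ (i ≟ a) f *ᴾ whenᴾ (N ∸ i ≟ b) g) (upTo (suc N)))
      ≈⟨ sumᴾ-upTo-zero (suc N) (λ i i<1+N → ≈-reflexive (cong (_*ᴾ whenᴾ (N ∸ i ≟ b) g)
                                     (whenᴾ-no (i ≟ a) f (λ i≡a → a≰N (subst (_≤ N) i≡a (ℕ.≤-pred i<1+N)))))) ⟩
    0ᴾ                                       ≡⟨ whenᴾ-no (N ≟ a ℕ.+ b) (f *ᴾ g) (λ N≡a+b → a≰N (subst (a ≤_) (sym N≡a+b) (ℕ.m≤m+n a b))) ⟨
    whenᴾ (N ≟ a ℕ.+ b) (f *ᴾ g)               ∎
    where
    open ≈-Reasoning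

private
  module TX = Substitution tX

  adams-tX : ∀ j q → adams (suc j) (tX q) ≈ whenᴾ (q ≟ 1) (pλ (suc j ∷ []))
  adams-tX j zero          = ≈-refl
  adams-tX j (suc zero)    = ≈-reflexive (cong (λ x → pλ (x ∷ [])) (ℕ.*-identityʳ (suc j)))
  adams-tX j (suc (suc q)) = ≈-refl

  pS-tX : ∀ j → TX.P (suc j) ≈ˢ pλ (suc j ∷ []) ·t^ suc j
  pS-tX j = mk≈ˢ at
    where
    at : ∀ N → TX.P (suc j) N ≈ (pλ (suc j ∷ []) ·t^ suc j) N
    at N with suc j ∣? N
    ... | yes j+1∣N = ≈-trans (adams-tX j (N ℕ./ suc j)) (whenᴾ-⇔ (N ℕ./ suc j ≟ 1) (N ≟ suc j) _
            (λ e → trans (sym (m/n*n≡m j+1∣N)) (trans (cong (ℕ._* suc j) e) (ℕ.*-identityˡ (suc j))))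
            (λ e → trans (cong (ℕ._/ suc j) (trans e (sym (ℕ.*-identityˡ (suc j))))) (m*n/n≡m 1 (suc j))))
    ... | no j+1∤N  = ≈-reflexive (sym (whenᴾ-no (N ≟ suc j) _ (λ e → j+1∤N (divides 1 (trans e (sym (ℕ.*-identityˡ (suc j))))))))

  all≥1? : ∀ m → Dec (All (1 ≤_) m)
  all≥1? = All.all? (1 ≤?_)

  Π-tX : ∀ m → TX.Π m ≈ˢ whenᴾ (all≥1? m) (pλ m) ·t^ sum m
  Π-tX []          = mk≈ˢ λ where
    zero    → ≈-refl
    (suc N) → ≈-refl
  Π-tX (zero ∷ m)  = ≈ˢ-trans (*ˢ-zeroˡ (TX.Π m) ≈ˢ-refl) (mk≈ˢ λ N → ≈-reflexive (sym (whenᴾ-0ᴾ (N ≟ sum (zero ∷ m)))))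
  Π-tX (suc a ∷ m) = begin
    TX.P (suc a) *ˢ TX.Π m                                                    ≈⟨ *ˢ-cong (pS-tX a) (Π-tX m) ⟩
    (pλ (suc a ∷ []) ·t^ suc a) *ˢ (whenᴾ (all≥1? m) (pλ m) ·t^ sum m)     ≈⟨ ·t^-*ˢ (suc a) (sum m) _ _ ⟩
    (pλ (suc a ∷ []) *ᴾ whenᴾ (all≥1? m) (pλ m)) ·t^ (suc a ℕ.+ sum m)       ≈⟨ ·t^-cong (suc a ℕ.+ sum m) (≈-trans (*ᴾ-whenᴾ (all≥1? m) (pλ (suc a ∷ [])) (pλ m))
                                                                                 (≈-trans (whenᴾ-cong (all≥1? m) (≈-reflexive (cong (λ c → (c , suc a ∷ m) ∷ []) (ℚ.*-identityʳ 1ℚ))))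
                                                                                 (whenᴾ-⇔ (all≥1? m) (all≥1? (suc a ∷ m)) _ (s≤s z≤n ∷_) All.tail))) ⟩
    whenᴾ (all≥1? (suc a ∷ m)) (pλ (suc a ∷ m)) ·t^ sum (suc a ∷ m)         ∎
    where
    open ≈ˢ-Reasoning

  coeff-Π-tX : ∀ m N μ → coeff (TX.Π m N) μ ≡ when (μ ⊢? N) (when (m ↭? μ) 1ℚ)
  coeff-Π-tX m N μ = begin
    coeff (TX.Π m N) μ                                               ≡⟨ ≈⇒≈ᴾ (≈ˢ-at (Π-tX m) N) μ ⟩
    coeff (whenᴾ (N ≟ sum m) (whenᴾ (all≥1? m) (pλ m))) μ          ≡⟨ trans (coeff-whenᴾ (N ≟ sum m) _ μ) (cong (when (N ≟ sum m))
                                                                          (trans (coeff-whenᴾ (all≥1? m) _ μ) (cong (when (all≥1? m)) (coeff-pλ m μ)))) ⟩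
    when (N ≟ sum m) (when (all≥1? m) (when (m ↭? μ) 1ℚ))           ≡⟨ by-cases (m ↭? μ) ⟩
    when (μ ⊢? N) (when (m ↭? μ) 1ℚ)                                ∎
    where
    open ≡-Reasoning
    by-cases : Dec (m ↭ μ) → when (N ≟ sum m) (when (all≥1? m) (when (m ↭? μ) 1ℚ)) ≡ when (μ ⊢? N) (when (m ↭? μ) 1ℚ)
    by-cases (yes m↭μ) = begin
      when (N ≟ sum m) (when (all≥1? m) (when (m ↭? μ) 1ℚ))   ≡⟨ when-×-dec (N ≟ sum m) (all≥1? m) _ ⟨
      when (N ≟ sum m ×-dec all≥1? m) (when (m ↭? μ) 1ℚ)      ≡⟨ when-⇔ (N ≟ sum m ×-dec all≥1? m) (μ ⊢? N) _
                                                                  (λ (N≡Σm , m≥1) → All-resp-↭ m↭μ m≥1 , trans (sym (sum-↭ m↭μ)) (sym N≡Σm))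
                                                                  (λ (μ≥1 , Σμ≡N) → sym (trans (sum-↭ m↭μ) Σμ≡N) , All-resp-↭ (↭-sym m↭μ) μ≥1) ⟩
      when (μ ⊢? N) (when (m ↭? μ) 1ℚ)                        ∎
    by-cases (no m≁μ) = begin
      when (N ≟ sum m) (when (all≥1? m) (when (m ↭? μ) 1ℚ))   ≡⟨ cong (λ x → when (N ≟ sum m) (when (all≥1? m) x)) (when-no (m ↭? μ) m≁μ) ⟩
      when (N ≟ sum m) (when (all≥1? m) 0ℚ)                   ≡⟨ trans (cong (when (N ≟ sum m)) (when-zero (all≥1? m))) (when-zero (N ≟ sum m)) ⟩
      0ℚ                                                      ≡⟨ trans (cong (when (μ ⊢? N)) (when-no (m ↭? μ) m≁μ)) (when-zero (μ ⊢? N)) ⟨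
      when (μ ⊢? N) (when (m ↭? μ) 1ℚ)                        ∎

coeff-Φ-tX : ∀ f N μ → coeff (Substitution.Φ tX f N) μ ≡ when (μ ⊢? N) (coeff f μ)
coeff-Φ-tX f N μ = begin
  coeff (TX.Φ f N) μ                                               ≡⟨ TX.coeff-Φ f N μ ⟩
  ∑[ t ∈ f ] (proj₁ t * coeff (TX.Π (proj₂ t) N) μ)                ≡⟨ ∑-cong f (λ t → cong (proj₁ t *_) (coeff-Π-tX (proj₂ t) N μ)) ⟩
  ∑[ t ∈ f ] (proj₁ t * when (μ ⊢? N) (when (proj₂ t ↭? μ) 1ℚ))   ≡⟨ ∑-cong f (λ t → trans (*-when (μ ⊢? N) (proj₁ t) _)
                                                                        (cong (when (μ ⊢? N)) (trans (*-when (proj₂ t ↭? μ) (proj₁ t) 1ℚ)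
                                                                          (cong (when (proj₂ t ↭? μ)) (ℚ.*-identityʳ (proj₁ t)))))) ⟩
  ∑[ t ∈ f ] when (μ ⊢? N) (coeffₜ μ t)                           ≡⟨ ∑-when f (μ ⊢? N) (coeffₜ μ) ⟩
  when (μ ⊢? N) (∑ f (coeffₜ μ))                                  ≡⟨ cong (when (μ ⊢? N)) (coeff-∑ f μ) ⟨
  when (μ ⊢? N) (coeff f μ)                                       ∎
  where
  open ≡-Reasoning

private
  coeff-Ω₀g : ∀ n μ → ¬ (μ ⊢ n) → coeff (Ω₀g n) μ ≡ 0ℚ
  coeff-Ω₀g zero    μ _    = refl
  coeff-Ω₀g (suc n) μ μ⊬n = trans (coeff-h (suc n) μ) (when-no (μ ⊢? suc n) μ⊬n)

-- Ω₀g, read as a series in t: Ω₀(tX) = Σₙ hₙ tⁿ.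
Ω₀[tX]≈Ω₀ : pleth Ω₀g tX ≈ˢ Ω₀g
Ω₀[tX]≈Ω₀ = mk≈ˢ λ N → mk≈ λ μ → begin
  coeff (pleth Ω₀g tX N) μ                                   ≡⟨ coeff-sumᴾ (λ n → TX.Φ (Ω₀g n) N) (upTo (suc N)) μ ⟩
  ∑[ n ∈ upTo (suc N) ] coeff (TX.Φ (Ω₀g n) N) μ              ≡⟨ ∑-cong (upTo (suc N)) (λ n → coeff-Φ-tX (Ω₀g n) N μ) ⟩
  ∑[ n ∈ upTo (suc N) ] when (μ ⊢? N) (coeff (Ω₀g n) μ)      ≡⟨ ∑-when (upTo (suc N)) (μ ⊢? N) _ ⟩
  when (μ ⊢? N) (∑[ n ∈ upTo (suc N) ] coeff (Ω₀g n) μ)      ≡⟨ only-degree-N N μ (μ ⊢? N) ⟩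
  coeff (Ω₀g N) μ                                            ∎
  where
  open ≡-Reasoning
  only-degree-N : ∀ N μ → (d : Dec (μ ⊢ N)) → when d (∑[ n ∈ upTo (suc N) ] coeff (Ω₀g n) μ) ≡ coeff (Ω₀g N) μ
  only-degree-N N μ (yes μ⊢N) = ∑-upTo-single (suc N) N _ ℕ.≤-refl
                                  (λ n _ n≢N → coeff-Ω₀g n μ (λ μ⊢n → n≢N (trans (sym (proj₂ μ⊢n)) (proj₂ μ⊢N))))
  only-degree-N N μ (no μ⊬N)  = sym (coeff-Ω₀g N μ μ⊬N)

-- The plethysms pₖ[Ω₀]

gcdL-∣ : ∀ μ → All (gcdL μ ∣_) μ
gcdL-∣ []      = []
gcdL-∣ (x ∷ μ) = gcd[m,n]∣m x (gcdL μ) ∷ All.map (∣-trans (gcd[m,n]∣n x (gcdL μ))) (gcdL-∣ μ)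

gcdL-greatest : ∀ {d} μ → All (d ∣_) μ → d ∣ gcdL μ
gcdL-greatest []      []         = _ ∣0
gcdL-greatest (x ∷ μ) (d∣x ∷ d∣μ) = gcd-greatest d∣x (gcdL-greatest μ d∣μ)

∣-sum : ∀ {d} μ → All (d ∣_) μ → d ∣ sum μ
∣-sum []      []          = _ ∣0
∣-sum (x ∷ μ) (d∣x ∷ d∣μ) = ∣m∣n⇒∣m+n d∣x (∣-sum μ d∣μ)

gcdL-pos : ∀ {i} μ → μ ⊢ i → 1 ≤ i → 1 ≤ gcdL μ
gcdL-pos []      (_ , refl)     ()
gcdL-pos (x ∷ μ) (1≤x ∷ _ , _) _ = ℕ.n≢0⇒n>0 (λ g≡0 → ℕ.<-irrefl (sym (gcd[m,n]≡0⇒m≡0 g≡0)) 1≤x)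

sum-map-* : ∀ k ν → sum (map (k ℕ.*_) ν) ≡ k ℕ.* sum ν
sum-map-* k []      = sym (ℕ.*-zeroʳ k)
sum-map-* k (x ∷ ν) = trans (cong (k ℕ.* x ℕ.+_) (sum-map-* k ν)) (sym (ℕ.*-distribˡ-+ k x (sum ν)))

module _ (j : ℕ) where

  private
    k = suc j

  map-/-map-* : ∀ m → map (ℕ._/ k) (map (k ℕ.*_) m) ≡ m
  map-/-map-* []      = refl
  map-/-map-* (x ∷ m) = cong₂ _∷_ (trans (cong (ℕ._/ k) (ℕ.*-comm k x)) (m*n/n≡m x k)) (map-/-map-* m)

  map-*-map-/ : ∀ μ → All (k ∣_) μ → map (k ℕ.*_) (map (ℕ._/ k) μ) ≡ μ
  map-*-map-/ []      []          = refl
  map-*-map-/ (x ∷ μ) (k∣x ∷ k∣μ) = cong₂ _∷_ (m*[n/m]≡n k∣x) (map-*-map-/ μ k∣μ)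

  All-∣-map-* : ∀ m → All (k ∣_) (map (k ℕ.*_) m)
  All-∣-map-* []      = []
  All-∣-map-* (x ∷ m) = m∣m*n x ∷ All-∣-map-* m

  coeff-adams : ∀ f μ → coeff (adams k f) μ ≡ when (All.all? (k ∣?_) μ) (coeff f (map (ℕ._/ k) μ))
  coeff-adams f μ = begin
    coeff (adams k f) μ                                                   ≡⟨ coeff-∑ (adams k f) μ ⟩
    ∑ (adams k f) (coeffₜ μ)                                              ≡⟨ ∑-map _ f (coeffₜ μ) ⟩
    ∑[ t ∈ f ] when (map (k ℕ.*_) (proj₂ t) ↭? μ) (proj₁ t)               ≡⟨ ∑-cong f (λ t → term t (All.all? (k ∣?_) μ)) ⟩
    ∑[ t ∈ f ] when (All.all? (k ∣?_) μ) (coeffₜ (map (ℕ._/ k) μ) t)      ≡⟨ ∑-when f (All.all? (k ∣?_) μ) _ ⟩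
    when (All.all? (k ∣?_) μ) (∑ f (coeffₜ (map (ℕ._/ k) μ)))             ≡⟨ cong (when (All.all? (k ∣?_) μ)) (coeff-∑ f _) ⟨
    when (All.all? (k ∣?_) μ) (coeff f (map (ℕ._/ k) μ))                  ∎
    where
    open ≡-Reasoning
    ν = map (ℕ._/ k) μ
    term : ∀ t → Dec (All (k ∣_) μ) →
           when (map (k ℕ.*_) (proj₂ t) ↭? μ) (proj₁ t) ≡ when (All.all? (k ∣?_) μ) (coeffₜ ν t)
    term (c , m) (yes k∣μ) = trans
      (when-⇔ (map (k ℕ.*_) m ↭? μ) (m ↭? ν) c
        (λ p → subst (_↭ ν) (map-/-map-* m) (↭-map⁺ (ℕ._/ k) p))
        (λ p → subst (map (k ℕ.*_) m ↭_) (map-*-map-/ μ k∣μ) (↭-map⁺ (k ℕ.*_) p)))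
      (sym (when-yes (All.all? (k ∣?_) μ) k∣μ))
    term (c , m) (no ¬k∣μ) = trans (when-no (map (k ℕ.*_) m ↭? μ) (λ p → ¬k∣μ (All-resp-↭ p (All-∣-map-* m))))
                                   (sym (when-no (All.all? (k ∣?_) μ) ¬k∣μ))

  ⊢-map-/ : ∀ {i} μ → All (k ∣_) μ → k ∣ i → (map (ℕ._/ k) μ ⊢ i ℕ./ k → μ ⊢ i) × (μ ⊢ i → map (ℕ._/ k) μ ⊢ i ℕ./ k)
  ⊢-map-/ {i} μ k∣μ k∣i = to , from
    where
    ν = map (ℕ._/ k) μ
    μ≡kν : map (k ℕ.*_) ν ≡ μ
    μ≡kν = map-*-map-/ μ k∣μ
    to : ν ⊢ i ℕ./ k → μ ⊢ i
    to (ν≥1 , Σν≡q) = subst (All (1 ≤_)) μ≡kν (Allₚ.map⁺ (All.map (ℕ.*-mono-≤ {1} {k} (s≤s z≤n)) ν≥1))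
                    , trans (cong sum (sym μ≡kν)) (trans (sum-map-* k ν) (trans (cong (k ℕ.*_) Σν≡q) (m*[n/m]≡n k∣i)))
    from : μ ⊢ i → ν ⊢ i ℕ./ k
    from (μ≥1 , Σμ≡i) = parts≥1 μ μ≥1 k∣μ
                      , ℕ.*-cancelˡ-≡ (sum ν) (i ℕ./ k) k
                          (trans (sym (sum-map-* k ν)) (trans (cong sum μ≡kν) (trans Σμ≡i (sym (m*[n/m]≡n k∣i)))))
      where
      parts≥1 : ∀ μ → All (1 ≤_) μ → All (k ∣_) μ → All (1 ≤_) (map (ℕ._/ k) μ)
      parts≥1 []      []          []          = []
      parts≥1 (x ∷ μ) (1≤x ∷ μ≥1) (k∣x ∷ k∣μ) =
        ℕ.n≢0⇒n>0 (λ x/k≡0 → ℕ.<-irrefl (sym (trans (sym (m*[n/m]≡n k∣x)) (trans (cong (k ℕ.*_) x/k≡0) (ℕ.*-zeroʳ k)))) 1≤x)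
          ∷ parts≥1 μ μ≥1 k∣μ

private
  Ω₀g-pos : ∀ q → 1 ≤ q → Ω₀g q ≡ h q
  Ω₀g-pos (suc q) _ = refl

  inverse-k*z : ∀ k x ν → 1 ≤ k → All (1 ≤_) (x ∷ ν) →
                divℕ 1 k * divℕ 1 (z (x ∷ ν)) ≡ divℕ (k ^ length ν) (z (map (k ℕ.*_) (x ∷ ν)))
  inverse-k*z k x ν 1≤k xν≥1 = begin
    divℕ 1 k * divℕ 1 (z (x ∷ ν))                   ≡⟨ divℕ-* 1 1 1≤k (z-pos (x ∷ ν)) ⟩
    divℕ (1 ℕ.* 1) (k ℕ.* z (x ∷ ν))                ≡⟨ divℕ-cong (1 ℕ.* 1) (k ^ length ν) (ℕ.*-mono-≤ 1≤k (z-pos (x ∷ ν)))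
                                                           (ℕ.*-mono-≤ (ℕ.m^n>0 k {{ℕ.>-nonZero 1≤k}} (suc (length ν))) (z-pos (x ∷ ν))) cross ⟩
    divℕ (k ^ length ν) (k ^ length (x ∷ ν) ℕ.* z (x ∷ ν))
                                                    ≡⟨ cong (divℕ (k ^ length ν)) (z-map k (x ∷ ν) 1≤k xν≥1) ⟨
    divℕ (k ^ length ν) (z (map (k ℕ.*_) (x ∷ ν)))   ∎
    where
    open ≡-Reasoning
    cross : 1 ℕ.* 1 ℕ.* (k ^ suc (length ν) ℕ.* z (x ∷ ν)) ≡ k ^ length ν ℕ.* (k ℕ.* z (x ∷ ν))
    cross = solve 3 (λ K P Z → con 1 :* con 1 :* (K :* P :* Z) := P :* (K :* Z)) refl k (k ^ length ν) (z (x ∷ ν))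
      where
      open ℕ-Solver

coeff-pS-Ω₀ : ∀ j i μ → 1 ≤ i →
              divℕ 1 (suc j) * coeff (pS (suc j) Ω₀g i) μ ≡
              when (μ ⊢? i) (when (suc j ∣? gcdL μ) (divℕ (suc j ^ (length μ ∸ 1)) (z μ)))
coeff-pS-Ω₀ j i μ 1≤i with suc j ∣? i
... | no k∤i = trans (ℚ.*-zeroʳ (divℕ 1 (suc j)))
  (sym (when²-no (μ ⊢? i) (suc j ∣? gcdL μ) _ λ (_ , Σμ≡i) k∣g → k∤i (subst (suc j ∣_) Σμ≡i (∣-sum μ (All.map (∣-trans k∣g) (gcdL-∣ μ))))))
... | yes k∣i = begin
  divℕ 1 k * coeff (adams k (Ω₀g q)) μ                         ≡⟨ cong (λ f → divℕ 1 k * coeff (adams k f) μ) (Ω₀g-pos q q≥1) ⟩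
  divℕ 1 k * coeff (adams k (h q)) μ                           ≡⟨ cong (divℕ 1 k *_) (coeff-adams j (h q) μ) ⟩
  divℕ 1 k * when (All.all? (k ∣?_) μ) (coeff (h q) ν)         ≡⟨ by-divisibility (All.all? (k ∣?_) μ) ⟩
  when (μ ⊢? i) (when (k ∣? gcdL μ) (divℕ (k ^ (length μ ∸ 1)) (z μ))) ∎
  where
  open ≡-Reasoning
  k = suc j
  q = i ℕ./ k
  ν = map (ℕ._/ k) μ
  q≥1 : 1 ≤ q
  q≥1 = ℕ.n≢0⇒n>0 (λ q≡0 → ℕ.<-irrefl (sym (trans (sym (m*[n/m]≡n k∣i)) (trans (cong (k ℕ.*_) q≡0) (ℕ.*-zeroʳ k)))) 1≤i)
  value : All (k ∣_) μ → μ ⊢ i → divℕ 1 k * divℕ 1 (z ν) ≡ divℕ (k ^ (length μ ∸ 1)) (z μ)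
  value k∣μ μ⊢i = subst (λ μ′ → divℕ 1 k * divℕ 1 (z ν) ≡ divℕ (k ^ (length μ′ ∸ 1)) (z μ′))
                        (map-*-map-/ j μ k∣μ) (scaled ν (proj₂ (⊢-map-/ j μ k∣μ k∣i) μ⊢i))
    where
    scaled : ∀ ν → ν ⊢ q → divℕ 1 k * divℕ 1 (z ν) ≡ divℕ (k ^ (length (map (k ℕ.*_) ν) ∸ 1)) (z (map (k ℕ.*_) ν))
    scaled []      (_ , Σ≡q)   = ⊥-elim (ℕ.<-irrefl Σ≡q q≥1)
    scaled (x ∷ ν) (xν≥1 , _) rewrite length-map (k ℕ.*_) ν = inverse-k*z k x ν (s≤s z≤n) xν≥1
  by-divisibility : Dec (All (k ∣_) μ) → divℕ 1 k * when (All.all? (k ∣?_) μ) (coeff (h q) ν) ≡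
                                         when (μ ⊢? i) (when (k ∣? gcdL μ) (divℕ (k ^ (length μ ∸ 1)) (z μ)))
  by-divisibility (no ¬k∣μ) = begin
    divℕ 1 k * when (All.all? (k ∣?_) μ) (coeff (h q) ν)   ≡⟨ cong (divℕ 1 k *_) (when-no (All.all? (k ∣?_) μ) ¬k∣μ) ⟩
    divℕ 1 k * 0ℚ                                          ≡⟨ ℚ.*-zeroʳ (divℕ 1 k) ⟩
    0ℚ                                                     ≡⟨ when²-no (μ ⊢? i) (k ∣? gcdL μ) _ (λ _ k∣g → ¬k∣μ (All.map (∣-trans k∣g) (gcdL-∣ μ))) ⟨
    when (μ ⊢? i) (when (k ∣? gcdL μ) (divℕ (k ^ (length μ ∸ 1)) (z μ))) ∎
  by-divisibility (yes k∣μ) = begin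
    divℕ 1 k * when (All.all? (k ∣?_) μ) (coeff (h q) ν)   ≡⟨ cong (divℕ 1 k *_) (trans (when-yes (All.all? (k ∣?_) μ) k∣μ) (coeff-h q ν)) ⟩
    divℕ 1 k * when (ν ⊢? q) (divℕ 1 (z ν))                ≡⟨ *-when (ν ⊢? q) (divℕ 1 k) _ ⟩
    when (ν ⊢? q) (divℕ 1 k * divℕ 1 (z ν))                ≡⟨ when-⇔ (ν ⊢? q) (μ ⊢? i) _ (proj₁ (⊢-map-/ j μ k∣μ k∣i)) (proj₂ (⊢-map-/ j μ k∣μ k∣i)) ⟩
    when (μ ⊢? i) (divℕ 1 k * divℕ 1 (z ν))                ≡⟨ when-cong (μ ⊢? i) (value k∣μ) ⟩
    when (μ ⊢? i) (divℕ (k ^ (length μ ∸ 1)) (z μ))        ≡⟨ cong (when (μ ⊢? i)) (when-yes (k ∣? gcdL μ) (gcdL-greatest μ k∣μ)) ⟨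
    when (μ ⊢? i) (when (k ∣? gcdL μ) (divℕ (k ^ (length μ ∸ 1)) (z μ))) ∎

∑-pS-Ω₀ : ∀ M i μ → 1 ≤ i → i ≤ M → ∑[ k ∈ upTo (suc M) ] (divℕ 1 k * coeff (pS k Ω₀g i) μ) ≡ coeff (H i) μ
∑-pS-Ω₀ M i μ 1≤i i≤M = begin
  ∑[ k ∈ upTo (suc M) ] (divℕ 1 k * coeff (pS k Ω₀g i) μ)
    ≡⟨ ∑-upTo-sucˡ M (λ k → divℕ 1 k * coeff (pS k Ω₀g i) μ) ⟩
  0ℚ * 0ℚ + ∑[ j ∈ upTo M ] (divℕ 1 (suc j) * coeff (pS (suc j) Ω₀g i) μ)
    ≡⟨ cong₂ _+_ (ℚ.*-zeroˡ 0ℚ) (∑-cong (upTo M) (λ j → coeff-pS-Ω₀ j i μ 1≤i)) ⟩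
  0ℚ + ∑[ j ∈ upTo M ] when (μ ⊢? i) (when (suc j ∣? g) (F (suc j)))
    ≡⟨ ℚ.+-identityˡ _ ⟩
  ∑[ j ∈ upTo M ] when (μ ⊢? i) (when (suc j ∣? g) (F (suc j)))
    ≡⟨ ∑-when (upTo M) (μ ⊢? i) _ ⟩
  when (μ ⊢? i) (∑[ j ∈ upTo M ] when (suc j ∣? g) (F (suc j)))
    ≡⟨ when-cong (μ ⊢? i) divisor-sum ⟩
  when (μ ⊢? i) (divℕ (σ r g) (z μ))
    ≡⟨ coeff-H i μ ⟨
  coeff (H i) μ ∎
  where
  open ≡-Reasoning
  g = gcdL μ
  r = length μ ∸ 1
  F : ℕ → ℚ
  F d = divℕ (d ^ r) (z μ)
  divisor-sum : μ ⊢ i → ∑[ j ∈ upTo M ] when (suc j ∣? g) (F (suc j)) ≡ divℕ (σ r g) (z μ)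
  divisor-sum μ⊢i = begin
    ∑[ j ∈ upTo M ] when (suc j ∣? g) (F (suc j))      ≡⟨ ∑-upTo-truncate g M _ g≤M
                                                            (λ j g≤j _ → when-no (suc j ∣? g) (λ j+1∣g → ℕ.<⇒≱ (s≤s g≤j) (∣⇒≤ {{g≢0}} j+1∣g))) ⟩
    ∑[ j ∈ upTo g ] when (suc j ∣? g) (F (suc j))      ≡⟨ ∑-applyUpTo-suc g (λ d → when (d ∣? g) (F d)) ⟨
    ∑[ d ∈ applyUpTo suc g ] when (d ∣? g) (F d)       ≡⟨ ∑-filter (_∣? g) (applyUpTo suc g) F ⟨
    ∑ (filter (_∣? g) (applyUpTo suc g)) F             ≡⟨ divℕ-sum (_^ r) (filter (_∣? g) (applyUpTo suc g)) (z-pos μ) ⟨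
    divℕ (σ r g) (z μ)                                 ∎
    where
    g≥1 = gcdL-pos μ μ⊢i 1≤i
    g≢0 = ℕ.>-nonZero g≥1
    g≤M : g ≤ M
    g≤M = ℕ.≤-trans (∣⇒≤ {{ℕ.>-nonZero 1≤i}} (subst (g ∣_) (proj₂ μ⊢i) (∣-sum μ (gcdL-∣ μ)))) i≤M

pS-cong : ∀ k {S T} → S ≈ˢ T → pS k S ≈ˢ pS k T
pS-cong zero    _          = ≈ˢ-refl
pS-cong (suc j) {S} {T} S≈T = mk≈ˢ at
  where
  at : ∀ N → pS (suc j) S N ≈ pS (suc j) T N
  at N with suc j ∣? N
  ... | yes _ = mk≈ λ μ → trans (coeff-adams j (S (N ℕ./ suc j)) μ)
                  (trans (cong (when (All.all? (suc j ∣?_) μ)) (≈⇒≈ᴾ (≈ˢ-at S≈T (N ℕ./ suc j)) (map (ℕ._/ suc j) μ)))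
                         (sym (coeff-adams j (T (N ℕ./ suc j)) μ)))
  ... | no _  = ≈-refl

pS-Ω₀-vanishes : ∀ k i → i < k → pS k Ω₀g i ≈ 0ᴾ
pS-Ω₀-vanishes (suc j) i       i<k with suc j ∣? i
... | no _ = ≈-refl
pS-Ω₀-vanishes (suc j) zero    _   | yes _ = ≈-refl
pS-Ω₀-vanishes (suc j) (suc i) i<k | yes k∣i = ⊥-elim (ℕ.<⇒≱ i<k (∣⇒≤ k∣i))

-- The logarithmic derivative of B

-- From here on A = Ω₀(tX), so that B = Ω(A).

open Substitution (pleth Ω₀g tX)

P-vanishes : ∀ k i → i < k → P k i ≈ 0ᴾ
P-vanishes k i i<k = ≈-trans (≈ˢ-at (pS-cong k Ω₀[tX]≈Ω₀) i) (pS-Ω₀-vanishes k i i<k)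

Π-vanishes : ∀ m N → N < sum m → Π m N ≈ 0ᴾ
Π-vanishes []      N ()
Π-vanishes (a ∷ m) N N<Σ = sumᴾ-upTo-zero (suc N) term
  where
  term : ∀ i → i < suc N → P a i *ᴾ Π m (N ∸ i) ≈ 0ᴾ
  term i i<1+N = by-cases (i <? a)
    where
    by-cases : Dec (i < a) → P a i *ᴾ Π m (N ∸ i) ≈ 0ᴾ
    by-cases (yes i<a) = *ᴾ-congʳ (Π m (N ∸ i)) (P-vanishes a i i<a)
    by-cases (no i≮a)  = ≈-trans (*ᴾ-congˡ (P a i) (Π-vanishes m (N ∸ i) N-i<Σm)) (≈-reflexive (*ᴾ-zeroʳ (P a i)))
      where
      N-i<Σm : N ∸ i < sum m
      N-i<Σm = ℕ.+-cancelˡ-< i (N ∸ i) (sum m)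
                 (ℕ.<-≤-trans (subst (_< a ℕ.+ sum m) (sym (ℕ.m+[n∸m]≡n (ℕ.≤-pred i<1+N))) N<Σ)
                              (ℕ.+-monoˡ-≤ (sum m) (ℕ.≮⇒≥ i≮a)))

Φ-vanishes : ∀ f N → All (λ t → Π (proj₂ t) N ≈ 0ᴾ) f → Φ f N ≈ 0ᴾ
Φ-vanishes []            N []       = ≈-refl
Φ-vanishes ((c , m) ∷ f) N (z ∷ zs) = +ᴾ-cong (scale-cong c z) (Φ-vanishes f N zs)

Φ-h-vanishes : ∀ j N → N < j → Φ (h j) N ≈ 0ᴾ
Φ-h-vanishes j N N<j = Φ-vanishes (h j) N
  (All.map (λ {t} p → Π-vanishes (proj₂ t) N (subst (N <_) (sym (proj₂ (PartitionOf⇒⊢ (proj₂ t) p))) N<j)) (monomials-h j))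

Φ-Ω≤ : ∀ L N → N ≤ L → Φ (Ω≤ L) N ≈ B N
Φ-Ω≤ L N N≤L = ≈-trans (≈ˢ-at (Φ-sumᴾ h (upTo (suc L))) N)
  (sumᴾ-upTo-truncate (suc N) (suc L) (s≤s N≤L) (λ j N<j _ → Φ-h-vanishes j N N<j))

θP*Φ-Ω≤ : ∀ M k → k ≤ M → (θ (P k) *ˢ Φ (Ω≤ (M ∸ k))) M ≈ (θ (P k) *ˢ B) M
θP*Φ-Ω≤ M k k≤M = sumᴾ-upTo-cong (suc M) term
  where
  term : ∀ i → i < suc M → θ (P k) i *ᴾ Φ (Ω≤ (M ∸ k)) (M ∸ i) ≈ θ (P k) i *ᴾ B (M ∸ i)
  term i _ = by-cases (i <? k)
    where
    by-cases : Dec (i < k) → θ (P k) i *ᴾ Φ (Ω≤ (M ∸ k)) (M ∸ i) ≈ θ (P k) i *ᴾ B (M ∸ i)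
    by-cases (yes i<k) = ≈-trans (*ᴾ-congʳ _ θPk≈0) (≈-sym (*ᴾ-congʳ _ θPk≈0))
      where
      θPk≈0 : θ (P k) i ≈ 0ᴾ
      θPk≈0 = scale-cong (ι i) (P-vanishes k i i<k)
    by-cases (no i≮k)  = *ᴾ-congˡ (θ (P k) i) (Φ-Ω≤ (M ∸ k) (M ∸ i) (ℕ.∸-monoʳ-≤ M (ℕ.≮⇒≥ i≮k)))

θB≈∑θP*B : ∀ M → scale (ι M) (B M) ≈ sumᴾ (map (λ k → scale (divℕ 1 k) ((θ (P k) *ˢ B) M)) (upTo (suc M)))
θB≈∑θP*B M = begin
  scale (ι M) (B M)                                                  ≈⟨ scale-cong (ι M) (Φ-Ω≤ M M ℕ.≤-refl) ⟨
  θ (Φ (Ω≤ M)) M                                                     ≈⟨ ≈ˢ-at (θ-Φ M (Ω≤ M) (Ω≤-vars M)) M ⟩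
  sumᴾ (map (λ k → (θ (P k) *ˢ Φ (∂ k (Ω≤ M))) M) (upTo (suc M)))    ≈⟨ sumᴾ-upTo-cong (suc M) (λ k k<1+M → term k (ℕ.≤-pred k<1+M)) ⟩
  sumᴾ (map (λ k → scale (divℕ 1 k) ((θ (P k) *ˢ B) M)) (upTo (suc M))) ∎
  where
  open ≈-Reasoning
  term : ∀ k → k ≤ M → (θ (P k) *ˢ Φ (∂ k (Ω≤ M))) M ≈ scale (divℕ 1 k) ((θ (P k) *ˢ B) M)
  term k k≤M = begin
    (θ (P k) *ˢ Φ (∂ k (Ω≤ M))) M                       ≈⟨ ≈ˢ-at (*ˢ-cong (≈ˢ-refl {θ (P k)}) (Φ-cong (∂-Ω≤ M k k≤M))) M ⟩
    (θ (P k) *ˢ Φ (scale (divℕ 1 k) (Ω≤ (M ∸ k)))) M    ≈⟨ ≈ˢ-at (*ˢ-cong (≈ˢ-refl {θ (P k)}) (Φ-scale (divℕ 1 k) (Ω≤ (M ∸ k)))) M ⟩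
    (θ (P k) *ˢ scaleˢ (divℕ 1 k) (Φ (Ω≤ (M ∸ k)))) M   ≈⟨ ≈ˢ-at (*ˢ-scaleˢ (divℕ 1 k) (θ (P k)) (Φ (Ω≤ (M ∸ k)))) M ⟩
    scale (divℕ 1 k) ((θ (P k) *ˢ Φ (Ω≤ (M ∸ k))) M)    ≈⟨ scale-cong (divℕ 1 k) (θP*Φ-Ω≤ M k k≤M) ⟩
    scale (divℕ 1 k) ((θ (P k) *ˢ B) M)                 ∎

∑θP≈iH : ∀ M i → i ≤ M → sumᴾ (map (λ k → scale (divℕ 1 k) (θ (P k) i)) (upTo (suc M))) ≈ scale (ι i) (H i)
∑θP≈iH M i i≤M = mk≈ λ μ → begin
  coeff (sumᴾ (map (λ k → scale (divℕ 1 k) (θ (P k) i)) (upTo (suc M)))) μ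
    ≡⟨ coeff-sumᴾ (λ k → scale (divℕ 1 k) (θ (P k) i)) (upTo (suc M)) μ ⟩
  ∑[ k ∈ upTo (suc M) ] coeff (scale (divℕ 1 k) (θ (P k) i)) μ
    ≡⟨ ∑-cong (upTo (suc M)) (λ k → term k μ) ⟩
  ∑[ k ∈ upTo (suc M) ] (ι i * (divℕ 1 k * coeff (pS k Ω₀g i) μ))
    ≡⟨ *-distribˡ-∑ (upTo (suc M)) (ι i) _ ⟨
  ι i * ∑[ k ∈ upTo (suc M) ] (divℕ 1 k * coeff (pS k Ω₀g i) μ)
    ≡⟨ by-degree i μ i≤M ⟩
  ι i * coeff (H i) μ
    ≡⟨ coeff-scale (ι i) (H i) μ ⟨
  coeff (scale (ι i) (H i)) μ ∎
  where
  open ≡-Reasoning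
  term : ∀ k μ → coeff (scale (divℕ 1 k) (θ (P k) i)) μ ≡ ι i * (divℕ 1 k * coeff (pS k Ω₀g i) μ)
  term k μ = begin
    coeff (scale (divℕ 1 k) (scale (ι i) (P k i))) μ      ≡⟨ coeff-scale (divℕ 1 k) (scale (ι i) (P k i)) μ ⟩
    divℕ 1 k * coeff (scale (ι i) (P k i)) μ              ≡⟨ cong (divℕ 1 k *_) (coeff-scale (ι i) (P k i) μ) ⟩
    divℕ 1 k * (ι i * coeff (P k i) μ)                    ≡⟨ cong (λ x → divℕ 1 k * (ι i * x)) (≈⇒≈ᴾ (≈ˢ-at (pS-cong k Ω₀[tX]≈Ω₀) i) μ) ⟩
    divℕ 1 k * (ι i * coeff (pS k Ω₀g i) μ)               ≡⟨ solve 3 (λ a b c → a :* (b :* c) := b :* (a :* c)) refl (divℕ 1 k) (ι i) _ ⟩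
    ι i * (divℕ 1 k * coeff (pS k Ω₀g i) μ)               ∎
    where
    open ℚ-Solver
  by-degree : ∀ j μ → j ≤ M → ι j * ∑[ k ∈ upTo (suc M) ] (divℕ 1 k * coeff (pS k Ω₀g j) μ) ≡ ι j * coeff (H j) μ
  by-degree zero    μ _   = trans (ℚ.*-zeroˡ (∑[ k ∈ upTo (suc M) ] (divℕ 1 k * coeff (pS k Ω₀g 0) μ))) (sym (ℚ.*-zeroˡ (coeff (H 0) μ)))
  by-degree (suc j) μ j<M = cong (ι (suc j) *_) (∑-pS-Ω₀ M (suc j) μ (s≤s z≤n) j<M)

θB≈∑iH*B : ∀ M → scale (ι M) (B M) ≈ sumᴾ (map (λ i → scale (ι i) (H i) *ᴾ B (M ∸ i)) (upTo (suc M)))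
θB≈∑iH*B M = begin
  scale (ι M) (B M)
    ≈⟨ θB≈∑θP*B M ⟩
  sumᴾ (map (λ k → scale (divℕ 1 k) ((θ (P k) *ˢ B) M)) ks)
    ≈⟨ sumᴾ-cong ks (λ k → scale-sumᴾ (divℕ 1 k) ks (λ i → θ (P k) i *ᴾ B (M ∸ i))) ⟩
  sumᴾ (map (λ k → sumᴾ (map (λ i → scale (divℕ 1 k) (θ (P k) i *ᴾ B (M ∸ i))) ks)) ks)
    ≈⟨ sumᴾ-comm ks ks (λ k i → scale (divℕ 1 k) (θ (P k) i *ᴾ B (M ∸ i))) ⟩
  sumᴾ (map (λ i → sumᴾ (map (λ k → scale (divℕ 1 k) (θ (P k) i *ᴾ B (M ∸ i))) ks)) ks)
    ≈⟨ sumᴾ-cong ks (λ i → sumᴾ-cong ks (λ k → ≈-sym (scale-*ᴾˡ (divℕ 1 k) (θ (P k) i) (B (M ∸ i))))) ⟩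
  sumᴾ (map (λ i → sumᴾ (map (λ k → scale (divℕ 1 k) (θ (P k) i) *ᴾ B (M ∸ i)) ks)) ks)
    ≈⟨ sumᴾ-cong ks (λ i → ≈-reflexive (sym (*ᴾ-distribʳ-sumᴾ ks (λ k → scale (divℕ 1 k) (θ (P k) i)) (B (M ∸ i))))) ⟩
  sumᴾ (map (λ i → sumᴾ (map (λ k → scale (divℕ 1 k) (θ (P k) i)) ks) *ᴾ B (M ∸ i)) ks)
    ≈⟨ sumᴾ-upTo-cong (suc M) (λ i i<1+M → *ᴾ-congʳ (B (M ∸ i)) (∑θP≈iH M i (ℕ.≤-pred i<1+M))) ⟩
  sumᴾ (map (λ i → scale (ι i) (H i) *ᴾ B (M ∸ i)) ks) ∎
  where
  open ≈-Reasoning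
  ks = upTo (suc M)

B-recurrence : ∀ n → B (suc n) ≈ sumᴾ (map (λ i → scale (divℕ i (suc n)) (H i *ᴾ B (suc n ∸ i))) (upTo (suc (suc n))))
B-recurrence n = begin
  B M                                                                             ≈⟨ scale-identity (B M) ⟨
  scale 1ℚ (B M)                                                                  ≡⟨ cong (λ c → scale c (B M)) (trans (sym (divℕ-self n)) (sym (1/M*ι M))) ⟩
  scale (divℕ 1 M * ι M) (B M)                                                    ≈⟨ scale-scale (divℕ 1 M) (ι M) (B M) ⟨
  scale (divℕ 1 M) (scale (ι M) (B M))                                            ≈⟨ scale-cong (divℕ 1 M) (θB≈∑iH*B M) ⟩
  scale (divℕ 1 M) (sumᴾ (map (λ i → scale (ι i) (H i) *ᴾ B (M ∸ i)) (upTo (suc M))))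
                                                                                  ≈⟨ scale-sumᴾ (divℕ 1 M) (upTo (suc M)) (λ i → scale (ι i) (H i) *ᴾ B (M ∸ i)) ⟩
  sumᴾ (map (λ i → scale (divℕ 1 M) (scale (ι i) (H i) *ᴾ B (M ∸ i))) (upTo (suc M)))
                                                                                  ≈⟨ sumᴾ-cong (upTo (suc M)) term ⟩
  sumᴾ (map (λ i → scale (divℕ i M) (H i *ᴾ B (M ∸ i))) (upTo (suc M)))          ∎
  where
  open ≈-Reasoning
  M = suc n
  1/M*ι : ∀ i → divℕ 1 M * ι i ≡ divℕ i M
  1/M*ι i = trans (divℕ-* 1 i {M} {1} (s≤s z≤n) (s≤s z≤n))
                  (divℕ-cong (1 ℕ.* i) i {M ℕ.* 1} {M} (ℕ.*-mono-≤ {1} {M} (s≤s z≤n) (s≤s z≤n)) (s≤s z≤n)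
                     (solve 2 (λ i n → con 1 :* i :* (con 1 :+ n) := i :* ((con 1 :+ n) :* con 1)) refl i n))
    where
    open ℕ-Solver
  term : ∀ i → scale (divℕ 1 M) (scale (ι i) (H i) *ᴾ B (M ∸ i)) ≈ scale (divℕ i M) (H i *ᴾ B (M ∸ i))
  term i = begin
    scale (divℕ 1 M) (scale (ι i) (H i) *ᴾ B (M ∸ i))   ≈⟨ scale-cong (divℕ 1 M) (scale-*ᴾˡ (ι i) (H i) (B (M ∸ i))) ⟩
    scale (divℕ 1 M) (scale (ι i) (H i *ᴾ B (M ∸ i)))   ≈⟨ scale-scale (divℕ 1 M) (ι i) _ ⟩
    scale (divℕ 1 M * ι i) (H i *ᴾ B (M ∸ i))           ≡⟨ cong (λ c → scale c (H i *ᴾ B (M ∸ i))) (1/M*ι i) ⟩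
    scale (divℕ i M) (H i *ᴾ B (M ∸ i))                 ∎

mainTheorem12 : (n : ℕ) →
    B (suc n) ≈ᴾ
      sumᴾ (map (λ k → scale (divℕ (suc (n ∸ k)) (suc n)) (H (suc (n ∸ k)) *ᴾ B k))
                (upTo (suc n)))
mainTheorem12 n = ≈⇒≈ᴾ (begin
  B (suc n)                                                                          ≈⟨ B-recurrence n ⟩
  sumᴾ (map (λ i → scale (divℕ i (suc n)) (H i *ᴾ B (suc n ∸ i))) (upTo (suc (suc n))))
                                                                                     ≈⟨ sumᴾ-upTo-sucˡ (suc n) {λ i → scale (divℕ i (suc n)) (H i *ᴾ B (suc n ∸ i))}
                                                                                          (≈-trans (≈-reflexive (cong (λ c → scale c (H 0 *ᴾ B (suc n))) (divℕ-zero (suc n))))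
                                                                                                   (scale-zero (H 0 *ᴾ B (suc n)))) ⟩
  sumᴾ (map (λ i → scale (divℕ (suc i) (suc n)) (H (suc i) *ᴾ B (n ∸ i))) (upTo (suc n)))
                                                                                     ≈⟨ sumᴾ-upTo-reverse (suc n) (λ i → scale (divℕ (suc i) (suc n)) (H (suc i) *ᴾ B (n ∸ i))) ⟩
  sumᴾ (map (λ k → scale (divℕ (suc (n ∸ k)) (suc n)) (H (suc (n ∸ k)) *ᴾ B (n ∸ (n ∸ k)))) (upTo (suc n)))
                                                                                     ≈⟨ sumᴾ-upTo-cong (suc n) (λ k k≤n → ≈-reflexive
                                                                                          (cong (λ j → scale (divℕ (suc (n ∸ k)) (suc n)) (H (suc (n ∸ k)) *ᴾ B j)) (ℕ.m∸[m∸n]≡n (ℕ.≤-pred k≤n)))) ⟩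
  sumᴾ (map (λ k → scale (divℕ (suc (n ∸ k)) (suc n)) (H (suc (n ∸ k)) *ᴾ B k)) (upTo (suc n))) ∎)
  where
  open ≈-Reasoning
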